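{- Let $n\ge 2$ and let $s_1,\ldots,s_{n-1}$ be the roots (with multiplicity) of $f'(x)$, where $f(x)=\sum_{i=0}^n a_ix^i$. Then \[DD_{n,0}=\operatorname{disc}_{a_0}(\operatorname{disc}_x f)=n^{2n(n-2)}a_n^{2(n-1)(n-2)}\prod_{1\le i<j\le n-1}\big(f(s_i)-f(s_j)\big)^2.\]
   Context: Here $a_0,\ldots,a_n$ are independent indeterminates and $s_1,\ldots,s_{n-1}$ lie in an algebraic closure of $\mathbb{Q}(a_0,\ldots,a_n)$. $D_n=\operatorname{disc}_x f\in\mathbb{Z}[a_0,\ldots,a_n]$ is normalized so that for $f=a_n\prod_{i=1}^n(x-r_i)$, $D_n=a_n^{2n-2}\prod_{i<j}(r_i-r_j)^2$. $DD_{n,0}=\operatorname{disc}_{a_0}(D_n)\in\mathbb{Z}[a_1,\ldots,a_n]$ is the discriminant of $D_n$ regarded as a polynomial in $a_0$ (of degree $n-1$), with the normalization $\operatorname{disc} g=c^{2d-2}\prod_{i<j}(\rho_i-\rho_j)^2$ for $g$ of degree $d$, leading coefficient $c$, roots $\rho_i$. -}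

module Defs where

open import Data.Nat using (ℕ; zero; suc; _∸_; _≤ᵇ_; ⌊_/2⌋) renaming (_+_ to _+ℕ_; _*_ to _*ℕ_)
open import Data.Bool using (Bool; true; false; _∧_; if_then_else_)
open import Data.Fin using (Fin; toℕ) renaming (zero to fz; suc to fs)
open import Data.List using (List; []; _∷_; map)
open import Data.Vec using (Vec; toList)
open import Data.Product using (∃)
open import Relation.Nullary using (¬_)
open import Algebra.Bundles using (CommutativeRing)
open import Level using (_⊔_)

-- Raw ring operations (no laws needed for the *definitions* below).

record Ops {a} (A : Set a) : Set a where
  field
    add  : A → A → A
    mul  : A → A → A
    neg  : A → A
    zer  : A
    one  : A

module OpsTools {a} {A : Set a} (O : Ops A) where
  open Ops O

  nat· : ℕ → A → A
  nat· zero    x = zer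
  nat· (suc k) x = add x (nat· k x)

  pow : A → ℕ → A
  pow x zero    = one
  pow x (suc k) = mul x (pow x k)

  negOnePow : ℕ → A
  negOnePow zero    = one
  negOnePow (suc k) = neg (negOnePow k)

  sub : A → A → A
  sub x y = add x (neg y)

  -- coefficient k of a coefficient list (lowest degree first), 0 beyond
  coeffL : List A → ℕ → A
  coeffL []       _       = zer
  coeffL (c ∷ cs) zero    = c
  coeffL (c ∷ cs) (suc k) = coeffL cs k

  sumFin : (n : ℕ) → (Fin n → A) → A
  sumFin zero    g = zer
  sumFin (suc n) g = add (g fz) (sumFin n (λ i → g (fs i)))

  punchOut' : {n : ℕ} → Fin (suc n) → Fin n → Fin (suc n)
  punchOut' fz     k      = fs k
  punchOut' (fs j) fz     = fz
  punchOut' (fs j) (fs k) = fs (punchOut' j k)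

  det : (n : ℕ) → (Fin n → Fin n → A) → A
  det zero    M = one
  det (suc n) M =
    sumFin (suc n) (λ j →
      mul (negOnePow (toℕ j))
          (mul (M fz j) (det n (λ r c → M (fs r) (punchOut' j c)))))

  -- entry of a band row of the Sylvester matrix: the row r contains the
  -- coefficients p m, p (m-1), …, p 0 of a polynomial of formal degree m,
  -- starting in column r.
  band : ℕ → (ℕ → A) → ℕ → ℕ → A
  band m p r col =
    if (r ≤ᵇ col) ∧ (col ≤ᵇ r +ℕ m) then p ((m +ℕ r) ∸ col) else zer

  -- Sylvester matrix of p (formal degree m) and q (formal degree k):
  -- k rows built from p followed by m rows built from q.
  sylvester : (m k : ℕ) → (ℕ → A) → (ℕ → A) → Fin (m +ℕ k) → Fin (m +ℕ k) → A
  sylvester m k p q r c =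
    if suc (toℕ r) ≤ᵇ k
      then band m p (toℕ r) (toℕ c)
      else band k q (toℕ r ∸ k) (toℕ c)

  resultant : (m k : ℕ) → (ℕ → A) → (ℕ → A) → A
  resultant m k p q = det (m +ℕ k) (sylvester m k p q)

  deriv : (ℕ → A) → ℕ → A
  deriv g i = nat· (suc i) (g (suc i))

  -- Discriminant of g of formal degree d with leading coefficient c = g d:
  --   disc g = (-1)^(d(d-1)/2) · Res(g, g') / c
  --          (= c^(2d-2) ∏_{i<j} (ρ_i - ρ_j)^2).
  -- The exact division by c is carried out division-free: in Syl(g,g')
  -- the first column is c (row 0) and d·c (row d-1), zero elsewhere;
  -- subtracting d·(row 0) from row d-1 does not change the determinant
  -- and leaves c as the only entry of column 0, so Res(g,g')/c is the
  -- determinant of the (0,0)-minor of the modified matrix.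
  -- Degree 1: disc = 1 (empty product).
  disc : (d : ℕ) → (ℕ → A) → A
  disc zero          g = one
  disc (suc zero)    g = one
  disc (suc (suc e)) g =
    mul (negOnePow ⌊ (d *ℕ (d ∸ 1)) /2⌋)
        (det (suc e +ℕ suc e) (λ r c → S' (fs r) (fs c)))
    where
      d = suc (suc e)
      S : Fin (d +ℕ suc e) → Fin (d +ℕ suc e) → A
      S = sylvester d (suc e) g (deriv g)
      S' : Fin (d +ℕ suc e) → Fin (d +ℕ suc e) → A
      S' r c = if toℕ r ≤ᵇ suc e then
                 (if suc e ≤ᵇ toℕ r
                    then sub (S r c) (nat· d (S fz c))   -- row d-1 = suc e
                    else S r c)
               else S r c

  evalL : List A → A → A
  evalL []       x = zer
  evalL (c ∷ cs) x = add c (mul x (evalL cs x))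

module PolyOps {a} {A : Set a} (O : Ops A) where
  open Ops O

  padd : List A → List A → List A
  padd []       q        = q
  padd (p ∷ ps) []       = p ∷ ps
  padd (p ∷ ps) (q ∷ qs) = add p q ∷ padd ps qs

  pmul : List A → List A → List A
  pmul []       q = []
  pmul (c ∷ cs) q = padd (map (mul c) q) (zer ∷ pmul cs q)

  polyOps : Ops (List A)
  polyOps = record
    { add = padd ; mul = pmul ; neg = map neg
    ; zer = [] ; one = one ∷ [] }

module Lemma46 {c ℓ} (R : CommutativeRing c ℓ) where
  open CommutativeRing R

  opsR : Ops Carrier
  opsR = record { add = _+_ ; mul = _*_ ; neg = -_ ; zer = 0# ; one = 1# }

  open OpsTools opsR public
  open PolyOps opsR public

  module P = OpsTools polyOps

  IsField : Set (c ⊔ ℓ)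
  IsField = ∀ x → ¬ (x ≈ 0#) → ∃ λ y → x * y ≈ 1#

  CharZero : Set ℓ
  CharZero = ∀ k → ¬ (nat· (suc k) 1# ≈ 0#)

  -- f(x) = Σ_{i=0}^n a_i x^i, given by a = (a_0, …, a_n).
  fCoeff : {n : ℕ} → Vec Carrier (suc n) → ℕ → Carrier
  fCoeff a = coeffL (toList a)

  fEval : {n : ℕ} → Vec Carrier (suc n) → Carrier → Carrier
  fEval a x = evalL (toList a) x

  -- f viewed with a_0 as a variable: coefficients of f in x are
  -- polynomials in a_0 (coefficient lists over R):
  -- x^0 ↦ a_0 (the variable), x^i ↦ the constant a_i (i ≥ 1).
  fCoeffA0 : {n : ℕ} → Vec Carrier (suc n) → ℕ → List Carrier
  fCoeffA0 a zero    = 0# ∷ 1# ∷ []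
  fCoeffA0 a (suc i) = fCoeff a (suc i) ∷ []

  D : (n : ℕ) → Vec Carrier (suc n) → List Carrier
  D n a = P.disc n (fCoeffA0 a)

  -- DD_{n,0} = disc_{a_0}(D_n), D_n of formal degree n-1 in a_0
  DD0 : (n : ℕ) → Vec Carrier (suc n) → Carrier
  DD0 n a = disc (n ∸ 1) (coeffL (D n a))

  rootPoly : List Carrier → List Carrier
  rootPoly []       = 1# ∷ []
  rootPoly (t ∷ ts) = pmul (- t ∷ 1# ∷ []) (rootPoly ts)

  pairProd : (Carrier → Carrier) → List Carrier → Carrier
  pairProd F []       = 1#
  pairProd F (t ∷ ts) = go ts * pairProd F ts
    where
      go : List Carrier → Carrier
      go []       = 1#
      go (u ∷ us) = (sub (F t) (F u) * sub (F t) (F u)) * go us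

-- Regard D = disc_x f as a polynomial in a₀.  The derivative f′ = n aₙ ∏ (x - sⱼ) does
-- not involve a₀, so the Poisson formula for the resultant gives
--   D = ± Res(f, f′) / aₙ = ± nⁿ aₙⁿ⁻¹ ∏ⱼ f(sⱼ) = C ∏ⱼ (a₀ - ρⱼ),   ρⱼ = a₀ - f(sⱼ),
-- where C and the ρⱼ do not depend on a₀.  The discriminant of the degree n - 1
-- polynomial C ∏ⱼ (a₀ - ρⱼ) is C^(2n-4) ∏_{i<j} (ρᵢ - ρⱼ)², and ρᵢ - ρⱼ = f(sⱼ) - f(sᵢ).
-- Both discriminants divide a Sylvester determinant by a leading coefficient that may
-- vanish; the division is done over R[X] with that coefficient replaced by X, which is
-- specialised afterwards.  The Poisson formula is proved by row and column operations
-- on the Sylvester matrix that split off one root at a time.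
module Submission where

open import Defs
open import Data.Nat using (ℕ; zero; suc; _∸_; _≤_; _<_; s≤s) renaming (_*_ to _*ℕ_)
open import Data.Vec using (Vec; lookup; toList; _∷_; [])
open import Data.Fin using (fromℕ)
open import Algebra.Bundles using (CommutativeRing)

module RingSolver {c ℓ} (R : CommutativeRing c ℓ) where
  open CommutativeRing R public hiding (zero)
  open import Relation.Binary.Reasoning.Setoid setoid public
  open import Algebra.Properties.Ring ring public
    using (-‿distribˡ-*; -‿distribʳ-*; -‿involutive; -0#≈0#; -‿+-comm)
  open import Data.Nat as N using (ℕ; zero; suc)
  import Data.Nat.Properties as NP
  open import Data.Integer as Z using (ℤ; +_; -[1+_])
  import Data.Integer.Properties as ZP
  open import Data.Sign as S using (Sign)
  open import Data.Maybe using (Maybe; just; nothing)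
  open import Relation.Nullary using (yes; no)
  import Relation.Binary.PropositionalEquality as P
  open import Algebra.Properties.Monoid.Mult +-monoid using (_×_; ×-homo-+)
  open import Algebra.Properties.Semiring.Mult semiring using (×1-homo-*)
  open import Algebra.Solver.Ring.AlmostCommutativeRing
    using (AlmostCommutativeRing; _-Raw-AlmostCommutative⟶_; fromCommutativeRing)

  -- The solver runs with integer coefficients, whose equality is decidable, so that it
  -- detects cancellations such as 1 - 1 = 0.  Literals are interpreted by litℤ, which
  -- sends 1 to 1# on the nose, so that the solved equations match goals stated with 1#.
  private
    multℤ : ℤ → Carrier
    multℤ (+ n) = n × 1#
    multℤ -[1+ n ] = - (suc n × 1#)

    litℕ : ℕ → Carrier
    litℕ zero = 0#
    litℕ (suc zero) = 1#
    litℕ (suc (suc n)) = 1# + litℕ (suc n)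

    litℕ≈× : ∀ n → litℕ n ≈ n × 1#
    litℕ≈× zero = refl
    litℕ≈× (suc zero) = sym (+-identityʳ 1#)
    litℕ≈× (suc (suc n)) = +-congˡ (litℕ≈× (suc n))

    litℤ : ℤ → Carrier
    litℤ (+ n) = litℕ n
    litℤ -[1+ n ] = - litℕ (suc n)

    litℤ≈multℤ : ∀ i → litℤ i ≈ multℤ i
    litℤ≈multℤ (+ n) = litℕ≈× n
    litℤ≈multℤ -[1+ n ] = -‿cong (litℕ≈× (suc n))

    signed : Sign → Carrier → Carrier
    signed S.+ x = x
    signed S.- x = - x

    multℤ-◃ : ∀ s n → multℤ (s Z.◃ n) ≈ signed s (n × 1#)
    multℤ-◃ S.+ zero = refl
    multℤ-◃ S.+ (suc n) = refl
    multℤ-◃ S.- zero = sym -0#≈0#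
    multℤ-◃ S.- (suc n) = refl

    multℤ-signAbs : ∀ i → multℤ i ≈ signed (Z.sign i) (Z.∣ i ∣ × 1#)
    multℤ-signAbs (+ zero) = refl
    multℤ-signAbs (+ suc n) = refl
    multℤ-signAbs -[1+ n ] = refl

    signed-* : ∀ s t x y → signed (s S.* t) (x * y) ≈ signed s x * signed t y
    signed-* S.+ S.+ x y = refl
    signed-* S.+ S.- x y = -‿distribʳ-* x y
    signed-* S.- S.+ x y = -‿distribˡ-* x y
    signed-* S.- S.- x y = begin
      x * y ≈⟨ sym (-‿involutive (x * y)) ⟩
      - - (x * y) ≈⟨ -‿cong (-‿distribˡ-* x y) ⟩
      - (- x * y) ≈⟨ -‿distribʳ-* (- x) y ⟩
      - x * - y ∎

    multℤ-⊖ : ∀ m n → multℤ (m Z.⊖ n) ≈ m × 1# - n × 1#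
    multℤ-⊖ m zero = sym (trans (+-congˡ -0#≈0#) (+-identityʳ _))
    multℤ-⊖ zero (suc n) = sym (+-identityˡ _)
    multℤ-⊖ (suc m) (suc n) = begin
      multℤ (suc m Z.⊖ suc n) ≡⟨ P.cong multℤ (ZP.[1+m]⊖[1+n]≡m⊖n m n) ⟩
      multℤ (m Z.⊖ n) ≈⟨ multℤ-⊖ m n ⟩
      m × 1# - n × 1# ≈⟨ sym (+-congˡ (-‿cong (+-identityˡ _))) ⟩
      m × 1# - (0# + n × 1#) ≈⟨ sym (+-congˡ (-‿cong (+-congʳ (-‿inverseʳ 1#)))) ⟩
      m × 1# - ((1# - 1#) + n × 1#) ≈⟨ subtract-common 1# (m × 1#) (n × 1#) ⟩
      (1# + m × 1#) - (1# + n × 1#) ∎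
      where
      subtract-common : ∀ a x y → x - ((a - a) + y) ≈ (a + x) - (a + y)
      subtract-common a x y = begin
        x - ((a - a) + y) ≈⟨ +-congˡ (-‿cong (+-assoc a (- a) y)) ⟩
        x - (a + (- a + y)) ≈⟨ +-congˡ (-‿cong (+-congˡ (+-comm (- a) y))) ⟩
        x - (a + (y - a)) ≈⟨ +-congˡ (-‿cong (sym (+-assoc a y (- a)))) ⟩
        x - ((a + y) - a) ≈⟨ +-congˡ (sym (-‿+-comm (a + y) (- a))) ⟩
        x + (- (a + y) + - - a) ≈⟨ +-congˡ (+-congˡ (-‿involutive a)) ⟩
        x + (- (a + y) + a) ≈⟨ +-congˡ (+-comm _ a) ⟩
        x + (a + - (a + y)) ≈⟨ sym (+-assoc x a _) ⟩
        (x + a) - (a + y) ≈⟨ +-congʳ (+-comm x a) ⟩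
        (a + x) - (a + y) ∎

    multℤ-+ : ∀ i j → multℤ (i Z.+ j) ≈ multℤ i + multℤ j
    multℤ-+ (+ m) (+ n) = ×-homo-+ 1# m n
    multℤ-+ (+ m) -[1+ n ] = multℤ-⊖ m (suc n)
    multℤ-+ -[1+ m ] (+ n) = trans (multℤ-⊖ n (suc m)) (+-comm _ _)
    multℤ-+ -[1+ m ] -[1+ n ] = begin
      - (suc (suc (m N.+ n)) × 1#) ≡⟨ P.cong (λ k → - (suc k × 1#)) (P.sym (NP.+-suc m n)) ⟩
      - ((suc m N.+ suc n) × 1#) ≈⟨ -‿cong (×-homo-+ 1# (suc m) (suc n)) ⟩
      - (suc m × 1# + suc n × 1#) ≈⟨ sym (-‿+-comm _ _) ⟩
      - (suc m × 1#) + - (suc n × 1#) ∎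

    multℤ-* : ∀ i j → multℤ (i Z.* j) ≈ multℤ i * multℤ j
    multℤ-* i j = begin
      multℤ ((Z.sign i S.* Z.sign j) Z.◃ (Z.∣ i ∣ N.* Z.∣ j ∣))
        ≈⟨ multℤ-◃ (Z.sign i S.* Z.sign j) (Z.∣ i ∣ N.* Z.∣ j ∣) ⟩
      signed (Z.sign i S.* Z.sign j) ((Z.∣ i ∣ N.* Z.∣ j ∣) × 1#)
        ≈⟨ signed-cong (Z.sign i S.* Z.sign j) (×1-homo-* (Z.∣ i ∣) (Z.∣ j ∣)) ⟩
      signed (Z.sign i S.* Z.sign j) ((Z.∣ i ∣ × 1#) * (Z.∣ j ∣ × 1#)) ≈⟨ signed-* (Z.sign i) (Z.sign j) _ _ ⟩
      signed (Z.sign i) (Z.∣ i ∣ × 1#) * signed (Z.sign j) (Z.∣ j ∣ × 1#)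
        ≈⟨ sym (*-cong (multℤ-signAbs i) (multℤ-signAbs j)) ⟩
      multℤ i * multℤ j ∎
      where
      signed-cong : ∀ s {x y} → x ≈ y → signed s x ≈ signed s y
      signed-cong S.+ e = e
      signed-cong S.- e = -‿cong e

    multℤ-neg : ∀ i → multℤ (Z.- i) ≈ - multℤ i
    multℤ-neg (+ zero) = sym -0#≈0#
    multℤ-neg (+ suc n) = refl
    multℤ-neg -[1+ n ] = sym (-‿involutive _)

  ℤ⟶R : Z.+-*-rawRing -Raw-AlmostCommutative⟶ fromCommutativeRing R
  ℤ⟶R = record
    { ⟦_⟧ = litℤ
    ; +-homo = λ i j → trans (litℤ≈multℤ (i Z.+ j)) (trans (multℤ-+ i j) (sym (+-cong (litℤ≈multℤ i) (litℤ≈multℤ j))))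
    ; *-homo = λ i j → trans (litℤ≈multℤ (i Z.* j)) (trans (multℤ-* i j) (sym (*-cong (litℤ≈multℤ i) (litℤ≈multℤ j))))
    ; -‿homo = λ i → trans (litℤ≈multℤ (Z.- i)) (trans (multℤ-neg i) (sym (-‿cong (litℤ≈multℤ i))))
    ; 0-homo = refl ; 1-homo = refl }

  ℤ-weaklyDecidable : ∀ (i j : ℤ) → Maybe (litℤ i ≈ litℤ j)
  ℤ-weaklyDecidable i j with i Z.≟ j
  ... | yes P.refl = just refl
  ... | no _ = nothing

  open import Algebra.Solver.Ring Z.+-*-rawRing (fromCommutativeRing R) ℤ⟶R ℤ-weaklyDecidable public
    using (solve; _:=_; _:+_; _:*_; :-_; _:-_; con; Polynomial)

  :0 :1 : ∀ {n} → Polynomial n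
  :0 = con (+ 0)
  :1 = con (+ 1)

module Indices where
  open import Data.Nat using (ℕ; zero; suc; pred; _*_; ⌊_/2⌋; _<_; _≤_; s≤s; z<s; s<s; _≟_; _≤ᵇ_; _<ᵇ_; _∸_; _+_)
  open import Data.Nat.Properties using (suc-injective; <-cmp; <-trans; n<1+n; m<n⇒m<1+n; <⇒≤)
  import Data.Nat.Properties as NP
  open import Data.Bool using (Bool; true; false; if_then_else_)
  open import Relation.Binary.PropositionalEquality as P using (_≡_; _≢_)
  open import Relation.Binary.Definitions using (tri<; tri≈; tri>)
  open import Relation.Nullary using (yes; no)
  open import Data.Empty using (⊥-elim)

  punchIn : ℕ → ℕ → ℕ
  punchIn zero k = suc k
  punchIn (suc j) zero = zero
  punchIn (suc j) (suc k) = suc (punchIn j k)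

  punchIn-< : ∀ j c n → j < suc n → c < n → punchIn j c < suc n
  punchIn-< zero c n p q = s<s q
  punchIn-< (suc j) zero (suc n) p q = z<s
  punchIn-< (suc j) (suc c) (suc n) (s<s p) (s<s q) = s<s (punchIn-< j c n p q)

  punchIn-≢ : ∀ j l → punchIn j l ≢ j
  punchIn-≢ zero l ()
  punchIn-≢ (suc j) zero ()
  punchIn-≢ (suc j) (suc l) e = punchIn-≢ j l (suc-injective e)

  punchOut : ℕ → ℕ → ℕ
  punchOut zero k = pred k
  punchOut (suc j) zero = zero
  punchOut (suc j) (suc k) = suc (punchOut j k)

  punchOut-punchIn : ∀ j l → punchOut j (punchIn j l) ≡ l
  punchOut-punchIn zero l = P.refl
  punchOut-punchIn (suc j) zero = P.refl
  punchOut-punchIn (suc j) (suc l) = P.cong suc (punchOut-punchIn j l)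

  punchIn-punchIn : ∀ j k c → j ≢ k → punchIn j (punchIn (punchOut j k) c) ≡ punchIn k (punchIn (punchOut k j) c)
  punchIn-punchIn zero zero c ne = ⊥-elim (ne P.refl)
  punchIn-punchIn zero (suc k) c ne = P.refl
  punchIn-punchIn (suc j) zero c ne = P.refl
  punchIn-punchIn (suc j) (suc k) zero ne = P.refl
  punchIn-punchIn (suc j) (suc k) (suc c) ne = P.cong suc (punchIn-punchIn j k c (λ e → ne (P.cong suc e)))

  punchIn-below : ∀ j c → c < j → punchIn j c ≡ c
  punchIn-below (suc j) zero p = P.refl
  punchIn-below (suc j) (suc c) (s<s p) = P.cong suc (punchIn-below j c p)

  punchIn-above : ∀ j c → j ≤ c → punchIn j c ≡ suc c
  punchIn-above zero c p = P.refl
  punchIn-above (suc j) (suc c) (s≤s p) = P.cong suc (punchIn-above j c p)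

  swapWithNext : ℕ → ℕ → ℕ
  swapWithNext zero zero = 1
  swapWithNext zero (suc zero) = 0
  swapWithNext zero (suc (suc r)) = suc (suc r)
  swapWithNext (suc i) zero = zero
  swapWithNext (suc i) (suc r) = suc (swapWithNext i r)

  swapWithNext-below : ∀ i r → r < i → swapWithNext i r ≡ r
  swapWithNext-below (suc i) zero p = P.refl
  swapWithNext-below (suc i) (suc r) (s<s p) = P.cong suc (swapWithNext-below i r p)

  swapWithNext-self : ∀ i → swapWithNext i i ≡ suc i
  swapWithNext-self zero = P.refl
  swapWithNext-self (suc i) = P.cong suc (swapWithNext-self i)

  swapWithNext-punchIn : ∀ i r → swapWithNext i (punchIn i r) ≡ punchIn (suc i) r
  swapWithNext-punchIn zero zero = P.refl
  swapWithNext-punchIn zero (suc r) = P.refl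
  swapWithNext-punchIn (suc i) zero = P.refl
  swapWithNext-punchIn (suc i) (suc r) = P.cong suc (swapWithNext-punchIn i r)

  rotateTo : ℕ → ℕ → ℕ
  rotateTo i zero = i
  rotateTo i (suc r) = punchIn i r

  swapWithNext-rotateTo : ∀ i r → swapWithNext i (rotateTo i r) ≡ rotateTo (suc i) r
  swapWithNext-rotateTo i zero = swapWithNext-self i
  swapWithNext-rotateTo i (suc r) = swapWithNext-punchIn i r

  copyRow : ℕ → ℕ → ℕ → ℕ
  copyRow i j r with r ≟ j
  ... | yes _ = i
  ... | no _ = r

  copyRow-target : ∀ i j → copyRow i j j ≡ i
  copyRow-target i j with j ≟ j
  ... | yes _ = P.refl
  ... | no ne = ⊥-elim (ne P.refl)

  copyRow-other : ∀ i j r → r ≢ j → copyRow i j r ≡ r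
  copyRow-other i j r ne with r ≟ j
  ... | yes e = ⊥-elim (ne e)
  ... | no _ = P.refl

  ∸-suc : ∀ k i → i < k → k ∸ i ≡ suc (k ∸ suc i)
  ∸-suc (suc k) zero p = P.refl
  ∸-suc (suc k) (suc i) (s<s p) = ∸-suc k i p

  ≤ᵇ-suc : ∀ a b → (suc a ≤ᵇ suc b) ≡ (a ≤ᵇ b)
  ≤ᵇ-suc zero b = P.refl
  ≤ᵇ-suc (suc a) b = P.refl

  ≤ᵇ-true : ∀ {a b} → a ≤ b → (a ≤ᵇ b) ≡ true
  ≤ᵇ-true {zero} p = P.refl
  ≤ᵇ-true {suc a} {suc b} (s≤s p) = P.trans (≤ᵇ-suc a b) (≤ᵇ-true p)

  ≤ᵇ-false : ∀ {a b} → b < a → (a ≤ᵇ b) ≡ false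
  ≤ᵇ-false {suc a} {zero} p = P.refl
  ≤ᵇ-false {suc a} {suc b} (s<s p) = P.trans (≤ᵇ-suc a b) (≤ᵇ-false p)

  <ᵇ-true : ∀ {a b} → a < b → (a <ᵇ b) ≡ true
  <ᵇ-true {zero} {suc b} p = P.refl
  <ᵇ-true {suc a} {suc b} (s<s p) = <ᵇ-true p

  <ᵇ-false : ∀ {a b} → b ≤ a → (a <ᵇ b) ≡ false
  <ᵇ-false {a} {zero} p = P.refl
  <ᵇ-false {suc a} {suc b} (s≤s p) = <ᵇ-false p

  <ᵇ-suc-ne : ∀ r t → r ≢ t → (r <ᵇ suc t) ≡ (r <ᵇ t)
  <ᵇ-suc-ne r t ne with <-cmp r t
  ... | tri< lt _ _ = P.trans (<ᵇ-true (m<n⇒m<1+n lt)) (P.sym (<ᵇ-true lt))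
  ... | tri≈ _ e _ = ⊥-elim (ne e)
  ... | tri> _ _ gt = P.trans (<ᵇ-false gt) (P.sym (<ᵇ-false (<⇒≤ gt)))

  if-t : ∀ {a} {A : Set a} {b : Bool} {x y : A} → b ≡ true → (if b then x else y) ≡ x
  if-t P.refl = P.refl

  if-f : ∀ {a} {A : Set a} {b : Bool} {x y : A} → b ≡ false → (if b then x else y) ≡ y
  if-f P.refl = P.refl

  rotateLast^ : ℕ → ℕ → ℕ → ℕ
  rotateLast^ N' zero r = r
  rotateLast^ N' (suc j) r = rotateLast^ N' j (rotateTo N' r)

  rotateLast^-formula : ∀ N' j r → j ≤ suc N' → r < suc N' → rotateLast^ N' j r ≡ (if r <ᵇ j then (suc N' ∸ j) + r else r ∸ j)
  rotateLast^-formula N' zero r _ _ = P.refl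
  rotateLast^-formula N' (suc j) zero (s≤s jN) _ rewrite rotateLast^-formula N' j N' (NP.m≤n⇒m≤1+n jN) (n<1+n N') | <ᵇ-false jN = P.sym (NP.+-identityʳ (N' ∸ j))
  rotateLast^-formula N' (suc j) (suc r) (s≤s jN) (s<s rN) rewrite punchIn-below N' r rN | rotateLast^-formula N' j r (NP.m≤n⇒m≤1+n jN) (<-trans rN (n<1+n N')) with r <ᵇ j
  ... | true = P.trans (P.cong (_+ r) (NP.+-∸-assoc 1 jN)) (P.sym (NP.+-suc (N' ∸ j) r))
  ... | false = P.refl

  triangle : ℕ → ℕ
  triangle zero = 0
  triangle (suc k) = k + triangle k

  triangle-double : ∀ d → d * suc d ≡ triangle (suc d) + triangle (suc d)
  triangle-double zero = P.refl
  triangle-double (suc d) = P.trans (expand d) (P.trans (P.cong (λ x → x + (suc d + suc d)) (triangle-double d)) (regroup d (triangle d)))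
    where
    open import Data.Nat.Tactic.RingSolver
    expand : ∀ d → suc d * suc (suc d) ≡ d * suc d + (suc d + suc d)
    expand = solve-∀
    regroup : ∀ d t → (d + t) + (d + t) + (suc d + suc d) ≡ (suc d + (d + t)) + (suc d + (d + t))
    regroup = solve-∀

  ⌊n*[n-1]/2⌋≡triangle : ∀ e → ⌊ suc (suc e) * suc e /2⌋ ≡ triangle (suc (suc e))
  ⌊n*[n-1]/2⌋≡triangle e = P.trans (P.cong ⌊_/2⌋ (P.trans (NP.*-comm (suc (suc e)) (suc e)) (triangle-double (suc e))))
        (P.sym (NP.n≡⌊n+n/2⌋ (triangle (suc (suc e)))))

module Multiples {c ℓ} (R : CommutativeRing c ℓ) where
  open RingSolver R
  open Lemma46 R using (nat·; pow)
  open import Data.Nat using (zero; suc) renaming (_+_ to _+ℕ_; _*_ to _*ℕ_)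
  import Data.Nat.Properties as NP
  import Relation.Binary.PropositionalEquality as P

  nat·-cong : ∀ k {x y} → x ≈ y → nat· k x ≈ nat· k y
  nat·-cong zero e = refl
  nat·-cong (suc k) e = +-cong e (nat·-cong k e)

  nat·≈nat·1* : ∀ k x → nat· k x ≈ nat· k 1# * x
  nat·≈nat·1* zero x = sym (zeroˡ x)
  nat·≈nat·1* (suc k) x = trans (+-cong (sym (*-identityˡ x)) (nat·≈nat·1* k x)) (sym (distribʳ x 1# (nat· k 1#)))

  nat·-zero : ∀ k {x} → x ≈ 0# → nat· k x ≈ 0#
  nat·-zero zero e = refl
  nat·-zero (suc k) e = trans (+-cong e (nat·-zero k e)) (+-identityˡ 0#)

  nat·-*ˡ : ∀ k a z → nat· k (a * z) ≈ a * nat· k z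
  nat·-*ˡ zero a z = sym (zeroʳ a)
  nat·-*ˡ (suc k) a z = trans (+-congˡ (nat·-*ˡ k a z)) (sym (distribˡ a z _))

  pow-cong : ∀ {x y} n → x ≈ y → pow x n ≈ pow y n
  pow-cong zero e = refl
  pow-cong (suc n) e = *-cong e (pow-cong n e)

  pow-* : ∀ x y k → pow (x * y) k ≈ pow x k * pow y k
  pow-* x y zero = sym (*-identityˡ 1#)
  pow-* x y (suc k) = trans (*-congˡ (pow-* x y k)) (solve 4 (λ a b c d → (a :* b) :* (c :* d) := (a :* c) :* (b :* d)) refl _ _ _ _)

  pow-+ : ∀ x a b → pow x (a +ℕ b) ≈ pow x a * pow x b
  pow-+ x zero b = sym (*-identityˡ _)
  pow-+ x (suc a) b = trans (*-congˡ (pow-+ x a b)) (sym (*-assoc _ _ _))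

  pow-pow : ∀ x a b → pow (pow x a) b ≈ pow x (a *ℕ b)
  pow-pow x a zero = reflexive (P.cong (pow x) (P.sym (NP.*-zeroʳ a)))
  pow-pow x a (suc b) = trans (*-congˡ (pow-pow x a b))
        (trans (sym (pow-+ x a (a *ℕ b))) (reflexive (P.cong (pow x) (P.sym (NP.*-suc a b)))))

  pow-1 : ∀ k → pow 1# k ≈ 1#
  pow-1 zero = refl
  pow-1 (suc k) = trans (*-identityˡ _) (pow-1 k)

  pow-involution : ∀ σ j → σ * σ ≈ 1# → pow σ (j +ℕ j) ≈ 1#
  pow-involution σ j e = trans (pow-+ σ j j) (trans (sym (pow-* σ σ j)) (trans (pow-cong j e) (pow-1 j)))

module BigOperators {c ℓ} (R : CommutativeRing c ℓ) where
  open RingSolver R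
  open Indices
  open import Data.Nat using (ℕ; zero; suc; _<_; _≤_; s≤s; z<s; s<s)
  open import Data.Nat.Properties using (suc-injective)
  open import Relation.Binary.PropositionalEquality as P using (_≢_)
  open import Data.List using (List; []; _∷_; map)
  open import Data.List.Membership.Propositional using (_∈_)
  open import Data.List.Relation.Unary.Any using (here; there)

  ∑ : ℕ → (ℕ → Carrier) → Carrier
  ∑ zero g = 0#
  ∑ (suc n) g = g 0 + ∑ n (λ i → g (suc i))

  private
    swap-mid : ∀ x y z → x + (y + z) ≈ y + (x + z)
    swap-mid = solve 3 (λ x y z → x :+ (y :+ z) := y :+ (x :+ z)) refl

    interchange : ∀ a b x y → (a + b) + (x + y) ≈ (a + x) + (b + y)
    interchange = solve 4 (λ a b x y → (a :+ b) :+ (x :+ y) := (a :+ x) :+ (b :+ y)) refl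

  ∑-cong : ∀ n {f g} → (∀ i → i < n → f i ≈ g i) → ∑ n f ≈ ∑ n g
  ∑-cong zero h = refl
  ∑-cong (suc n) h = +-cong (h 0 z<s) (∑-cong n (λ i p → h (suc i) (s<s p)))

  ∑-+ : ∀ n f g → ∑ n (λ i → f i + g i) ≈ ∑ n f + ∑ n g
  ∑-+ zero f g = sym (+-identityˡ 0#)
  ∑-+ (suc n) f g = trans (+-congˡ (∑-+ n _ _)) (interchange _ _ _ _)

  ∑-* : ∀ n a f → ∑ n (λ i → a * f i) ≈ a * ∑ n f
  ∑-* zero a f = sym (zeroʳ a)
  ∑-* (suc n) a f = trans (+-congˡ (∑-* n a _)) (sym (distribˡ a _ _))

  ∑-neg : ∀ n f → ∑ n (λ i → - f i) ≈ - ∑ n f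
  ∑-neg zero f = sym -0#≈0#
  ∑-neg (suc n) f = trans (+-congˡ (∑-neg n _)) (-‿+-comm _ _)

  ∑-zero : ∀ n f → (∀ i → i < n → f i ≈ 0#) → ∑ n f ≈ 0#
  ∑-zero n f h = trans (∑-cong n h) (zeros n)
    where
    zeros : ∀ n → ∑ n (λ _ → 0#) ≈ 0#
    zeros zero = refl
    zeros (suc n) = trans (+-identityˡ _) (zeros n)

  ∑-last : ∀ n f → ∑ (suc n) f ≈ ∑ n f + f n
  ∑-last zero f = trans (+-identityʳ _) (sym (+-identityˡ _))
  ∑-last (suc n) f = trans (+-congˡ (∑-last n _)) (sym (+-assoc _ _ _))

  ∑-single : ∀ n f j → j < n → (∀ i → i < n → i ≢ j → f i ≈ 0#) → ∑ n f ≈ f j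
  ∑-single (suc n) f zero p h =
    trans (+-congˡ (∑-zero n _ (λ i q → h (suc i) (s<s q) (λ ())))) (+-identityʳ _)
  ∑-single (suc n) f (suc j) (s<s p) h =
    trans (+-cong (h 0 z<s (λ ())) (∑-single n _ j p (λ i q ne → h (suc i) (s<s q) (λ e → ne (suc-injective e))))) (+-identityˡ _)

  ∑-swap : ∀ n m (F : ℕ → ℕ → Carrier) → ∑ n (λ i → ∑ m (F i)) ≈ ∑ m (λ j → ∑ n (λ i → F i j))
  ∑-swap zero m F = sym (∑-zero m _ (λ _ _ → refl))
  ∑-swap (suc n) m F = begin
    ∑ m (F 0) + ∑ n (λ i → ∑ m (F (suc i))) ≈⟨ +-congˡ (∑-swap n m _) ⟩
    ∑ m (F 0) + ∑ m (λ j → ∑ n (λ i → F (suc i) j)) ≈⟨ sym (∑-+ m _ _) ⟩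
    ∑ m (λ j → F 0 j + ∑ n (λ i → F (suc i) j)) ∎

  ∑-punchIn : ∀ n f j → j ≤ n → ∑ (suc n) f ≈ f j + ∑ n (λ l → f (punchIn j l))
  ∑-punchIn n f zero p = refl
  ∑-punchIn (suc n) f (suc j) (s≤s p) =
    trans (+-congˡ (∑-punchIn n (λ i → f (suc i)) j p)) (swap-mid _ _ _)

  ∑∑-antisym : ∀ n (F : ℕ → ℕ → Carrier) → (∀ i j → i < n → j < n → F i j + F j i ≈ 0#) →
    (∀ i → i < n → F i i ≈ 0#) → ∑ n (λ i → ∑ n (F i)) ≈ 0#
  ∑∑-antisym zero F h d = refl
  ∑∑-antisym (suc n) F h d = begin
    ∑ (suc n) (λ i → ∑ (suc n) (F i)) ≈⟨ ∑-cong (suc n) (λ i _ → ∑-last n (F i)) ⟩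
    ∑ (suc n) (λ i → ∑ n (F i) + F i n) ≈⟨ ∑-+ (suc n) (λ i → ∑ n (F i)) (λ i → F i n) ⟩
    ∑ (suc n) (λ i → ∑ n (F i)) + ∑ (suc n) (λ i → F i n) ≈⟨ +-cong (∑-last n _) (∑-last n _) ⟩
    (∑ n (λ i → ∑ n (F i)) + ∑ n (F n)) + (∑ n (λ i → F i n) + F n n)
      ≈⟨ +-cong (+-congʳ (∑∑-antisym n F (λ i j p q → h i j (lt p) (lt q)) (λ i p → d i (lt p)))) (+-congˡ (d n le)) ⟩
    (0# + ∑ n (F n)) + (∑ n (λ i → F i n) + 0#) ≈⟨ +-cong (+-identityˡ _) (+-identityʳ _) ⟩
    ∑ n (F n) + ∑ n (λ i → F i n) ≈⟨ sym (∑-+ n _ _) ⟩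
    ∑ n (λ j → F n j + F j n) ≈⟨ ∑-zero n _ (λ j p → h n j le (lt p)) ⟩
    0# ∎
    where
    open import Data.Nat.Properties using (m<n⇒m<1+n; n<1+n)
    lt : ∀ {i} → i < n → i < suc n
    lt = m<n⇒m<1+n
    le : n < suc n
    le = n<1+n n

  ∑-linear : ∀ n f g a → ∑ n (λ i → f i + a * g i) ≈ ∑ n f + a * ∑ n g
  ∑-linear n f g a = trans (∑-+ n f (λ i → a * g i)) (+-congˡ (∑-* n a g))

  ∏ : ∀ {a} {A : Set a} → (A → Carrier) → List A → Carrier
  ∏ F [] = 1#
  ∏ F (x ∷ xs) = F x * ∏ F xs

  ∏-cong : ∀ {a} {A : Set a} {F H : A → Carrier} L → (∀ x → x ∈ L → F x ≈ H x) → ∏ F L ≈ ∏ H L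
  ∏-cong [] h = refl
  ∏-cong (x ∷ L) h = *-cong (h x (here P.refl)) (∏-cong L (λ y m → h y (there m)))

  ∏-* : ∀ {a} {A : Set a} (F H : A → Carrier) L → ∏ (λ x → F x * H x) L ≈ ∏ F L * ∏ H L
  ∏-* F H [] = sym (*-identityˡ 1#)
  ∏-* F H (x ∷ L) = trans (*-congˡ (∏-* F H L)) (solve 4 (λ a b c d → (a :* b) :* (c :* d) := (a :* c) :* (b :* d)) refl _ _ _ _)

  ∏-root : ∀ t L → t ∈ L → ∏ (λ u → t - u) L ≈ 0#
  ∏-root t (x ∷ L) (here P.refl) = trans (*-congʳ (-‿inverseʳ t)) (zeroˡ _)
  ∏-root t (x ∷ L) (there m) = trans (*-congˡ (∏-root t L m)) (zeroʳ _)

  ∏-map : ∀ {a b} {A : Set a} {B : Set b} (F : B → Carrier) (G : A → Carrier) (h : A → B) L → (∀ x → F (h x) ≈ G x) → ∏ F (map h L) ≈ ∏ G L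
  ∏-map F G h [] e = refl
  ∏-map F G h (x ∷ L) e = *-cong (e x) (∏-map F G h L e)

module Determinants {c ℓ} (R : CommutativeRing c ℓ) where
  open RingSolver R
  open BigOperators R public
  open Indices
  open Lemma46 R public using () renaming (negOnePow to sgn)
  open import Data.Nat using (ℕ; zero; suc; _<_; _≤_; s≤s; z<s; s<s; _≟_) renaming (_+_ to _+ℕ_; _*_ to _*ℕ_)
  open import Data.Nat.Properties using (suc-injective; <-trans; n<1+n; <-cmp; ≤-pred)
  import Data.Nat.Properties as NP
  open import Relation.Binary.PropositionalEquality as P using (_≡_; _≢_)
  open import Relation.Nullary using (yes; no)
  open import Data.Empty using (⊥-elim)
  open import Data.Sum using (inj₁; inj₂)
  open import Relation.Binary.Definitions using (tri<; tri≈; tri>)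

  Mat : Set c
  Mat = ℕ → ℕ → Carrier

  minor : ℕ → Mat → Mat
  minor j M r c = M (suc r) (punchIn j c)

  detN : ℕ → Mat → Carrier
  detN zero M = 1#
  detN (suc n) M = ∑ (suc n) (λ j → sgn j * (M 0 j * detN n (minor j M)))

  sgn-suc-suc : ∀ a b → sgn (suc a) * sgn (suc b) ≈ sgn a * sgn b
  sgn-suc-suc a b = solve 2 (λ x y → (:- x) :* (:- y) := x :* y) refl (sgn a) (sgn b)

  sgn-square : ∀ a → sgn a * sgn a ≈ 1#
  sgn-square zero = *-identityˡ 1#
  sgn-square (suc a) = trans (sgn-suc-suc a a) (sgn-square a)

  sgn-+ : ∀ a b → sgn (a +ℕ b) ≈ sgn a * sgn b
  sgn-+ zero b = sym (*-identityˡ _)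
  sgn-+ (suc a) b = trans (-‿cong (sgn-+ a b)) (-‿distribˡ-* _ _)

  sgn-n*n : ∀ a → sgn (a *ℕ a) ≈ sgn a
  sgn-n*n zero = refl
  sgn-n*n (suc b) = begin
    - sgn (b +ℕ b *ℕ suc b) ≡⟨ P.cong (λ x → - sgn (b +ℕ x)) (NP.*-suc b b) ⟩
    - sgn (b +ℕ (b +ℕ b *ℕ b)) ≈⟨ -‿cong (trans (sgn-+ b _) (*-congˡ (trans (sgn-+ b _) (*-congˡ (sgn-n*n b))))) ⟩
    - (sgn b * (sgn b * sgn b)) ≈⟨ -‿cong (*-congˡ (sgn-square b)) ⟩
    - (sgn b * 1#) ≈⟨ -‿cong (*-identityʳ _) ⟩
    - sgn b ∎

  twoRowSign : ℕ → ℕ → Carrier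
  twoRowSign j k = sgn j * sgn (punchOut j k)

  twoRowSign-antisym : ∀ j k → j ≢ k → twoRowSign j k ≈ - twoRowSign k j
  twoRowSign-antisym zero zero ne = ⊥-elim (ne P.refl)
  twoRowSign-antisym zero (suc k) ne = solve 1 (λ x → :1 :* x := :- ((:- x) :* :1)) refl (sgn k)
  twoRowSign-antisym (suc j) zero ne = solve 1 (λ x → (:- x) :* :1 := :- (:1 :* x)) refl (sgn j)
  twoRowSign-antisym (suc j) (suc k) ne = trans (sgn-suc-suc j (punchOut j k))
        (trans (twoRowSign-antisym j k (λ e → ne (P.cong suc e))) (-‿cong (sym (sgn-suc-suc k (punchOut k j)))))

  detN-cong : ∀ n {M N : Mat} → (∀ r c → r < n → c < n → M r c ≈ N r c) → detN n M ≈ detN n N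
  detN-cong zero h = refl
  detN-cong (suc n) h = ∑-cong (suc n) (λ j p → *-congˡ {sgn j} (*-cong (h 0 j z<s p)
    (detN-cong n (λ r c q s → h (suc r) (punchIn j c) (s<s q) (punchIn-< j c n p s)))))

  private
    linear-in-minor : ∀ s m x a y → s * (m * (x + a * y)) ≈ s * (m * x) + a * (s * (m * y))
    linear-in-minor = solve 5 (λ s m x a y → s :* (m :* (x :+ a :* y)) := s :* (m :* x) :+ a :* (s :* (m :* y))) refl

    linear-in-entry : ∀ s d x a y → s * ((x + a * y) * d) ≈ s * (x * d) + a * (s * (y * d))
    linear-in-entry = solve 5 (λ s d x a y → s :* ((x :+ a :* y) :* d) := s :* (x :* d) :+ a :* (s :* (y :* d))) refl

  detN-rowLinear : ∀ n i (M A B : Mat) a → i < n →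
    (∀ r c → r < n → c < n → r ≢ i → A r c ≈ M r c) →
    (∀ r c → r < n → c < n → r ≢ i → B r c ≈ M r c) →
    (∀ c → c < n → M i c ≈ A i c + a * B i c) →
    detN n M ≈ detN n A + a * detN n B
  detN-rowLinear (suc n) zero M A B a p hA hB hM = trans (∑-cong (suc n) expandedTerm)
        (∑-linear (suc n) (λ j → sgn j * (A 0 j * detN n (minor j A))) (λ j → sgn j * (B 0 j * detN n (minor j B))) a)
    where
    expandedTerm : ∀ j → j < suc n → sgn j * (M 0 j * detN n (minor j M)) ≈
           sgn j * (A 0 j * detN n (minor j A)) + a * (sgn j * (B 0 j * detN n (minor j B)))
    expandedTerm j q = begin
      sgn j * (M 0 j * detN n (minor j M)) ≈⟨ *-congˡ (*-congʳ (hM j q)) ⟩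
      sgn j * ((A 0 j + a * B 0 j) * detN n (minor j M)) ≈⟨ linear-in-entry _ _ _ _ _ ⟩
      sgn j * (A 0 j * detN n (minor j M)) + a * (sgn j * (B 0 j * detN n (minor j M)))
        ≈⟨ +-cong (*-congˡ (*-congˡ (minor-unchanged A hA))) (*-congˡ (*-congˡ (*-congˡ (minor-unchanged B hB)))) ⟩
      sgn j * (A 0 j * detN n (minor j A)) + a * (sgn j * (B 0 j * detN n (minor j B))) ∎
      where
      minor-unchanged : ∀ X → (∀ r c → r < suc n → c < suc n → r ≢ 0 → X r c ≈ M r c) → detN n (minor j M) ≈ detN n (minor j X)
      minor-unchanged X h = detN-cong n (λ r c s t → sym (h (suc r) (punchIn j c) (s<s s) (punchIn-< j c n q t) (λ ())))
  detN-rowLinear (suc n) (suc i) M A B a (s<s p) hA hB hM = trans (∑-cong (suc n) expandedTerm)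
        (∑-linear (suc n) (λ j → sgn j * (A 0 j * detN n (minor j A))) (λ j → sgn j * (B 0 j * detN n (minor j B))) a)
    where
    expandedTerm : ∀ j → j < suc n → sgn j * (M 0 j * detN n (minor j M)) ≈
           sgn j * (A 0 j * detN n (minor j A)) + a * (sgn j * (B 0 j * detN n (minor j B)))
    expandedTerm j q = begin
      sgn j * (M 0 j * detN n (minor j M)) ≈⟨ *-congˡ (*-congˡ (detN-rowLinear n i (minor j M) (minor j A) (minor j B) a p
          (λ r c s t ne → hA (suc r) (punchIn j c) (s<s s) (punchIn-< j c n q t) (λ e → ne (suc-injective e)))
          (λ r c s t ne → hB (suc r) (punchIn j c) (s<s s) (punchIn-< j c n q t) (λ e → ne (suc-injective e)))
          (λ c t → hM (punchIn j c) (punchIn-< j c n q t)))) ⟩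
      sgn j * (M 0 j * (detN n (minor j A) + a * detN n (minor j B))) ≈⟨ linear-in-minor _ _ _ _ _ ⟩
      sgn j * (M 0 j * detN n (minor j A)) + a * (sgn j * (M 0 j * detN n (minor j B)))
        ≈⟨ +-cong (*-congˡ (*-congʳ (sym (hA 0 j z<s q (λ ())))))
             (*-congˡ (*-congˡ (*-congʳ (sym (hB 0 j z<s q (λ ())))))) ⟩
      sgn j * (A 0 j * detN n (minor j A)) + a * (sgn j * (B 0 j * detN n (minor j B))) ∎

  byCases : ∀ {a} {A : Set a} (j k : ℕ) → (j ≡ k → A) → (j ≢ k → A) → A
  byCases j k f g with j ≟ k
  ... | yes e = f e
  ... | no ne = g ne

  twoRowMinor : Mat → ℕ → ℕ → ℕ → Carrier
  twoRowMinor M n j k = detN n (λ r c → M (suc (suc r)) (punchIn j (punchIn (punchOut j k) c)))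

  twoRowTerm : Mat → ℕ → ℕ → ℕ → Carrier
  twoRowTerm M n j k with j ≟ k
  ... | yes _ = 0#
  ... | no _ = twoRowSign j k * (M 0 j * (M 1 k * twoRowMinor M n j k))

  twoRowTerm-diag : ∀ M n j → twoRowTerm M n j j ≈ 0#
  twoRowTerm-diag M n j with j ≟ j
  ... | yes _ = refl
  ... | no ne = ⊥-elim (ne P.refl)

  twoRowTerm-offDiag : ∀ M n j k → j ≢ k → twoRowTerm M n j k ≈ twoRowSign j k * (M 0 j * (M 1 k * twoRowMinor M n j k))
  twoRowTerm-offDiag M n j k ne with j ≟ k
  ... | yes e = ⊥-elim (ne e)
  ... | no _ = refl

  twoRowMinor-sym : ∀ M n j k → j ≢ k → twoRowMinor M n j k ≈ twoRowMinor M n k j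
  twoRowMinor-sym M n j k ne = detN-cong n (λ r c _ _ → reflexive (P.cong (M (suc (suc r))) (punchIn-punchIn j k c ne)))

  -- Expanding along the first two rows shows that swapping them negates the determinant;
  -- the other alternation properties are derived from this one by induction.
  detN-expandTwoRows : ∀ n M → detN (suc (suc n)) M ≈ ∑ (suc (suc n)) (λ j → ∑ (suc (suc n)) (twoRowTerm M n j))
  detN-expandTwoRows n M = ∑-cong (suc (suc n)) row
    where
    reassociate : ∀ s m t x d → s * (m * (t * (x * d))) ≈ (s * t) * (m * (x * d))
    reassociate = solve 5 (λ s m t x d → s :* (m :* (t :* (x :* d))) := (s :* t) :* (m :* (x :* d))) refl
    row : ∀ j → j < suc (suc n) → sgn j * (M 0 j * detN (suc n) (minor j M)) ≈ ∑ (suc (suc n)) (twoRowTerm M n j)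
    row j p = begin
      sgn j * (M 0 j * ∑ (suc n) (λ l → sgn l * (M 1 (punchIn j l) * detN n (minor l (minor j M)))))
        ≈⟨ *-congˡ (sym (∑-* (suc n) (M 0 j) (λ l → sgn l * (M 1 (punchIn j l) * detN n (minor l (minor j M)))))) ⟩
      sgn j * ∑ (suc n) (λ l → M 0 j * (sgn l * (M 1 (punchIn j l) * detN n (minor l (minor j M)))))
        ≈⟨ sym (∑-* (suc n) (sgn j) (λ l → M 0 j * (sgn l * (M 1 (punchIn j l) * detN n (minor l (minor j M)))))) ⟩
      ∑ (suc n) (λ l → sgn j * (M 0 j * (sgn l * (M 1 (punchIn j l) * detN n (minor l (minor j M))))))
        ≈⟨ ∑-cong (suc n) (λ l _ → term l) ⟩
      ∑ (suc n) (λ l → twoRowTerm M n j (punchIn j l))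
        ≈⟨ sym
             (trans (∑-punchIn (suc n) (twoRowTerm M n j) j (≤-pred p))
                (trans (+-congʳ (twoRowTerm-diag M n j)) (+-identityˡ _))) ⟩
      ∑ (suc (suc n)) (twoRowTerm M n j) ∎
      where
      term : ∀ l → sgn j * (M 0 j * (sgn l * (M 1 (punchIn j l) * detN n (minor l (minor j M))))) ≈ twoRowTerm M n j (punchIn j l)
      term l = sym (begin
        twoRowTerm M n j (punchIn j l) ≈⟨ twoRowTerm-offDiag M n j (punchIn j l) (λ e → punchIn-≢ j l (P.sym e)) ⟩
        twoRowSign j (punchIn j l) * (M 0 j * (M 1 (punchIn j l) * twoRowMinor M n j (punchIn j l)))
          ≡⟨ P.cong
               (λ u → sgn j * sgn u * (M 0 j * (M 1 (punchIn j l) * detN n (λ r c → M (suc (suc r)) (punchIn j (punchIn u c))))))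
               (punchOut-punchIn j l) ⟩
        (sgn j * sgn l) * (M 0 j * (M 1 (punchIn j l) * detN n (minor l (minor j M)))) ≈⟨ sym (reassociate _ _ _ _ _) ⟩
        sgn j * (M 0 j * (sgn l * (M 1 (punchIn j l) * detN n (minor l (minor j M))))) ∎)

  detN-swapFirstRows : ∀ n M → detN (suc (suc n)) (λ r c → M (swapWithNext 0 r) c) ≈ - detN (suc (suc n)) M
  detN-swapFirstRows n M = begin
    detN (suc (suc n)) M' ≈⟨ detN-expandTwoRows n M' ⟩
    ∑ (suc (suc n)) (λ j → ∑ (suc (suc n)) (twoRowTerm M' n j))
      ≈⟨ ∑-cong (suc (suc n)) (λ j _ → ∑-cong (suc (suc n)) (λ k _ → swapped-term j k)) ⟩
    ∑ (suc (suc n)) (λ j → ∑ (suc (suc n)) (λ k → - twoRowTerm M n k j))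
      ≈⟨ ∑-cong (suc (suc n)) (λ j _ → ∑-neg (suc (suc n)) (λ k → twoRowTerm M n k j)) ⟩
    ∑ (suc (suc n)) (λ j → - ∑ (suc (suc n)) (λ k → twoRowTerm M n k j))
      ≈⟨ ∑-neg (suc (suc n)) (λ j → ∑ (suc (suc n)) (λ k → twoRowTerm M n k j)) ⟩
    - ∑ (suc (suc n)) (λ j → ∑ (suc (suc n)) (λ k → twoRowTerm M n k j))
      ≈⟨ -‿cong (sym (∑-swap (suc (suc n)) (suc (suc n)) (twoRowTerm M n))) ⟩
    - ∑ (suc (suc n)) (λ k → ∑ (suc (suc n)) (twoRowTerm M n k)) ≈⟨ -‿cong (sym (detN-expandTwoRows n M)) ⟩
    - detN (suc (suc n)) M ∎
    where
    M' : Mat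
    M' r c = M (swapWithNext 0 r) c
    rearrange : ∀ q m1 m0 d → - q * (m1 * (m0 * d)) ≈ - (q * (m0 * (m1 * d)))
    rearrange = solve 4 (λ q m1 m0 d → (:- q) :* (m1 :* (m0 :* d)) := :- (q :* (m0 :* (m1 :* d)))) refl
    swapped-term : ∀ j k → twoRowTerm M' n j k ≈ - twoRowTerm M n k j
    swapped-term j k = byCases j k
          (λ { P.refl → trans (twoRowTerm-diag M' n j) (sym (trans (-‿cong (twoRowTerm-diag M n j)) -0#≈0#)) })
          λ ne → begin
      twoRowTerm M' n j k ≈⟨ twoRowTerm-offDiag M' n j k ne ⟩
      twoRowSign j k * (M 1 j * (M 0 k * twoRowMinor M n j k))
        ≈⟨ *-cong (twoRowSign-antisym j k ne) (*-congˡ (*-congˡ (twoRowMinor-sym M n j k ne))) ⟩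
      - twoRowSign k j * (M 1 j * (M 0 k * twoRowMinor M n k j)) ≈⟨ rearrange _ _ _ _ ⟩
      - (twoRowSign k j * (M 0 k * (M 1 j * twoRowMinor M n k j)))
        ≈⟨ -‿cong (sym (twoRowTerm-offDiag M n k j (λ e → ne (P.sym e)))) ⟩
      - twoRowTerm M n k j ∎

  detN-equalFirstRows : ∀ n M → (∀ c → c < suc (suc n) → M 0 c ≈ M 1 c) → detN (suc (suc n)) M ≈ 0#
  detN-equalFirstRows n M h = trans (detN-expandTwoRows n M) (∑∑-antisym (suc (suc n)) (twoRowTerm M n) anti (λ i _ → twoRowTerm-diag M n i))
    where
    cancel : ∀ q a b d → q * (a * (b * d)) + - q * (b * (a * d)) ≈ 0#
    cancel = solve 4 (λ q a b d → q :* (a :* (b :* d)) :+ (:- q) :* (b :* (a :* d)) := :0) refl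
    anti : ∀ j k → j < suc (suc n) → k < suc (suc n) → twoRowTerm M n j k + twoRowTerm M n k j ≈ 0#
    anti j k p q = byCases j k (λ { P.refl → trans (+-cong (twoRowTerm-diag M n j) (twoRowTerm-diag M n j)) (+-identityˡ 0#) })
          λ ne → begin
      twoRowTerm M n j k + twoRowTerm M n k j
        ≈⟨ +-cong (twoRowTerm-offDiag M n j k ne) (twoRowTerm-offDiag M n k j (λ e → ne (P.sym e))) ⟩
      twoRowSign j k * (M 0 j * (M 1 k * twoRowMinor M n j k)) + twoRowSign k j * (M 0 k * (M 1 j * twoRowMinor M n k j))
        ≈⟨ +-cong (*-congˡ (*-congˡ (*-congʳ (sym (h k q)))))
             (*-cong (twoRowSign-antisym k j (λ e → ne (P.sym e)))
                (*-congˡ (*-cong (sym (h j p)) (twoRowMinor-sym M n k j (λ e → ne (P.sym e)))))) ⟩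
      twoRowSign j k * (M 0 j * (M 0 k * twoRowMinor M n j k)) + - twoRowSign j k * (M 0 k * (M 0 j * twoRowMinor M n j k))
        ≈⟨ cancel _ _ _ _ ⟩
      0# ∎

  detN-swapAdjacentRows : ∀ n i M → suc i < n → detN n (λ r c → M (swapWithNext i r) c) ≈ - detN n M
  detN-swapAdjacentRows (suc (suc n)) zero M p = detN-swapFirstRows n M
  detN-swapAdjacentRows (suc n) (suc i) M (s<s p) = trans (∑-cong (suc n) term) (∑-neg (suc n) (λ j → sgn j * (M 0 j * detN n (minor j M))))
    where
    term : ∀ j → j < suc n → sgn j * (M 0 j * detN n (λ r c → minor j M (swapWithNext i r) c)) ≈ - (sgn j * (M 0 j * detN n (minor j M)))
    term j q = trans (*-congˡ (*-congˡ (detN-swapAdjacentRows n i (minor j M) p)))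
      (solve 3 (λ s m d → s :* (m :* (:- d)) := :- (s :* (m :* d))) refl _ _ _)

  detN-equalAdjacentRows : ∀ n i M → suc i < n → (∀ c → c < n → M i c ≈ M (suc i) c) → detN n M ≈ 0#
  detN-equalAdjacentRows (suc (suc n)) zero M p h = detN-equalFirstRows n M h
  detN-equalAdjacentRows (suc n) (suc i) M (s<s p) h = ∑-zero (suc n) _ term
    where
    term : ∀ j → j < suc n → sgn j * (M 0 j * detN n (minor j M)) ≈ 0#
    term j q = trans
          (*-congˡ (*-congˡ (detN-equalAdjacentRows n i (minor j M) p (λ c t → h (punchIn j c) (punchIn-< j c n q t)))))
      (trans (*-congˡ (zeroʳ _)) (zeroʳ _))

  ≈-neg-flip : ∀ {x y} → y ≈ - x → x ≈ - y
  ≈-neg-flip {x} {y} e = trans (sym (-‿involutive x)) (-‿cong (sym e))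

  detN-equalRows : ∀ n i j M → i < j → j < n → (∀ c → c < n → M i c ≈ M j c) → detN n M ≈ 0#
  detN-equalRows n i (suc j) M p q h with NP.m≤n⇒m<n∨m≡n (≤-pred p)
  ... | inj₂ P.refl = detN-equalAdjacentRows n i M q h
  ... | inj₁ i<j = trans (≈-neg-flip (detN-swapAdjacentRows n j M q)) (trans (-‿cong ih) -0#≈0#)
    where
    ih : detN n (λ r c → M (swapWithNext j r) c) ≈ 0#
    ih = detN-equalRows n i j (λ r c → M (swapWithNext j r) c) i<j (<-trans (n<1+n j) q)
           (λ c t → trans (reflexive (P.cong (λ u → M u c) (swapWithNext-below j i i<j)))
                          (trans (h c t) (reflexive (P.cong (λ u → M u c) (P.sym (swapWithNext-self j))))))

  detN-addRowMultiple : ∀ n i j (M N : Mat) a → i < n → j < n → i ≢ j →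
    (∀ r c → r < n → c < n → r ≢ j → N r c ≈ M r c) →
    (∀ c → c < n → N j c ≈ M j c + a * M i c) → detN n N ≈ detN n M
  detN-addRowMultiple n i j M N a p q ne hN hj = begin
    detN n N ≈⟨ detN-rowLinear n j N M copied a q (λ r c s t ne' → sym (hN r c s t ne'))
        (λ r c s t ne' → trans (reflexive (P.cong (λ u → M u c) (copyRow-other i j r ne'))) (sym (hN r c s t ne')))
        (λ c t → trans (hj c t) (+-congˡ (*-congˡ (sym (reflexive (P.cong (λ u → M u c) (copyRow-target i j))))))) ⟩
    detN n M + a * detN n copied ≈⟨ +-congˡ (trans (*-congˡ copied-vanishes) (zeroʳ a)) ⟩
    detN n M + 0# ≈⟨ +-identityʳ _ ⟩
    detN n M ∎
    where
    copied : Mat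
    copied r c = M (copyRow i j r) c
    copied-source : ∀ c → copied i c ≡ M i c
    copied-source c = P.cong (λ u → M u c) (copyRow-other i j i ne)
    copied-target : ∀ c → copied j c ≡ M i c
    copied-target c = P.cong (λ u → M u c) (copyRow-target i j)
    copied-vanishes : detN n copied ≈ 0#
    copied-vanishes with <-cmp i j
    ... | tri< lt _ _ = detN-equalRows n i j copied lt q (λ c _ → reflexive (P.trans (copied-source c) (P.sym (copied-target c))))
    ... | tri≈ _ e _ = ⊥-elim (ne e)
    ... | tri> _ _ gt = detN-equalRows n j i copied gt p (λ c _ → reflexive (P.trans (copied-target c) (P.sym (copied-source c))))

  detN-rotateTo : ∀ n i M → i ≤ n → detN (suc n) (λ r c → M (rotateTo i r) c) ≈ sgn i * detN (suc n) M
  detN-rotateTo n zero M p = trans (detN-cong (suc n) same-entries) (sym (*-identityˡ _))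
    where
    same-entries : ∀ r c → r < suc n → c < suc n → M (rotateTo 0 r) c ≈ M r c
    same-entries zero c _ _ = refl
    same-entries (suc r) c _ _ = refl
  detN-rotateTo n (suc i) M p = begin
    detN (suc n) (λ r c → M (rotateTo (suc i) r) c)
      ≈⟨ detN-cong (suc n) (λ r c _ _ → reflexive (P.cong (λ u → M u c) (P.sym (swapWithNext-rotateTo i r)))) ⟩
    detN (suc n) (λ r c → M (swapWithNext i (rotateTo i r)) c)
      ≈⟨ detN-rotateTo n i (λ r c → M (swapWithNext i r) c) (NP.<⇒≤ p) ⟩
    sgn i * detN (suc n) (λ r c → M (swapWithNext i r) c) ≈⟨ *-congˡ (detN-swapAdjacentRows (suc n) i M (s<s p)) ⟩
    sgn i * (- detN (suc n) M) ≈⟨ solve 2 (λ s d → s :* (:- d) := (:- s) :* d) refl _ _ ⟩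
    sgn (suc i) * detN (suc n) M ∎

  detN-unrotateTo : ∀ n i M → i ≤ n → detN (suc n) M ≈ sgn i * detN (suc n) (λ r c → M (rotateTo i r) c)
  detN-unrotateTo n i M p = begin
    detN (suc n) M ≈⟨ sym (*-identityˡ _) ⟩
    1# * detN (suc n) M ≈⟨ *-congʳ (sym (sgn-square i)) ⟩
    (sgn i * sgn i) * detN (suc n) M ≈⟨ *-assoc _ _ _ ⟩
    sgn i * (sgn i * detN (suc n) M) ≈⟨ *-congˡ (sym (detN-rotateTo n i M p)) ⟩
    sgn i * detN (suc n) (λ r c → M (rotateTo i r) c) ∎

  detN-expandSparseRow : ∀ n i j M → i ≤ n → j ≤ n → (∀ c → c < suc n → c ≢ j → M i c ≈ 0#) →
    detN (suc n) M ≈ sgn i * (sgn j * (M i j * detN n (λ r c → M (punchIn i r) (punchIn j c))))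
  detN-expandSparseRow n i j M p q h = trans (detN-unrotateTo n i M p) (*-congˡ
    (∑-single (suc n) (λ j' → sgn j' * (M i j' * detN n (λ r c → M (punchIn i r) (punchIn j' c)))) j (s≤s q)
       (λ c t ne → trans (*-congˡ (trans (*-congʳ (h c t ne)) (zeroˡ _))) (zeroʳ _))))

  detN-zeroFirstColumn : ∀ n M → (∀ r → r < suc n → M r 0 ≈ 0#) → detN (suc n) M ≈ 0#
  detN-zeroFirstColumn n M h = ∑-zero (suc n) _ (term n M h)
    where
    term : ∀ n M → (∀ r → r < suc n → M r 0 ≈ 0#) → ∀ j → j < suc n → sgn j * (M 0 j * detN n (minor j M)) ≈ 0#
    term n M h zero _ = trans (*-congˡ (trans (*-congʳ (h 0 z<s)) (zeroˡ _))) (zeroʳ _)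
    term (suc n') M h (suc j) (s<s q) = trans (*-congˡ (*-congˡ (detN-zeroFirstColumn n' (minor (suc j) M) (λ r t → h (suc r) (s<s t)))))
          (trans (*-congˡ (zeroʳ _)) (zeroʳ _))

  detN-blockFirstColumn : ∀ n M → (∀ r → r < n → M (suc r) 0 ≈ 0#) → detN (suc n) M ≈ M 0 0 * detN n (λ r c → M (suc r) (suc c))
  detN-blockFirstColumn n M h = trans (+-congˡ (∑-zero n _ (term n M h))) (trans (+-identityʳ _) (*-identityˡ _))
    where
    term : ∀ n M → (∀ r → r < n → M (suc r) 0 ≈ 0#) → ∀ j → j < n → sgn (suc j) * (M 0 (suc j) * detN n (minor (suc j) M)) ≈ 0#
    term (suc n') M h j q = trans (*-congˡ (*-congˡ (detN-zeroFirstColumn n' (minor (suc j) M) (λ r t → h r t))))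
          (trans (*-congˡ (zeroʳ _)) (zeroʳ _))

  detN-firstColumnLinear : ∀ n (M A B : Mat) a →
    (∀ r c → r < suc n → c < suc n → c ≢ 0 → A r c ≈ M r c) →
    (∀ r c → r < suc n → c < suc n → c ≢ 0 → B r c ≈ M r c) →
    (∀ r → r < suc n → M r 0 ≈ A r 0 + a * B r 0) →
    detN (suc n) M ≈ detN (suc n) A + a * detN (suc n) B
  detN-firstColumnLinear n M A B a hA hB hM = trans (∑-cong (suc n) (term n M A B hA hB hM))
    (∑-linear (suc n) (λ j → sgn j * (A 0 j * detN n (minor j A))) (λ j → sgn j * (B 0 j * detN n (minor j B))) a)
    where
    term : ∀ n (M A B : Mat) →
      (∀ r c → r < suc n → c < suc n → c ≢ 0 → A r c ≈ M r c) →
      (∀ r c → r < suc n → c < suc n → c ≢ 0 → B r c ≈ M r c) →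
      (∀ r → r < suc n → M r 0 ≈ A r 0 + a * B r 0) →
      ∀ j → j < suc n → sgn j * (M 0 j * detN n (minor j M)) ≈
           sgn j * (A 0 j * detN n (minor j A)) + a * (sgn j * (B 0 j * detN n (minor j B)))
    term n M A B hA hB hM zero q = begin
      sgn 0 * (M 0 0 * detN n (minor 0 M)) ≈⟨ *-congˡ (*-congʳ (hM 0 z<s)) ⟩
      sgn 0 * ((A 0 0 + a * B 0 0) * detN n (minor 0 M)) ≈⟨ linear-in-entry _ _ _ _ _ ⟩
      sgn 0 * (A 0 0 * detN n (minor 0 M)) + a * (sgn 0 * (B 0 0 * detN n (minor 0 M)))
        ≈⟨ +-cong (*-congˡ (*-congˡ (minor-unchanged A hA))) (*-congˡ (*-congˡ (*-congˡ (minor-unchanged B hB)))) ⟩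
      sgn 0 * (A 0 0 * detN n (minor 0 A)) + a * (sgn 0 * (B 0 0 * detN n (minor 0 B))) ∎
      where
      minor-unchanged : ∀ X → (∀ r c → r < suc n → c < suc n → c ≢ 0 → X r c ≈ M r c) → detN n (minor 0 M) ≈ detN n (minor 0 X)
      minor-unchanged X h = detN-cong n (λ r c s t → sym (h (suc r) (suc c) (s<s s) (s<s t) (λ ())))
    term (suc n) M A B hA hB hM (suc j) q = begin
      sgn (suc j) * (M 0 (suc j) * detN (suc n) (minor (suc j) M)) ≈⟨ *-congˡ (*-congˡ (detN-firstColumnLinear n (minor (suc j) M) (minor (suc j) A) (minor (suc j) B) a
          (λ r c s t ne → hA (suc r) (punchIn (suc j) c) (s<s s) (punchIn-< (suc j) c (suc n) q t) (punchIn-suc≢0 j c ne))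
          (λ r c s t ne → hB (suc r) (punchIn (suc j) c) (s<s s) (punchIn-< (suc j) c (suc n) q t) (punchIn-suc≢0 j c ne))
          (λ r s → hM (suc r) (s<s s)))) ⟩
      sgn (suc j) * (M 0 (suc j) * (detN (suc n) (minor (suc j) A) + a * detN (suc n) (minor (suc j) B)))
        ≈⟨ linear-in-minor _ _ _ _ _ ⟩
      _
        ≈⟨ +-cong (*-congˡ (*-congʳ (sym (hA 0 (suc j) z<s q (λ ())))))
             (*-congˡ (*-congˡ (*-congʳ (sym (hB 0 (suc j) z<s q (λ ())))))) ⟩
      sgn (suc j) * (A 0 (suc j) * detN (suc n) (minor (suc j) A)) + a * (sgn (suc j) * (B 0 (suc j) * detN (suc n) (minor (suc j) B))) ∎
      where
      punchIn-suc≢0 : ∀ j c → c ≢ 0 → punchIn (suc j) c ≢ 0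
      punchIn-suc≢0 j zero ne = ⊥-elim (ne P.refl)
      punchIn-suc≢0 j (suc c) ne ()
    term zero M A B hA hB hM (suc j) (s<s ())

  setFirstColumn : (ℕ → Carrier) → Mat → Mat
  setFirstColumn v M r zero = v r
  setFirstColumn v M r (suc c) = M r (suc c)

  detN-firstColumnSum : ∀ m n M (V : ℕ → ℕ → Carrier) → (∀ r → r < suc n → M r 0 ≈ ∑ m (λ i → V i r)) →
    detN (suc n) M ≈ ∑ m (λ i → detN (suc n) (setFirstColumn (V i) M))
  detN-firstColumnSum zero n M V h = detN-zeroFirstColumn n M h
  detN-firstColumnSum (suc m) n M V h = begin
    detN (suc n) M
      ≈⟨ detN-firstColumnLinear n M (setFirstColumn (V 0) M) rest 1# (other-columns (V 0)) (other-columns _)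
           (λ r t → trans (h r t) (+-congˡ (sym (*-identityˡ _)))) ⟩
    detN (suc n) (setFirstColumn (V 0) M) + 1# * detN (suc n) rest ≈⟨ +-congˡ (*-identityˡ _) ⟩
    detN (suc n) (setFirstColumn (V 0) M) + detN (suc n) rest
      ≈⟨ +-congˡ (detN-firstColumnSum m n rest (λ i → V (suc i)) (λ r t → refl)) ⟩
    detN (suc n) (setFirstColumn (V 0) M) + ∑ m (λ i → detN (suc n) (setFirstColumn (V (suc i)) rest))
      ≈⟨ +-congˡ (∑-cong m (λ i _ → detN-cong (suc n) (rest-firstColumn (V (suc i))))) ⟩
    detN (suc n) (setFirstColumn (V 0) M) + ∑ m (λ i → detN (suc n) (setFirstColumn (V (suc i)) M)) ∎
    where
    rest : Mat
    rest = setFirstColumn (λ r → ∑ m (λ i → V (suc i) r)) M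
    other-columns : ∀ v r c → r < suc n → c < suc n → c ≢ 0 → setFirstColumn v M r c ≈ M r c
    other-columns v r zero _ _ ne = ⊥-elim (ne P.refl)
    other-columns v r (suc c) _ _ _ = refl
    rest-firstColumn : ∀ v r c → r < suc n → c < suc n → setFirstColumn v rest r c ≈ setFirstColumn v M r c
    rest-firstColumn v r zero _ _ = refl
    rest-firstColumn v r (suc c) _ _ = refl

  δ : ℕ → ℕ → Carrier
  δ zero zero = 1#
  δ zero (suc r) = 0#
  δ (suc i) zero = 0#
  δ (suc i) (suc r) = δ i r

  δ-self : ∀ i → δ i i ≡ 1#
  δ-self zero = P.refl
  δ-self (suc i) = δ-self i

  δ-ne : ∀ i r → i ≢ r → δ i r ≡ 0#
  δ-ne zero zero ne = ⊥-elim (ne P.refl)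
  δ-ne zero (suc r) ne = P.refl
  δ-ne (suc i) zero ne = P.refl
  δ-ne (suc i) (suc r) ne = δ-ne i r (λ e → ne (P.cong suc e))

  detN-expandFirstColumn : ∀ n M → detN (suc n) M ≈ ∑ (suc n) (λ i → sgn i * (M i 0 * detN n (λ r c → M (punchIn i r) (suc c))))
  detN-expandFirstColumn n M = begin
    detN (suc n) M ≈⟨ detN-firstColumnSum (suc n) n M (λ i r → δ i r * M i 0) firstColumn ⟩
    ∑ (suc n) (λ i → detN (suc n) (setFirstColumn (λ r → δ i r * M i 0) M)) ≈⟨ ∑-cong (suc n) term ⟩
    ∑ (suc n) (λ i → sgn i * (M i 0 * detN n (λ r c → M (punchIn i r) (suc c)))) ∎
    where
    firstColumn : ∀ r → r < suc n → M r 0 ≈ ∑ (suc n) (λ i → δ i r * M i 0)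
    firstColumn r t = sym (trans (∑-single (suc n) (λ i → δ i r * M i 0) r t
        (λ i _ ne → trans (*-congʳ (reflexive (δ-ne i r ne))) (zeroˡ _)))
      (trans (*-congʳ (reflexive (δ-self r))) (*-identityˡ _)))
    term : ∀ i → i < suc n → detN (suc n) (setFirstColumn (λ r → δ i r * M i 0) M) ≈ sgn i * (M i 0 * detN n (λ r c → M (punchIn i r) (suc c)))
    term i t = begin
      detN (suc n) (setFirstColumn (λ r → δ i r * M i 0) M) ≈⟨ detN-firstColumnLinear n _ (setFirstColumn (λ _ → 0#) M) unitColumn (M i 0) (other-columns _) (other-columns _)
           (λ r _ → trans (*-comm _ _) (sym (+-identityˡ _))) ⟩
      detN (suc n) (setFirstColumn (λ _ → 0#) M) + M i 0 * detN (suc n) unitColumn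
        ≈⟨ +-congʳ (detN-zeroFirstColumn n (setFirstColumn (λ _ → 0#) M) (λ r _ → refl)) ⟩
      0# + M i 0 * detN (suc n) unitColumn ≈⟨ +-identityˡ _ ⟩
      M i 0 * detN (suc n) unitColumn ≈⟨ *-congˡ (detN-unrotateTo n i unitColumn (≤-pred t)) ⟩
      M i 0 * (sgn i * detN (suc n) (λ r c → unitColumn (rotateTo i r) c)) ≈⟨ *-congˡ (*-congˡ (detN-blockFirstColumn n (λ r c → unitColumn (rotateTo i r) c)
          (λ r _ → reflexive (δ-ne i (punchIn i r) (λ eq → punchIn-≢ i r (P.sym eq)))))) ⟩
      M i 0 * (sgn i * (δ i i * detN n (λ r c → M (punchIn i r) (suc c))))
        ≈⟨ *-congˡ (*-congˡ (trans (*-congʳ (reflexive (δ-self i))) (*-identityˡ _))) ⟩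
      M i 0 * (sgn i * detN n (λ r c → M (punchIn i r) (suc c)))
        ≈⟨ solve 3 (λ m s d → m :* (s :* d) := s :* (m :* d)) refl _ _ _ ⟩
      sgn i * (M i 0 * detN n (λ r c → M (punchIn i r) (suc c))) ∎
      where
      unitColumn : Mat
      unitColumn = setFirstColumn (δ i) M
      other-columns : ∀ v r c → r < suc n → c < suc n → c ≢ 0 → setFirstColumn v M r c ≈ setFirstColumn (λ r → δ i r * M i 0) M r c
      other-columns v r zero _ _ ne = ⊥-elim (ne P.refl)
      other-columns v r (suc c) _ _ _ = refl

  detN-transpose : ∀ n M → detN n (λ r c → M c r) ≈ detN n M
  detN-transpose zero M = refl
  detN-transpose (suc n) M = trans
        (∑-cong (suc n) (λ j _ → *-congˡ {sgn j} (*-congˡ {M j 0} (detN-transpose n (λ r c → M (punchIn j r) (suc c))))))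
        (sym (detN-expandFirstColumn n M))

  detN-addColumnMultiple : ∀ n i j (M N : Mat) a → i < n → j < n → i ≢ j →
    (∀ r c → r < n → c < n → c ≢ j → N r c ≈ M r c) →
    (∀ r → r < n → N r j ≈ M r j + a * M r i) → detN n N ≈ detN n M
  detN-addColumnMultiple n i j M N a p q ne hN hj = begin
    detN n N ≈⟨ sym (detN-transpose n N) ⟩
    detN n (λ r c → N c r)
      ≈⟨ detN-addRowMultiple n i j (λ r c → M c r) (λ r c → N c r) a p q ne (λ r c s t ne' → hN c r t s ne') hj ⟩
    detN n (λ r c → M c r) ≈⟨ detN-transpose n M ⟩
    detN n M ∎

  detN-expandSparseColumn : ∀ n i j M → i ≤ n → j ≤ n → (∀ r → r < suc n → r ≢ i → M r j ≈ 0#) →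
    detN (suc n) M ≈ sgn i * (sgn j * (M i j * detN n (λ r c → M (punchIn i r) (punchIn j c))))
  detN-expandSparseColumn n i j M p q h = begin
    detN (suc n) M ≈⟨ sym (detN-transpose (suc n) M) ⟩
    detN (suc n) (λ r c → M c r) ≈⟨ detN-expandSparseRow n j i (λ r c → M c r) q p h ⟩
    sgn j * (sgn i * (M i j * detN n (λ r c → M (punchIn i c) (punchIn j r))))
      ≈⟨ *-congˡ (*-congˡ (*-congˡ (detN-transpose n (λ r c → M (punchIn i r) (punchIn j c))))) ⟩
    sgn j * (sgn i * (M i j * detN n (λ r c → M (punchIn i r) (punchIn j c))))
      ≈⟨ solve 3 (λ a b x → a :* (b :* x) := b :* (a :* x)) refl _ _ _ ⟩
    sgn i * (sgn j * (M i j * detN n (λ r c → M (punchIn i r) (punchIn j c)))) ∎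

module CoefficientLists {c ℓ} (R : CommutativeRing c ℓ) where
  open RingSolver R
  open Multiples R
  open Lemma46 R using (coeffL; padd; pmul; rootPoly; deriv)
  open import Data.Nat using (ℕ; zero; suc; _<_; _≤_; s≤s; s<s)
  open import Data.List using (List; []; _∷_; map; length)
  import Data.Nat.Properties as NP
  import Relation.Binary.PropositionalEquality as P
  open import Relation.Binary.PropositionalEquality using (_≡_)

  shift : (ℕ → Carrier) → ℕ → Carrier
  shift f zero = 0#
  shift f (suc j) = f j

  coeffL-padd : ∀ A B i → coeffL (padd A B) i ≈ coeffL A i + coeffL B i
  coeffL-padd [] B i = sym (+-identityˡ _)
  coeffL-padd (a ∷ A) [] i = sym (+-identityʳ _)
  coeffL-padd (a ∷ A) (b ∷ B) zero = refl
  coeffL-padd (a ∷ A) (b ∷ B) (suc i) = coeffL-padd A B i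

  coeffL-map* : ∀ a L i → coeffL (map (a *_) L) i ≈ a * coeffL L i
  coeffL-map* a [] i = sym (zeroʳ a)
  coeffL-map* a (x ∷ L) zero = refl
  coeffL-map* a (x ∷ L) (suc i) = coeffL-map* a L i

  coeffL-neg : ∀ L i → coeffL (map -_ L) i ≈ - coeffL L i
  coeffL-neg [] i = sym -0#≈0#
  coeffL-neg (x ∷ L) zero = refl
  coeffL-neg (x ∷ L) (suc i) = coeffL-neg L i

  coeffL-pmul-cons : ∀ a A B i → coeffL (pmul (a ∷ A) B) i ≈ a * coeffL B i + shift (coeffL (pmul A B)) i
  coeffL-pmul-cons a A B zero = trans (coeffL-padd (map (a *_) B) (0# ∷ pmul A B) 0) (+-congʳ (coeffL-map* a B 0))
  coeffL-pmul-cons a A B (suc i) = trans (coeffL-padd (map (a *_) B) (0# ∷ pmul A B) (suc i)) (+-congʳ (coeffL-map* a B (suc i)))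

  coeffL-pmul-constant : ∀ a L i → coeffL (pmul (a ∷ []) L) i ≈ a * coeffL L i
  coeffL-pmul-constant a L i = trans (coeffL-pmul-cons a [] L i) (trans (+-congˡ (shift-zero i)) (+-identityʳ _))
    where
    shift-zero : ∀ i → shift (coeffL []) i ≈ 0#
    shift-zero zero = refl
    shift-zero (suc i) = refl

  coeffL-≥length : ∀ (L : List Carrier) j → length L ≤ j → coeffL L j ≡ 0#
  coeffL-≥length [] j p = P.refl
  coeffL-≥length (x ∷ L) (suc j) (s≤s p) = coeffL-≥length L j p

  coeffL-rootPoly-cons : ∀ t ts i → coeffL (rootPoly (t ∷ ts)) i ≈ shift (coeffL (rootPoly ts)) i - t * coeffL (rootPoly ts) i
  coeffL-rootPoly-cons t ts i = trans (coeffL-pmul-cons (- t) (1# ∷ []) (rootPoly ts) i)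
    (trans (+-congˡ (cs i)) (trans (+-comm _ _) (+-congˡ (sym (-‿distribˡ-* t _)))))
    where
    cs : ∀ i → shift (coeffL (pmul (1# ∷ []) (rootPoly ts))) i ≈ shift (coeffL (rootPoly ts)) i
    cs zero = refl
    cs (suc i) = trans (coeffL-pmul-constant 1# (rootPoly ts) i) (*-identityˡ _)

  coeffL-rootPoly-above : ∀ ts i → length ts < i → coeffL (rootPoly ts) i ≈ 0#
  coeffL-rootPoly-above [] (suc i) p = refl
  coeffL-rootPoly-above (t ∷ ts) (suc i) (s<s p) = trans (coeffL-rootPoly-cons t ts (suc i))
    (trans (+-cong (coeffL-rootPoly-above ts i p) (-‿cong (trans (*-congˡ (coeffL-rootPoly-above ts (suc i) (NP.m<n⇒m<1+n p))) (zeroʳ t))))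
      (trans (+-identityˡ _) -0#≈0#))

  coeffL-rootPoly-leading : ∀ ts → coeffL (rootPoly ts) (length ts) ≈ 1#
  coeffL-rootPoly-leading [] = refl
  coeffL-rootPoly-leading (t ∷ ts) = trans (coeffL-rootPoly-cons t ts (suc (length ts)))
    (trans (+-cong (coeffL-rootPoly-leading ts) (-‿cong (trans (*-congˡ (coeffL-rootPoly-above ts (suc (length ts)) (NP.n<1+n _))) (zeroʳ t))))
      (trans (+-congˡ -0#≈0#) (+-identityʳ _)))

  deriv-cong : ∀ {g h} → (∀ i → g i ≈ h i) → ∀ i → deriv g i ≈ deriv h i
  deriv-cong e i = nat·-cong (suc i) (e (suc i))

module Sylvester {c ℓ} (R : CommutativeRing c ℓ) where
  open RingSolver R
  open Multiples R
  open Determinants R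
  open CoefficientLists R
  open Indices
  open Lemma46 R using (band; coeffL; rootPoly; pow)
  open import Data.Nat using (ℕ; zero; suc; _<_; _≤_; s≤s; s<s; _≤ᵇ_; _<ᵇ_; _∸_)
    renaming (_+_ to _+ℕ_; _*_ to _*ℕ_)
  open import Data.Nat.Properties using (≤-refl; <-trans; m<n⇒m<1+n; n<1+n; <-cmp; ≤-pred; m+n∸m≡n; ≤-trans; <⇒≤)
  import Data.Nat.Properties as NP
  open import Data.Bool using (true; false; if_then_else_; _∧_)
  open import Data.List using (List; []; _∷_; length)
  open import Relation.Binary.PropositionalEquality as P using (_≡_; _≢_)
  open import Data.Empty using (⊥-elim)
  open import Relation.Binary.Definitions using (tri<; tri≈; tri>)
  open import Data.Product using (_,_; _×_)
  open import Data.Sum using (inj₁; inj₂)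

  reverseCoeff : ℕ → (ℕ → Carrier) → ℕ → Carrier
  reverseCoeff m p i = if i ≤ᵇ m then p (m ∸ i) else 0#

  reverseCoeffShift : ℕ → (ℕ → Carrier) → ℕ → Carrier
  reverseCoeffShift m p zero = 0#
  reverseCoeffShift m p (suc i) = reverseCoeff m p i

  band-suc : ∀ m p r c → band m p (suc r) (suc c) ≡ band m p r c
  band-suc m p r c rewrite ≤ᵇ-suc r c | ≤ᵇ-suc c (r +ℕ m) | NP.+-suc m r = P.refl

  band-0 : ∀ m p r → band m p (suc r) 0 ≡ 0#
  band-0 m p r = P.refl

  band-base : ∀ m p c → band m p 0 c ≡ reverseCoeff m p c
  band-base m p c rewrite NP.+-identityʳ m = P.refl

  band-at : ∀ m p r i → band m p r (r +ℕ i) ≡ reverseCoeff m p i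
  band-at m p zero i = band-base m p i
  band-at m p (suc r) i = P.trans (band-suc m p r (r +ℕ i)) (band-at m p r i)

  band-below : ∀ m p r c → c < r → band m p r c ≡ 0#
  band-below m p (suc r) zero q = P.refl
  band-below m p (suc r) (suc c) (s<s q) = P.trans (band-suc m p r c) (band-below m p r c q)

  reverseCoeff-above : ∀ m p i → m < i → reverseCoeff m p i ≡ 0#
  reverseCoeff-above m p i q rewrite ≤ᵇ-false q = P.refl

  reverseCoeff-within : ∀ m p i → i ≤ m → reverseCoeff m p i ≡ p (m ∸ i)
  reverseCoeff-within m p i q rewrite ≤ᵇ-true q = P.refl

  band-far : ∀ m p r c → r +ℕ m < c → band m p r c ≡ 0#
  band-far m p r c q with NP.m≤n⇒∃[o]m+o≡n (NP.≤-trans (NP.m≤m+n r m) (<⇒≤ q))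
  ... | i , P.refl = P.trans (band-at m p r i) (reverseCoeff-above m p i (NP.+-cancelˡ-< r m i q))

  sylN : ℕ → ℕ → (ℕ → Carrier) → (ℕ → Carrier) → Mat
  sylN m k p q r c = if suc r ≤ᵇ k then band m p r c else band k q (r ∸ k) c

  syl-top : ∀ m k p q r c → r < k → sylN m k p q r c ≡ band m p r c
  syl-top m k p q r c lt rewrite ≤ᵇ-true lt = P.refl

  syl-bot : ∀ m k p q r c → k ≤ r → sylN m k p q r c ≡ band k q (r ∸ k) c
  syl-bot m k p q r c le rewrite ≤ᵇ-false (s≤s le) = P.refl

  band-cong : ∀ m {p q} → (∀ i → p i ≈ q i) → ∀ r col → band m p r col ≈ band m q r col
  band-cong m e r col with (r ≤ᵇ col) ∧ (col ≤ᵇ r +ℕ m)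
  ... | true = e _
  ... | false = refl

  sylN-cong : ∀ m k {p p' q q'} → (∀ i → p i ≈ p' i) → (∀ i → q i ≈ q' i) → ∀ r col → sylN m k p q r col ≈ sylN m k p' q' r col
  sylN-cong m k ep eq r col with suc r ≤ᵇ k
  ... | true = band-cong m ep r col
  ... | false = band-cong k eq (r ∸ k) col

  subtractNextRow : Carrier → Mat → ℕ → Mat
  subtractNextRow s M t r c = if r <ᵇ t then M r c - s * M (suc r) c else M r c

  subtractNextRow-below : ∀ s M t r c → r < t → subtractNextRow s M t r c ≡ M r c - s * M (suc r) c
  subtractNextRow-below s M t r c lt rewrite <ᵇ-true lt = P.refl

  subtractNextRow-above : ∀ s M t r c → t ≤ r → subtractNextRow s M t r c ≡ M r c
  subtractNextRow-above s M t r c le rewrite <ᵇ-false le = P.refl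

  detN-subtractNextRows : ∀ n s M t → t < n → detN n (subtractNextRow s M t) ≈ detN n M
  detN-subtractNextRows n s M zero p = detN-cong n (λ r c _ _ → refl)
  detN-subtractNextRows n s M (suc t) p = trans
        (detN-addRowMultiple n (suc t) t (subtractNextRow s M t) (subtractNextRow s M (suc t)) (- s) p
           (<-trans (n<1+n t) p)
           (λ e → NP.1+n≢n e) off on)
        (detN-subtractNextRows n s M t (<-trans (n<1+n t) p))
    where
    off : ∀ r c → r < n → c < n → r ≢ t → subtractNextRow s M (suc t) r c ≈ subtractNextRow s M t r c
    off r c _ _ ne rewrite <ᵇ-suc-ne r t ne = refl
    on : ∀ c → c < n → subtractNextRow s M (suc t) t c ≈ subtractNextRow s M t t c + - s * subtractNextRow s M t (suc t) c
    on c _ rewrite <ᵇ-true (n<1+n t) | <ᵇ-false (≤-refl {t}) | <ᵇ-false (NP.n≤1+n t) = +-congˡ (-‿distribˡ-* s _)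

  hornerScan : Carrier → (ℕ → Carrier) → ℕ → Carrier
  hornerScan s v zero = v zero
  hornerScan s v (suc c) = v (suc c) + s * hornerScan s v c

  hornerScanUpTo : Carrier → Mat → ℕ → Mat
  hornerScanUpTo s M t r c = if c <ᵇ t then hornerScan s (M r) c else M r c

  detN-hornerScanUpTo : ∀ n s M t → t ≤ n → detN n (hornerScanUpTo s M t) ≈ detN n M
  detN-hornerScanUpTo n s M zero p = detN-cong n (λ r c _ _ → refl)
  detN-hornerScanUpTo n s M (suc zero) p = detN-cong n same-entries
    where
    same-entries : ∀ r c → r < n → c < n → hornerScanUpTo s M 1 r c ≈ M r c
    same-entries r zero _ _ = refl
    same-entries r (suc c) _ _ = refl
  detN-hornerScanUpTo n s M (suc (suc t)) p =
    trans (detN-addColumnMultiple n t (suc t) (hornerScanUpTo s M (suc t)) (hornerScanUpTo s M (suc (suc t))) s (<-trans (n<1+n t) p) p (λ eq → NP.1+n≢n (P.sym eq)) off on)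
          (detN-hornerScanUpTo n s M (suc t) (<⇒≤ p))
    where
    off : ∀ r c → r < n → c < n → c ≢ suc t → hornerScanUpTo s M (suc (suc t)) r c ≈ hornerScanUpTo s M (suc t) r c
    off r c _ _ ne rewrite <ᵇ-suc-ne c (suc t) ne = refl
    on : ∀ r → r < n → hornerScanUpTo s M (suc (suc t)) r (suc t) ≈ hornerScanUpTo s M (suc t) r (suc t) + s * hornerScanUpTo s M (suc t) r t
    on r _ rewrite <ᵇ-true (n<1+n t) | <ᵇ-false (≤-refl {t}) = refl

  detN-hornerScan : ∀ n s M → detN n (λ r c → hornerScan s (M r) c) ≈ detN n M
  detN-hornerScan n s M = trans (detN-cong n scan-entries) (detN-hornerScanUpTo n s M n ≤-refl)
    where
    scan-entries : ∀ r c → r < n → c < n → hornerScan s (M r) c ≈ hornerScanUpTo s M n r c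
    scan-entries r c _ q rewrite <ᵇ-true q = refl

  hornerScan-cong : ∀ s {v w} → (∀ c → v c ≈ w c) → ∀ c → hornerScan s v c ≈ hornerScan s w c
  hornerScan-cong s h zero = h zero
  hornerScan-cong s h (suc c) = +-cong (h (suc c)) (*-congˡ (hornerScan-cong s h c))

  hornerScan-inverse : ∀ (s : Carrier) (v w : ℕ → Carrier) → v 0 ≈ w 0 → (∀ c → v (suc c) ≈ w (suc c) - s * w c) → ∀ c → hornerScan s v c ≈ w c
  hornerScan-inverse s v w h0 hs zero = h0
  hornerScan-inverse s v w h0 hs (suc c) = trans (+-cong (hs c) (*-congˡ (hornerScan-inverse s v w h0 hs c)))
    (solve 3 (λ a b x → (a :- x :* b) :+ x :* b := a) refl _ _ _)

  hornerScan-zeroPrefix : ∀ s v k → (∀ c → c < k → v c ≈ 0#) → ∀ c → c < k → hornerScan s v c ≈ 0#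
  hornerScan-zeroPrefix s v k h zero q = h zero q
  hornerScan-zeroPrefix s v k h (suc c) q = trans (+-cong (h (suc c) q) (*-congˡ (hornerScan-zeroPrefix s v k h c (<-trans (n<1+n c) q))))
    (trans (+-identityˡ _) (zeroʳ s))

  hornerDesc : ℕ → (ℕ → Carrier) → Carrier → ℕ → Carrier
  hornerDesc m p s zero = p m
  hornerDesc m p s (suc i) = p (m ∸ suc i) + s * hornerDesc m p s i

  evalDesc : ℕ → (ℕ → Carrier) → Carrier → Carrier
  evalDesc m p s = hornerDesc m p s m

  hornerScan-band : ∀ m p s k i → i ≤ m → hornerScan s (band m p k) (k +ℕ i) ≈ hornerDesc m p s i
  hornerScan-band m p s zero zero q = reflexive (band-base m p 0)
  hornerScan-band m p s (suc k) zero q = begin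
    band m p (suc k) (suc (k +ℕ 0)) + s * hornerScan s (band m p (suc k)) (k +ℕ 0) ≈⟨ +-cong (reflexive (band-at m p (suc k) 0))
       (*-congˡ (hornerScan-zeroPrefix s _ (suc k) (λ c lt → reflexive (band-below m p (suc k) c lt)) (k +ℕ 0) (s≤s (NP.≤-reflexive (NP.+-identityʳ k))))) ⟩
    reverseCoeff m p 0 + s * 0# ≈⟨ trans (+-congˡ (zeroʳ s)) (+-identityʳ _) ⟩
    p m ∎
  hornerScan-band m p s k (suc i) q rewrite NP.+-suc k i =
    +-cong (trans (reflexive (P.trans (P.cong (band m p k) (P.sym (NP.+-suc k i))) (band-at m p k (suc i)))) (reflexive (reverseCoeff-within m p (suc i) q))) (*-congˡ (hornerScan-band m p s k i (<⇒≤ q)))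

  band-linearFactor : ∀ K k q q₁ s → (∀ i → reverseCoeff K q i ≈ reverseCoeff k q₁ i - s * reverseCoeffShift k q₁ i) →
    ∀ u → (band K q u 0 ≈ band k q₁ u 0 - s * 0#) × (∀ c → band K q u (suc c) ≈ band k q₁ u (suc c) - s * band k q₁ u c)
  band-linearFactor K k q q₁ s h zero = trans (reflexive (band-base K q 0)) (trans (h 0) (+-congʳ (sym (reflexive (band-base k q₁ 0))))) ,
    λ c → trans (reflexive (band-base K q (suc c))) (trans (h (suc c)) (sym (+-cong (reflexive (band-base k q₁ (suc c))) (-‿cong (*-congˡ (reflexive (band-base k q₁ c)))))))
  band-linearFactor K k q q₁ s h (suc u) = firstColumn , laterColumns
    where
    open import Data.Product using (proj₁; proj₂)
    ih = band-linearFactor K k q q₁ s h u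
    firstColumn : band K q (suc u) 0 ≈ band k q₁ (suc u) 0 - s * 0#
    firstColumn = sym (trans (+-congˡ (-‿cong (zeroʳ s))) (trans (+-congˡ -0#≈0#) (+-identityʳ _)))
    laterColumns : ∀ c → band K q (suc u) (suc c) ≈ band k q₁ (suc u) (suc c) - s * band k q₁ (suc u) c
    laterColumns zero = trans (reflexive (band-suc K q u 0))
          (trans (proj₁ ih)
             (sym (+-cong (reflexive (band-suc k q₁ u 0)) (-‿cong (*-congˡ (reflexive (band-0 k q₁ u)))))))
    laterColumns (suc c) = trans (reflexive (band-suc K q u (suc c)))
          (trans (proj₂ ih c)
             (sym (+-cong (reflexive (band-suc k q₁ u (suc c))) (-‿cong (*-congˡ (reflexive (band-suc k q₁ u c)))))))

  -- One step of the Poisson formula for q = (x - s) q₁.  Subtracting s times the next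
  -- row from each of the first k rows and then taking Horner running sums along every
  -- row leaves the other p-rows unchanged, divides the q-rows by (x - s), and clears
  -- the last column except for the entry p(s) in row k.
  module PeelRoot (m k : ℕ) (p q q₁ : ℕ → Carrier) (s : Carrier)
           (h : ∀ i → reverseCoeff (suc k) q i ≈ reverseCoeff k q₁ i - s * reverseCoeffShift k q₁ i) where
    open import Data.Product using (proj₁; proj₂)
    N' : ℕ
    N' = m +ℕ k
    S : Mat
    S = sylN m (suc k) p q
    D : Mat
    D = subtractNextRow s S k
    F : Mat
    F r c = hornerScan s (D r) c

    F-upperRows : ∀ r → r < k → ∀ c → F r c ≈ band m p r c
    F-upperRows r lt c = trans (hornerScan-cong s D-row c) (hornerScan-inverse s v (band m p r) column₀ laterColumns c)
      where
      v : ℕ → Carrier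
      v c = band m p r c - s * band m p (suc r) c
      D-row : ∀ c → D r c ≈ v c
      D-row c = trans (reflexive (subtractNextRow-below s S k r c lt))
            (+-cong (reflexive (syl-top m (suc k) p q r c (m<n⇒m<1+n lt)))
               (-‿cong (*-congˡ (reflexive (syl-top m (suc k) p q (suc r) c (s<s lt))))))
      column₀ : v 0 ≈ band m p r 0
      column₀ = trans (+-congˡ (trans (-‿cong (zeroʳ s)) -0#≈0#)) (+-identityʳ _)
      laterColumns : ∀ c → v (suc c) ≈ band m p r (suc c) - s * band m p r c
      laterColumns c = +-congˡ (-‿cong (*-congˡ (reflexive (band-suc m p r c))))

    F-lowerRows : ∀ u c → F (suc k +ℕ u) c ≈ band k q₁ u c
    F-lowerRows u c = trans (hornerScan-cong s D-row c) (hornerScan-inverse s (band (suc k) q u) (band k q₁ u) column₀ (proj₂ rows) c)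
      where
      rows = band-linearFactor (suc k) k q q₁ s h u
      D-row : ∀ c → D (suc k +ℕ u) c ≈ band (suc k) q u c
      D-row c = trans (reflexive (subtractNextRow-above s S k (suc k +ℕ u) c (NP.≤-trans (NP.n≤1+n k) (NP.m≤m+n (suc k) u))))
            (trans (reflexive (syl-bot m (suc k) p q (suc k +ℕ u) c (NP.m≤m+n (suc k) u)))
               (reflexive (P.cong (λ x → band (suc k) q x c) (m+n∸m≡n (suc k) u))))
      column₀ : band (suc k) q u 0 ≈ band k q₁ u 0
      column₀ = trans (proj₁ rows) (trans (+-congˡ (trans (-‿cong (zeroʳ s)) -0#≈0#)) (+-identityʳ _))

    F-pivot : F k N' ≈ evalDesc m p s
    F-pivot = begin
      hornerScan s (D k) (m +ℕ k) ≈⟨ hornerScan-cong s D-pivotRow (m +ℕ k) ⟩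
      hornerScan s (band m p k) (m +ℕ k) ≡⟨ P.cong (hornerScan s (band m p k)) (NP.+-comm m k) ⟩
      hornerScan s (band m p k) (k +ℕ m) ≈⟨ hornerScan-band m p s k m ≤-refl ⟩
      hornerDesc m p s m ∎
      where
      D-pivotRow : ∀ c → D k c ≈ band m p k c
      D-pivotRow c = trans (reflexive (subtractNextRow-above s S k k c ≤-refl)) (reflexive (syl-top m (suc k) p q k c (n<1+n k)))

    F-lastColumn : ∀ r → r < suc N' → r ≢ k → F r N' ≈ 0#
    F-lastColumn r rn ne with <-cmp r k
    ... | tri< lt _ _ = trans (F-upperRows r lt N') (reflexive (band-far m p r N'
            (P.subst (r +ℕ m <_) (NP.+-comm k m) (NP.+-monoˡ-< m lt))))
    ... | tri≈ _ e _ = ⊥-elim (ne e)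
    ... | tri> _ _ gt with NP.m≤n⇒∃[o]m+o≡n gt
    ... | u , P.refl = trans (F-lowerRows u N') (reflexive (band-far k q₁ u N' (NP.+-monoˡ-< k u<m)))
      where
      u<m : u < m
      u<m = NP.+-cancelʳ-< k u m (P.subst (_< m +ℕ k) (NP.+-comm k u) (≤-pred rn))

    F-minor : ∀ r c → r < N' → c < N' → F (punchIn k r) (punchIn N' c) ≈ sylN m k p q₁ r c
    F-minor r c rn cn rewrite punchIn-below N' c cn with <-cmp r k
    ... | tri< lt _ _ rewrite punchIn-below k r lt = trans (F-upperRows r lt c) (sym (reflexive (syl-top m k p q₁ r c lt)))
    ... | tri≈ _ P.refl _ rewrite punchIn-above k r ≤-refl = trans (reflexive (P.cong (λ x → F x c) (P.sym index)))
          (trans (F-lowerRows (r ∸ k) c) (sym (reflexive (syl-bot m k p q₁ r c ≤-refl))))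
      where
      index : suc k +ℕ (r ∸ k) ≡ suc r
      index = P.cong suc (NP.m+[n∸m]≡n (≤-refl {k}))
    ... | tri> _ _ gt rewrite punchIn-above k r (<⇒≤ gt) = trans (reflexive (P.cong (λ x → F x c) (P.sym index)))
          (trans (F-lowerRows (r ∸ k) c) (sym (reflexive (syl-bot m k p q₁ r c (<⇒≤ gt)))))
      where
      index : suc k +ℕ (r ∸ k) ≡ suc r
      index = P.cong suc (NP.m+[n∸m]≡n (<⇒≤ gt))

    detN-sylvester-peelRoot : detN (suc N') S ≈ sgn m * (evalDesc m p s * detN N' (sylN m k p q₁))
    detN-sylvester-peelRoot = begin
      detN (suc N') S ≈⟨ sym (detN-subtractNextRows (suc N') s S k (s≤s (NP.m≤n+m k m))) ⟩
      detN (suc N') D ≈⟨ sym (detN-hornerScan (suc N') s D) ⟩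
      detN (suc N') F ≈⟨ detN-expandSparseColumn N' k N' F (NP.m≤n+m k m) ≤-refl F-lastColumn ⟩
      sgn k * (sgn N' * (F k N' * detN N' (λ r c → F (punchIn k r) (punchIn N' c))))
        ≈⟨ *-congˡ (*-congˡ (*-cong F-pivot (detN-cong N' F-minor))) ⟩
      sgn k * (sgn (m +ℕ k) * (evalDesc m p s * detN N' (sylN m k p q₁))) ≈⟨ *-congˡ (*-congʳ (sgn-+ m k)) ⟩
      sgn k * ((sgn m * sgn k) * (evalDesc m p s * detN N' (sylN m k p q₁)))
        ≈⟨ solve 3 (λ a b x → a :* ((b :* a) :* x) := b :* ((a :* a) :* x)) refl _ _ _ ⟩
      sgn m * ((sgn k * sgn k) * (evalDesc m p s * detN N' (sylN m k p q₁)))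
        ≈⟨ *-congˡ (trans (*-congʳ (sgn-square k)) (*-identityˡ _)) ⟩
      sgn m * (evalDesc m p s * detN N' (sylN m k p q₁)) ∎

  detN-diagonalBand : ∀ n (q : ℕ → Carrier) → detN n (λ r c → band 0 q r c) ≈ pow (q 0) n
  detN-diagonalBand zero q = refl
  detN-diagonalBand (suc n) q = trans (detN-blockFirstColumn n (λ r c → band 0 q r c) (λ r _ → refl))
    (*-congˡ (trans (detN-cong n (λ r c _ _ → reflexive (band-suc 0 q r c))) (detN-diagonalBand n q)))

  reverseCoeff-linearFactor : ∀ k (q q₁ : ℕ → Carrier) t → (∀ j → q j ≈ shift q₁ j - t * q₁ j) → (∀ j → k < j → q₁ j ≈ 0#) →
    ∀ i → reverseCoeff (suc k) q i ≈ reverseCoeff k q₁ i - t * reverseCoeffShift k q₁ i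
  reverseCoeff-linearFactor k q q₁ t hq hz i with <-cmp i (suc k)
  ... | tri< lt _ _ = begin
    reverseCoeff (suc k) q i ≡⟨ reverseCoeff-within (suc k) q i (<⇒≤ lt) ⟩
    q (suc k ∸ i) ≡⟨ P.cong q (NP.+-∸-assoc 1 (≤-pred lt)) ⟩
    q (suc (k ∸ i)) ≈⟨ hq (suc (k ∸ i)) ⟩
    q₁ (k ∸ i) - t * q₁ (suc (k ∸ i))
      ≈⟨ +-cong (sym (reflexive (reverseCoeff-within k q₁ i (≤-pred lt)))) (-‿cong (*-congˡ (shifted-last i lt))) ⟩
    reverseCoeff k q₁ i - t * reverseCoeffShift k q₁ i ∎
    where
    shifted-last : ∀ i → i < suc k → q₁ (suc (k ∸ i)) ≈ reverseCoeffShift k q₁ i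
    shifted-last zero _ = hz (suc k) (n<1+n k)
    shifted-last (suc i) (s<s p) = trans (reflexive (P.cong q₁ (P.sym (∸-suc k i p)))) (sym (reflexive (reverseCoeff-within k q₁ i (<⇒≤ p))))
  ... | tri≈ _ P.refl _ = begin
    reverseCoeff (suc k) q (suc k) ≡⟨ reverseCoeff-within (suc k) q (suc k) ≤-refl ⟩
    q (k ∸ k) ≡⟨ P.cong q (NP.n∸n≡0 k) ⟩
    q 0 ≈⟨ hq 0 ⟩
    0# - t * q₁ 0
      ≈⟨ +-cong (sym (reflexive (reverseCoeff-above k q₁ (suc k) (n<1+n k))))
           (-‿cong
              (*-congˡ
                 (sym (trans (reflexive (reverseCoeff-within k q₁ k ≤-refl)) (reflexive (P.cong q₁ (NP.n∸n≡0 k))))))) ⟩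
    reverseCoeff k q₁ (suc k) - t * reverseCoeffShift k q₁ (suc k) ∎
  ... | tri> _ _ gt = begin
    reverseCoeff (suc k) q i ≡⟨ reverseCoeff-above (suc k) q i gt ⟩
    0# ≈⟨ sym (trans (+-congˡ (trans (-‿cong (zeroʳ t)) -0#≈0#)) (+-identityʳ 0#)) ⟩
    0# - t * 0#
      ≈⟨ +-cong (sym (reflexive (reverseCoeff-above k q₁ i (<-trans (n<1+n k) gt))))
           (-‿cong (*-congˡ (sym (shifted-beyond i gt)))) ⟩
    reverseCoeff k q₁ i - t * reverseCoeffShift k q₁ i ∎
    where
    shifted-beyond : ∀ i → suc k < i → reverseCoeffShift k q₁ i ≈ 0#
    shifted-beyond (suc i) (s<s p) = reflexive (reverseCoeff-above k q₁ i p)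

  sylvester-poisson : ∀ m (ss : List Carrier) (p q : ℕ → Carrier) (cc : Carrier) → (∀ i → q i ≈ cc * coeffL (rootPoly ss) i) →
    detN (m +ℕ length ss) (sylN m (length ss) p q) ≈ sgn (m *ℕ length ss) * (pow cc m * ∏ (evalDesc m p) ss)
  sylvester-poisson m [] p q cc h rewrite NP.+-identityʳ m | NP.*-zeroʳ m = begin
    detN m (λ r c → band 0 q r c) ≈⟨ detN-diagonalBand m q ⟩
    pow (q 0) m ≈⟨ pow-cong m (trans (h 0) (*-identityʳ cc)) ⟩
    pow cc m ≈⟨ sym (trans (*-identityˡ _) (*-identityʳ _)) ⟩
    1# * (pow cc m * 1#) ∎
  sylvester-poisson m (t ∷ ts) p q cc h rewrite NP.+-suc m (length ts) | NP.*-suc m (length ts) = begin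
    detN (suc (m +ℕ k)) (sylN m (suc k) p q)
      ≈⟨ PeelRoot.detN-sylvester-peelRoot m k p q q₁ t (reverseCoeff-linearFactor k q q₁ t q-factor q₁-above) ⟩
    sgn m * (evalDesc m p t * detN (m +ℕ k) (sylN m k p q₁))
      ≈⟨ *-congˡ (*-congˡ (sylvester-poisson m ts p q₁ cc (λ i → refl))) ⟩
    sgn m * (evalDesc m p t * (sgn (m *ℕ k) * (pow cc m * ∏ (evalDesc m p) ts)))
      ≈⟨ solve 5 (λ a e b x y → a :* (e :* (b :* (x :* y))) := (a :* b) :* (x :* (e :* y))) refl _ _ _ _ _ ⟩
    (sgn m * sgn (m *ℕ k)) * (pow cc m * (evalDesc m p t * ∏ (evalDesc m p) ts)) ≈⟨ *-congʳ (sym (sgn-+ m (m *ℕ k))) ⟩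
    sgn (m +ℕ m *ℕ k) * (pow cc m * (evalDesc m p t * ∏ (evalDesc m p) ts)) ∎
    where
    k = length ts
    q₁ : ℕ → Carrier
    q₁ i = cc * coeffL (rootPoly ts) i
    q-factor : ∀ j → q j ≈ shift q₁ j - t * q₁ j
    q-factor zero = trans (h 0)
          (trans (*-congˡ (coeffL-rootPoly-cons t ts 0))
             (solve 3 (λ c t x → c :* (:0 :- t :* x) := :0 :- t :* (c :* x)) refl cc t _))
    q-factor (suc j) = trans (h (suc j))
          (trans (*-congˡ (coeffL-rootPoly-cons t ts (suc j)))
             (solve 4 (λ c t y x → c :* (y :- t :* x) := c :* y :- t :* (c :* x)) refl cc t _ _))
    q₁-above : ∀ j → k < j → q₁ j ≈ 0#
    q₁-above j p = trans (*-congˡ (coeffL-rootPoly-above ts j p)) (zeroʳ cc)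

  detN-rotateLast^ : ∀ N' j M → detN (suc N') (λ r c → M (rotateLast^ N' j r) c) ≈ sgn (j *ℕ N') * detN (suc N') M
  detN-rotateLast^ N' zero M = sym (*-identityˡ (detN (suc N') M))
  detN-rotateLast^ N' (suc j) M = begin
    detN (suc N') (λ r c → M (rotateLast^ N' j (rotateTo N' r)) c)
      ≈⟨ detN-rotateTo N' N' (λ r c → M (rotateLast^ N' j r) c) ≤-refl ⟩
    sgn N' * detN (suc N') (λ r c → M (rotateLast^ N' j r) c) ≈⟨ *-congˡ (detN-rotateLast^ N' j M) ⟩
    sgn N' * (sgn (j *ℕ N') * detN (suc N') M) ≈⟨ sym (*-assoc _ _ _) ⟩
    (sgn N' * sgn (j *ℕ N')) * detN (suc N') M ≈⟨ *-congʳ (sym (sgn-+ N' (j *ℕ N'))) ⟩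
    sgn (N' +ℕ j *ℕ N') * detN (suc N') M ∎

  sylN-swap≡rotate : ∀ m′ k p q r c → r < suc (m′ +ℕ k) →
    sylN k (suc m′) q p r c ≡ sylN (suc m′) k p q (rotateLast^ (m′ +ℕ k) (suc m′) r) c
  sylN-swap≡rotate m′ k p q r c r<N with NP.<-≤-connex r (suc m′)
  ... | inj₁ r<m = P.trans (syl-top k m q p r c r<m) (P.sym (P.trans
          (P.cong (λ x → sylN m k p q x c) (P.trans rotated (P.trans (if-t (<ᵇ-true r<m)) (P.cong (_+ℕ r) (NP.m+n∸m≡n m k)))))
          (P.trans (syl-bot m k p q (k +ℕ r) c (NP.m≤m+n k r)) (P.cong (λ x → band k q x c) (NP.m+n∸m≡n k r)))))
    where
    m = suc m′
    rotated = rotateLast^-formula (m′ +ℕ k) m r (s≤s (NP.m≤m+n m′ k)) r<N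
  ... | inj₂ m≤r = P.trans (syl-bot k m q p r c m≤r) (P.sym (P.trans
          (P.cong (λ x → sylN m k p q x c) (P.trans rotated (if-f (<ᵇ-false m≤r))))
          (syl-top m k p q (r ∸ m) c r∸m<k)))
    where
    m = suc m′
    rotated = rotateLast^-formula (m′ +ℕ k) m r (s≤s (NP.m≤m+n m′ k)) r<N
    r∸m<k : r ∸ m < k
    r∸m<k = NP.+-cancelˡ-< m (r ∸ m) k (P.subst (_< m +ℕ k) (P.sym (NP.m+[n∸m]≡n m≤r)) r<N)

  sgn-[1+m]*[m+k] : ∀ m k → sgn (suc m *ℕ (m +ℕ k)) ≈ sgn (suc m *ℕ k)
  sgn-[1+m]*[m+k] m k = begin
    sgn ((m +ℕ k) +ℕ m *ℕ (m +ℕ k))             ≡⟨ P.cong sgn (exponent m k) ⟩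
    sgn ((k +ℕ m *ℕ k) +ℕ (m +ℕ m *ℕ m))       ≈⟨ sgn-+ (k +ℕ m *ℕ k) (m +ℕ m *ℕ m) ⟩
    sgn (k +ℕ m *ℕ k) * sgn (m +ℕ m *ℕ m)
      ≈⟨ *-congˡ (trans (sgn-+ m _) (trans (*-congˡ (sgn-n*n m)) (sgn-square m))) ⟩
    sgn (k +ℕ m *ℕ k) * 1#                     ≈⟨ *-identityʳ _ ⟩
    sgn (suc m *ℕ k)                           ∎
    where
    open import Data.Nat.Tactic.RingSolver using (solve-∀)
    exponent : ∀ a k → (a +ℕ k) +ℕ a *ℕ (a +ℕ k) ≡ (k +ℕ a *ℕ k) +ℕ (a +ℕ a *ℕ a)
    exponent = solve-∀

  detN-sylvester-swap : ∀ m k p q → detN (m +ℕ k) (sylN k m q p) ≈ sgn (m *ℕ k) * detN (m +ℕ k) (sylN m k p q)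
  detN-sylvester-swap zero k p q =
    trans (detN-cong k (λ r c r<k _ → reflexive (P.sym (syl-top 0 k p q r c r<k)))) (sym (*-identityˡ _))
  detN-sylvester-swap (suc m′) k p q = begin
    detN (suc N) (sylN k (suc m′) q p)
      ≈⟨ detN-cong (suc N) (λ r c r<N _ → reflexive (sylN-swap≡rotate m′ k p q r c r<N)) ⟩
    detN (suc N) (λ r c → sylN (suc m′) k p q (rotateLast^ N (suc m′) r) c)
      ≈⟨ detN-rotateLast^ N (suc m′) (sylN (suc m′) k p q) ⟩
    sgn (suc m′ *ℕ N) * detN (suc N) (sylN (suc m′) k p q)  ≈⟨ *-congʳ (sgn-[1+m]*[m+k] m′ k) ⟩
    sgn (suc m′ *ℕ k) * detN (suc N) (sylN (suc m′) k p q)  ∎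
    where
    N = m′ +ℕ k

  sylvester-poisson′ : ∀ m (ss : List Carrier) (p q : ℕ → Carrier) (cc : Carrier) → (∀ i → p i ≈ cc * coeffL (rootPoly ss) i) →
    detN (length ss +ℕ m) (sylN (length ss) m p q) ≈ pow cc m * ∏ (evalDesc m q) ss
  sylvester-poisson′ m ss p q cc h rewrite NP.+-comm (length ss) m = begin
    detN (m +ℕ length ss) (sylN (length ss) m p q) ≈⟨ detN-sylvester-swap m (length ss) q p ⟩
    sgn (m *ℕ length ss) * detN (m +ℕ length ss) (sylN m (length ss) q p) ≈⟨ *-congˡ (sylvester-poisson m ss q p cc h) ⟩
    sgn (m *ℕ length ss) * (sgn (m *ℕ length ss) * (pow cc m * ∏ (evalDesc m q) ss)) ≈⟨ sym (*-assoc _ _ _) ⟩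
    (sgn (m *ℕ length ss) * sgn (m *ℕ length ss)) * (pow cc m * ∏ (evalDesc m q) ss)
      ≈⟨ trans (*-congʳ (sgn-square (m *ℕ length ss))) (*-identityˡ _) ⟩
    pow cc m * ∏ (evalDesc m q) ss ∎

module DiscriminantMinor {c ℓ} (R : CommutativeRing c ℓ) where
  open RingSolver R
  open Multiples R
  open Determinants R
  open CoefficientLists R
  open Sylvester R
  open Indices
  open Lemma46 R using (det; sumFin; punchOut'; disc; deriv; nat·; band)
  open import Data.Nat using (ℕ; zero; suc; _<_; s≤s; z<s; s<s; _≤ᵇ_; _∸_; ⌊_/2⌋)
    renaming (_+_ to _+ℕ_; _*_ to _*ℕ_)
  open import Data.Nat.Properties using (suc-injective; ≤-refl; <-cmp; <⇒≤)
  import Data.Nat.Properties as NP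
  open import Data.Fin using (Fin; toℕ) renaming (zero to fz; suc to fs)
  open import Data.Bool using (true; false; if_then_else_)
  open import Relation.Binary.PropositionalEquality as P using (_≡_; _≢_)
  open import Data.Empty using (⊥-elim)
  open import Relation.Binary.Definitions using (tri<; tri≈; tri>)

  sumFin-cong : ∀ n {f g : Fin n → Carrier} → (∀ i → f i ≈ g i) → sumFin n f ≈ sumFin n g
  sumFin-cong zero h = refl
  sumFin-cong (suc n) h = +-cong (h fz) (sumFin-cong n (λ i → h (fs i)))

  det-cong : ∀ n {A B : Fin n → Fin n → Carrier} → (∀ r c → A r c ≈ B r c) → det n A ≈ det n B
  det-cong zero h = refl
  det-cong (suc n) h = sumFin-cong (suc n)
        (λ j → *-congˡ {sgn (toℕ j)} (*-cong (h fz j) (det-cong n (λ r c → h (fs r) (punchOut' j c)))))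

  sumFin-∑ : ∀ n (g : ℕ → Carrier) → sumFin n (λ j → g (toℕ j)) ≈ ∑ n g
  sumFin-∑ zero g = refl
  sumFin-∑ (suc n) g = +-congˡ (sumFin-∑ n (λ i → g (suc i)))

  toℕ-punchOut' : ∀ {n} (j : Fin (suc n)) (c : Fin n) → toℕ (punchOut' j c) ≡ punchIn (toℕ j) (toℕ c)
  toℕ-punchOut' fz c = P.refl
  toℕ-punchOut' (fs j) fz = P.refl
  toℕ-punchOut' (fs j) (fs c) = P.cong suc (toℕ-punchOut' j c)

  det≈detN : ∀ n (M : Mat) → det n (λ r c → M (toℕ r) (toℕ c)) ≈ detN n M
  det≈detN zero M = refl
  det≈detN (suc n) M = trans (sumFin-cong (suc n) term) (sumFin-∑ (suc n) (λ j → sgn j * (M 0 j * detN n (minor j M))))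
    where
    term : ∀ j → sgn (toℕ j) * (M 0 (toℕ j) * det n (λ r c → M (suc (toℕ r)) (toℕ (punchOut' j c))))
             ≈ sgn (toℕ j) * (M 0 (toℕ j) * detN n (minor (toℕ j) M))
    term j = *-congˡ (*-congˡ (trans
      (det-cong n (λ r c → reflexive (P.cong (M (suc (toℕ r))) (toℕ-punchOut' j c))))
      (det≈detN n (minor (toℕ j) M))))

  module DiscMatrix (e : ℕ) (g : ℕ → Carrier) where
    d : ℕ
    d = suc (suc e)
    S : Mat
    S = sylN d (suc e) g (deriv g)
    S' : Mat
    S' r c = if r ≤ᵇ suc e then (if suc e ≤ᵇ r then S r c - nat· d (S 0 c) else S r c) else S r c
    discMinor : Mat
    discMinor r c = S' (suc r) (suc c)

  open DiscMatrix public using (discMinor)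

  disc≈detN-discMinor : ∀ e g → disc (suc (suc e)) g ≈ sgn ⌊ suc (suc e) *ℕ suc e /2⌋ * detN (suc e +ℕ suc e) (discMinor e g)
  disc≈detN-discMinor e g = *-congˡ (det≈detN (suc e +ℕ suc e) (discMinor e g))

  module LeadingColumn (e : ℕ) (g : ℕ → Carrier) where
    open DiscMatrix e g hiding (discMinor)
    S'-j : ∀ c → S' (suc e) c ≡ S (suc e) c - nat· d (S 0 c)
    S'-j c rewrite ≤ᵇ-true (≤-refl {suc e}) = P.refl
    S'-ne : ∀ r c → r ≢ suc e → S' r c ≡ S r c
    S'-ne r c ne with <-cmp r (suc e)
    ... | tri< lt _ _ rewrite ≤ᵇ-true (<⇒≤ lt) | ≤ᵇ-false lt = P.refl
    ... | tri≈ _ eq _ = ⊥-elim (ne eq)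
    ... | tri> _ _ gt rewrite ≤ᵇ-false gt = P.refl

    col0 : ∀ r → r < suc e +ℕ suc e → S' (suc r) 0 ≈ 0#
    col0 r _ with <-cmp r e
    ... | tri< lt _ _ = trans (reflexive (S'-ne (suc r) 0 (λ x → NP.<-irrefl (suc-injective x) lt)))
          (reflexive (P.trans (syl-top d (suc e) g (deriv g) (suc r) 0 (s<s lt)) (band-0 d g r)))
    ... | tri≈ _ P.refl _ = trans (reflexive (S'-j 0)) (trans (+-congʳ (reflexive deriv-lead)) (-‿inverseʳ _))
      where
      deriv-lead : S (suc r) 0 ≡ nat· d (S 0 0)
      deriv-lead = P.trans (syl-bot d (suc r) g (deriv g) (suc r) 0 ≤-refl)
            (P.trans (P.cong (λ x → band (suc r) (deriv g) x 0) (NP.n∸n≡0 r))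
               (P.trans (band-base (suc r) (deriv g) 0) (P.cong (nat· d) (P.sym (band-base d g 0)))))
    ... | tri> _ _ gt = trans (reflexive (S'-ne (suc r) 0 (λ x → NP.<-irrefl (P.sym (suc-injective x)) gt)))
          (reflexive
             (P.trans (syl-bot d (suc e) g (deriv g) (suc r) 0 (s≤s (<⇒≤ gt)))
                (P.trans (P.cong (λ x → band (suc e) (deriv g) x 0) (∸-suc r e gt))
                   (band-0 (suc e) (deriv g) (r ∸ suc e)))))

    detN-sylvester-leadingColumn : detN (suc (suc e +ℕ suc e)) S ≈ g d * detN (suc e +ℕ suc e) (discMinor e g)
    detN-sylvester-leadingColumn = begin
      detN (suc (suc e +ℕ suc e)) S
        ≈⟨ sym
             (detN-addRowMultiple (suc (suc e +ℕ suc e)) 0 (suc e) S S' (- nat· d 1#) z<s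
                (s≤s (s≤s (NP.m≤m+n e (suc e)))) (λ ())
                (λ r c _ _ ne → reflexive (S'-ne r c ne))
                (λ c _ → trans (reflexive (S'-j c)) (+-congˡ (trans (-‿cong (nat·≈nat·1* d (S 0 c))) (-‿distribˡ-* _ _))))) ⟩
      detN (suc (suc e +ℕ suc e)) S' ≈⟨ detN-blockFirstColumn (suc e +ℕ suc e) S' col0 ⟩
      S' 0 0 * detN (suc e +ℕ suc e) (discMinor e g)
        ≈⟨ *-congʳ (reflexive (P.trans (S'-ne 0 0 (λ ())) (band-base d g 0))) ⟩
      g d * detN (suc e +ℕ suc e) (discMinor e g) ∎

  sylvesterDeriv-cong : ∀ e {g g'} → (∀ i → g i ≈ g' i) → ∀ r col → sylN (suc (suc e)) (suc e) g (deriv g) r col ≈ sylN (suc (suc e)) (suc e) g' (deriv g') r col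
  sylvesterDeriv-cong e eg r col = sylN-cong (suc (suc e)) (suc e) eg (deriv-cong eg) r col

  discMinor-cong : ∀ e {g g'} → (∀ i → g i ≈ g' i) → ∀ r col → DiscMatrix.discMinor e g r col ≈ DiscMatrix.discMinor e g' r col
  discMinor-cong e eg r col with suc r ≤ᵇ suc e
  ... | false = sylvesterDeriv-cong e eg (suc r) (suc col)
  ... | true with suc e ≤ᵇ suc r
  ... | false = sylvesterDeriv-cong e eg (suc r) (suc col)
  ... | true = +-cong (sylvesterDeriv-cong e eg (suc r) (suc col))
        (-‿cong (nat·-cong (suc (suc e)) (sylvesterDeriv-cong e eg 0 (suc col))))

  disc-cong : ∀ d {g g'} → (∀ i → g i ≈ g' i) → disc d g ≈ disc d g'
  disc-cong zero e = refl
  disc-cong (suc zero) e = refl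
  disc-cong (suc (suc d)) {g} {g'} e = trans (disc≈detN-discMinor d g)
        (trans (*-congˡ (detN-cong (suc d +ℕ suc d) (λ r col _ _ → discMinor-cong d e r col)))
           (sym (disc≈detN-discMinor d g')))

module Evaluation {c ℓ} (R : CommutativeRing c ℓ) where
  open RingSolver R
  open Multiples R
  open Determinants R
  open CoefficientLists R
  open Sylvester R
  open Indices
  open Lemma46 R using (coeffL; rootPoly; deriv; nat·; pairProd; sub; evalL)
  open import Data.Nat using (ℕ; zero; suc; _<_; _≤_; s≤s; _∸_)
  import Data.Nat.Properties as NP
  open import Data.List using (List; []; _∷_; map; length)
  open import Data.List.Membership.Propositional using (_∈_)
  open import Relation.Binary.PropositionalEquality as P using (_≡_)

  evalUpTo : ℕ → (ℕ → Carrier) → Carrier → Carrier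
  evalUpTo zero p x = p 0
  evalUpTo (suc m) p x = p 0 + x * evalUpTo m (λ i → p (suc i)) x

  hornerDesc-suc : ∀ m p s i → i ≤ m → hornerDesc (suc m) p s i ≈ hornerDesc m (λ j → p (suc j)) s i
  hornerDesc-suc m p s zero _ = refl
  hornerDesc-suc m p s (suc i) le = +-cong (reflexive (P.cong p (∸-suc m i le))) (*-congˡ (hornerDesc-suc m p s i (NP.<⇒≤ le)))

  evalDesc≈evalUpTo : ∀ m p s → evalDesc m p s ≈ evalUpTo m p s
  evalDesc≈evalUpTo zero p s = refl
  evalDesc≈evalUpTo (suc m) p s = +-cong (reflexive (P.cong p (NP.n∸n≡0 m)))
        (*-congˡ (trans (hornerDesc-suc m p s m NP.≤-refl) (evalDesc≈evalUpTo m (λ j → p (suc j)) s)))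

  evalUpTo-cong : ∀ m {p q} x → (∀ i → p i ≈ q i) → evalUpTo m p x ≈ evalUpTo m q x
  evalUpTo-cong zero x h = h 0
  evalUpTo-cong (suc m) x h = +-cong (h 0) (*-congˡ (evalUpTo-cong m x (λ i → h (suc i))))

  evalUpTo-linear : ∀ m p q a x → evalUpTo m (λ i → p i + a * q i) x ≈ evalUpTo m p x + a * evalUpTo m q x
  evalUpTo-linear zero p q a x = refl
  evalUpTo-linear (suc m) p q a x = trans (+-congˡ (*-congˡ (evalUpTo-linear m _ _ a x)))
    (solve 6 (λ p0 q0 a x e f → p0 :+ a :* q0 :+ x :* (e :+ a :* f) := p0 :+ x :* e :+ a :* (q0 :+ x :* f)) refl _ _ _ _
       _ _)

  evalUpTo-scale : ∀ m p a x → evalUpTo m (λ i → a * p i) x ≈ a * evalUpTo m p x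
  evalUpTo-scale zero p a x = refl
  evalUpTo-scale (suc m) p a x = trans (+-congˡ (*-congˡ (evalUpTo-scale m _ a x)))
    (solve 4 (λ a p0 x e → a :* p0 :+ x :* (a :* e) := a :* (p0 :+ x :* e)) refl _ _ _ _)

  evalUpTo-extend : ∀ m p x → p (suc m) ≈ 0# → evalUpTo (suc m) p x ≈ evalUpTo m p x
  evalUpTo-extend zero p x h = trans (+-congˡ (trans (*-congˡ h) (zeroʳ x))) (+-identityʳ _)
  evalUpTo-extend (suc m) p x h = +-congˡ (*-congˡ (evalUpTo-extend m (λ i → p (suc i)) x h))

  evalUpTo-shift : ∀ m g x → evalUpTo (suc m) (shift g) x ≈ x * evalUpTo m g x
  evalUpTo-shift m g x = +-identityˡ _

  evalDesc-cong : ∀ m {p q} x → (∀ i → p i ≈ q i) → evalDesc m p x ≈ evalDesc m q x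
  evalDesc-cong m x e = trans (evalDesc≈evalUpTo m _ x) (trans (evalUpTo-cong m x e) (sym (evalDesc≈evalUpTo m _ x)))

  evalDesc-congˣ : ∀ m p {x y} → x ≈ y → evalDesc m p x ≈ evalDesc m p y
  evalDesc-congˣ m p {x} {y} e = hornerDesc-congˣ m
    where
    hornerDesc-congˣ : ∀ i → hornerDesc m p x i ≈ hornerDesc m p y i
    hornerDesc-congˣ zero = refl
    hornerDesc-congˣ (suc i) = +-congˡ (*-cong e (hornerDesc-congˣ i))

  evalDesc-scale : ∀ m p a x → evalDesc m (λ i → a * p i) x ≈ a * evalDesc m p x
  evalDesc-scale m p a x = begin
    evalDesc m (λ i → a * p i) x  ≈⟨ evalDesc≈evalUpTo m _ x ⟩
    evalUpTo m (λ i → a * p i) x  ≈⟨ evalUpTo-scale m p a x ⟩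
    a * evalUpTo m p x            ≈⟨ *-congˡ (sym (evalDesc≈evalUpTo m p x)) ⟩
    a * evalDesc m p x            ∎

  evalUpTo-zero : ∀ m x → evalUpTo m (λ _ → 0#) x ≈ 0#
  evalUpTo-zero zero x = refl
  evalUpTo-zero (suc m) x = trans (+-congˡ (trans (*-congˡ (evalUpTo-zero m x)) (zeroʳ x))) (+-identityʳ 0#)

  evalL≈evalUpTo : ∀ L m x → length L ≤ suc m → evalL L x ≈ evalUpTo m (coeffL L) x
  evalL≈evalUpTo [] m x p = sym (evalUpTo-zero m x)
  evalL≈evalUpTo (c ∷ []) zero x p = trans (+-congˡ (zeroʳ x)) (+-identityʳ c)
  evalL≈evalUpTo (c ∷ L) (suc m) x (s≤s p) = +-congˡ (*-congˡ (evalL≈evalUpTo L m x p))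

  rootCoeff : List Carrier → ℕ → Carrier
  rootCoeff ts = coeffL (rootPoly ts)

  evalUpTo-rootPoly : ∀ ts x → evalUpTo (length ts) (rootCoeff ts) x ≈ ∏ (λ u → x - u) ts
  evalUpTo-rootPoly [] x = refl
  evalUpTo-rootPoly (t ∷ ts) x = begin
    evalUpTo (suc k) (rootCoeff (t ∷ ts)) x
      ≈⟨ evalUpTo-cong (suc k) x (λ i → trans (coeffL-rootPoly-cons t ts i) (+-congˡ (-‿distribˡ-* t _))) ⟩
    evalUpTo (suc k) (λ i → shift (rootCoeff ts) i + - t * rootCoeff ts i) x
      ≈⟨ evalUpTo-linear (suc k) (shift (rootCoeff ts)) (rootCoeff ts) (- t) x ⟩
    evalUpTo (suc k) (shift (rootCoeff ts)) x + - t * evalUpTo (suc k) (rootCoeff ts) x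
      ≈⟨ +-cong (evalUpTo-shift k (rootCoeff ts) x)
           (*-congˡ (evalUpTo-extend k (rootCoeff ts) x (coeffL-rootPoly-above ts (suc k) (NP.n<1+n k)))) ⟩
    x * evalUpTo k (rootCoeff ts) x + - t * evalUpTo k (rootCoeff ts) x ≈⟨ sym (distribʳ _ x (- t)) ⟩
    (x - t) * evalUpTo k (rootCoeff ts) x ≈⟨ *-congˡ (evalUpTo-rootPoly ts x) ⟩
    (x - t) * ∏ (λ u → x - u) ts ∎
    where k = length ts

  deriv-linearFactor : ∀ h t i → deriv (λ j → shift h j - t * h j) i ≈ h i + (shift (deriv h) i - t * deriv h i)
  deriv-linearFactor h t zero = begin
    nat· 1 (h 0 - t * h 1) ≈⟨ trans (nat·≈nat·1* 1 _) (*-congʳ (+-identityʳ 1#)) ⟩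
    1# * (h 0 - t * h 1) ≈⟨ solve 3 (λ a b t → :1 :* (a :- t :* b) := a :+ (:0 :- t :* (:1 :* b))) refl _ _ _ ⟩
    h 0 + (0# - t * (1# * h 1))
      ≈⟨ +-congˡ (+-congˡ (-‿cong (*-congˡ (sym (trans (nat·≈nat·1* 1 (h 1)) (*-congʳ (+-identityʳ 1#))))))) ⟩
    h 0 + (0# - t * nat· 1 (h 1)) ∎
  deriv-linearFactor h t (suc j) = begin
    nat· (suc (suc j)) (h (suc j) - t * h (suc (suc j))) ≈⟨ nat·≈nat·1* (suc (suc j)) _ ⟩
    (1# + nat· (suc j) 1#) * (h (suc j) - t * h (suc (suc j)))
      ≈⟨ solve 4 (λ n a b t → (:1 :+ n) :* (a :- t :* b) := a :+ (n :* a :- t :* ((:1 :+ n) :* b))) refl _ _ _ _ ⟩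
    h (suc j) + (nat· (suc j) 1# * h (suc j) - t * ((1# + nat· (suc j) 1#) * h (suc (suc j))))
      ≈⟨ +-congˡ (+-cong (sym (nat·≈nat·1* (suc j) _)) (-‿cong (*-congˡ (sym (nat·≈nat·1* (suc (suc j)) _))))) ⟩
    h (suc j) + (nat· (suc j) (h (suc j)) - t * nat· (suc (suc j)) (h (suc (suc j)))) ∎

  derivRootPoly : List Carrier → Carrier → Carrier
  derivRootPoly ts x = evalUpTo (length ts) (deriv (rootCoeff ts)) x

  evalDesc-derivRootPoly : ∀ ts m x → length ts ≡ suc m → evalDesc m (deriv (rootCoeff ts)) x ≈ derivRootPoly ts x
  evalDesc-derivRootPoly ts m x len = begin
    evalDesc m (deriv (rootCoeff ts)) x        ≈⟨ evalDesc≈evalUpTo m _ x ⟩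
    evalUpTo m (deriv (rootCoeff ts)) x        ≈⟨ sym (evalUpTo-extend m _ x top-vanishes) ⟩
    evalUpTo (suc m) (deriv (rootCoeff ts)) x  ≡⟨ P.cong (λ k → evalUpTo k (deriv (rootCoeff ts)) x) (P.sym len) ⟩
    derivRootPoly ts x                         ∎
    where
    top-vanishes : deriv (rootCoeff ts) (suc m) ≈ 0#
    top-vanishes = nat·-zero (suc (suc m))
      (coeffL-rootPoly-above ts (suc (suc m)) (P.subst (_< suc (suc m)) (P.sym len) (NP.n<1+n (suc m))))

  derivRootPoly-cons : ∀ t ts x → derivRootPoly (t ∷ ts) x ≈ ∏ (λ u → x - u) ts + (x - t) * derivRootPoly ts x
  derivRootPoly-cons t ts x = begin
    evalUpTo (suc k) (deriv (rootCoeff (t ∷ ts))) x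
      ≈⟨ evalUpTo-cong (suc k) x
           (λ i → trans (deriv-cong (coeffL-rootPoly-cons t ts) i) (trans (deriv-linearFactor (rootCoeff ts) t i) (+-congˡ (sym (trans (*-identityˡ _) (+-congˡ (sym (-‿distribˡ-* t (deriv (rootCoeff ts) i))))))))) ⟩
    evalUpTo (suc k) (λ i → rootCoeff ts i + 1# * (shift D i + - t * D i)) x
      ≈⟨ evalUpTo-linear (suc k) (rootCoeff ts) (λ i → shift D i + - t * D i) 1# x ⟩
    evalUpTo (suc k) (rootCoeff ts) x + 1# * evalUpTo (suc k) (λ i → shift D i + - t * D i) x
      ≈⟨ +-cong (evalUpTo-extend k (rootCoeff ts) x (coeffL-rootPoly-above ts (suc k) (NP.n<1+n k)))
           (trans (*-identityˡ _) (evalUpTo-linear (suc k) (shift D) D (- t) x)) ⟩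
    evalUpTo k (rootCoeff ts) x + (evalUpTo (suc k) (shift D) x + - t * evalUpTo (suc k) D x)
      ≈⟨ +-cong (evalUpTo-rootPoly ts x)
           (+-cong (evalUpTo-shift k D x)
              (*-congˡ
                 (evalUpTo-extend k D x
                    (nat·-zero (suc (suc k)) (coeffL-rootPoly-above ts (suc (suc k)) (NP.m<n⇒m<1+n (NP.n<1+n k))))))) ⟩
    ∏ (λ u → x - u) ts + (x * evalUpTo k D x + - t * evalUpTo k D x) ≈⟨ +-congˡ (sym (distribʳ _ x (- t))) ⟩
    ∏ (λ u → x - u) ts + (x - t) * derivRootPoly ts x ∎
    where
    k = length ts
    D = deriv (rootCoeff ts)

  pairFactors : (Carrier → Carrier) → Carrier → List Carrier → Carrier
  pairFactors F t [] = 1#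
  pairFactors F t (u ∷ us) = (sub (F t) (F u) * sub (F t) (F u)) * pairFactors F t us

  -- The inner product in pairProd is bound by an anonymous where clause, so it
  -- cannot be named; unification names it as innerProduct instead.
  module _ (F : Carrier → Carrier) (t : Carrier) where
    mutual
      private
        innerProduct : List Carrier → List Carrier → Carrier
        innerProduct = _

        innerProduct≈pairFactors : ∀ ts us → innerProduct ts us ≈ pairFactors F t us
        innerProduct≈pairFactors ts [] = refl
        innerProduct≈pairFactors ts (v ∷ vs) = *-congˡ (innerProduct≈pairFactors ts vs)

      pairProd-cons : ∀ ts → pairProd F (t ∷ ts) ≈ pairFactors F t ts * pairProd F ts
      pairProd-cons [] = refl
      pairProd-cons (u ∷ us) with u ∷ us
      ... | ts = *-congʳ (*-congˡ (innerProduct≈pairFactors ts us))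

  pairProd-map : ∀ F G h L → (∀ t u → sub (F (h t)) (F (h u)) * sub (F (h t)) (F (h u)) ≈ sub (G t) (G u) * sub (G t) (G u)) →
    pairProd F (map h L) ≈ pairProd G L
  pairProd-map F G h [] sq = refl
  pairProd-map F G h (t ∷ L) sq = begin
    pairProd F (h t ∷ map h L)                        ≈⟨ pairProd-cons F (h t) (map h L) ⟩
    pairFactors F (h t) (map h L) * pairProd F (map h L) ≈⟨ *-cong (factors L) (pairProd-map F G h L sq) ⟩
    pairFactors G t L * pairProd G L                    ≈⟨ sym (pairProd-cons G t L) ⟩
    pairProd G (t ∷ L)                                  ∎
    where
    factors : ∀ us → pairFactors F (h t) (map h us) ≈ pairFactors G t us
    factors [] = refl
    factors (u ∷ us) = *-cong (sq t u) (factors us)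

  AB : ∀ t us → ∏ (λ u → t - u) us * ∏ (λ u → u - t) us ≈ sgn (length us) * pairFactors (λ x → x) t us
  AB t [] = refl
  AB t (u ∷ us) = begin
    ((t - u) * ∏ (λ u → t - u) us) * ((u - t) * ∏ (λ u → u - t) us)
      ≈⟨ solve 4 (λ a b c d → (a :* b) :* (c :* d) := (a :* c) :* (b :* d)) refl _ _ _ _ ⟩
    ((t - u) * (u - t)) * (∏ (λ u → t - u) us * ∏ (λ u → u - t) us) ≈⟨ *-congˡ (AB t us) ⟩
    ((t - u) * (u - t)) * (sgn (length us) * pairFactors (λ x → x) t us)
      ≈⟨ solve 4 (λ t u s g → ((t :- u) :* (u :- t)) :* (s :* g) := (:- s) :* (((t :- u) :* (t :- u)) :* g)) refl _ _ _
           _ ⟩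
    - sgn (length us) * (((t - u) * (t - u)) * pairFactors (λ x → x) t us) ∎

  ∏-derivRootPoly : ∀ ts → ∏ (derivRootPoly ts) ts ≈ sgn (triangle (length ts)) * pairProd (λ x → x) ts
  ∏-derivRootPoly [] = sym (*-identityˡ 1#)
  ∏-derivRootPoly (t ∷ us) = begin
    derivRootPoly (t ∷ us) t * ∏ (derivRootPoly (t ∷ us)) us
      ≈⟨ *-cong at-first (trans (∏-cong us at-rest) (∏-* (λ x → x - t) (derivRootPoly us) us)) ⟩
    ∏ (λ u → t - u) us * (∏ (λ x → x - t) us * ∏ (derivRootPoly us) us) ≈⟨ sym (*-assoc _ _ _) ⟩
    (∏ (λ u → t - u) us * ∏ (λ x → x - t) us) * ∏ (derivRootPoly us) us ≈⟨ *-cong (AB t us) (∏-derivRootPoly us) ⟩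
    (sgn k * pairFactors (λ x → x) t us) * (sgn (triangle k) * pairProd (λ x → x) us)
      ≈⟨ solve 4 (λ a g b p → (a :* g) :* (b :* p) := (a :* b) :* (g :* p)) refl _ _ _ _ ⟩
    (sgn k * sgn (triangle k)) * (pairFactors (λ x → x) t us * pairProd (λ x → x) us)
      ≈⟨ *-cong (sym (sgn-+ k (triangle k))) (sym (pairProd-cons (λ x → x) t us)) ⟩
    sgn (triangle (suc k)) * pairProd (λ x → x) (t ∷ us) ∎
    where
    k = length us
    at-first : derivRootPoly (t ∷ us) t ≈ ∏ (λ u → t - u) us
    at-first = trans (derivRootPoly-cons t us t) (trans (+-congˡ (trans (*-congʳ (-‿inverseʳ t)) (zeroˡ _))) (+-identityʳ _))
    at-rest : ∀ x → x ∈ us → derivRootPoly (t ∷ us) x ≈ (x - t) * derivRootPoly us x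
    at-rest x m = trans (derivRootPoly-cons t us x) (trans (+-congʳ (∏-root x us m)) (+-identityˡ _))

module Homomorphisms {c₁ ℓ₁ c₂ ℓ₂} (R : CommutativeRing c₁ ℓ₁) (S : CommutativeRing c₂ ℓ₂) where
  open import Algebra.Morphism.Structures using (IsRingHomomorphism)
  open import Data.Nat using (ℕ; zero; suc; _≤ᵇ_; _∸_; ⌊_/2⌋) renaming (_+_ to _+ℕ_)
  open import Data.Bool using (Bool; true; false; if_then_else_; _∧_)
  open import Data.List using ([]; _∷_; map)
  module R = CommutativeRing R
  module S = CommutativeRing S
  open import Relation.Binary.Reasoning.Setoid S.setoid
  module LR = Lemma46 R
  module LS = Lemma46 S
  module DR = Determinants R
  module DS = Determinants S
  module CR = CoefficientLists R
  module CS = CoefficientLists S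
  module SR = Sylvester R
  module SS = Sylvester S
  module DiR = DiscriminantMinor R
  module DiS = DiscriminantMinor S
  module ER = Evaluation R
  module ES = Evaluation S
  module MS = Multiples S

  module _ (φ : R.Carrier → S.Carrier) (h : IsRingHomomorphism R.rawRing S.rawRing φ) where
    open IsRingHomomorphism h

    ∑-homo : ∀ n f → φ (DR.∑ n f) S.≈ DS.∑ n (λ i → φ (f i))
    ∑-homo zero f = 0#-homo
    ∑-homo (suc n) f = S.trans (+-homo _ _) (S.+-congˡ (∑-homo n (λ i → f (suc i))))

    sgn-homo : ∀ k → φ (DR.sgn k) S.≈ DS.sgn k
    sgn-homo zero = 1#-homo
    sgn-homo (suc k) = S.trans (-‿homo _) (S.-‿cong (sgn-homo k))

    detN-homo : ∀ n M → φ (DR.detN n M) S.≈ DS.detN n (λ r c → φ (M r c))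
    detN-homo zero M = 1#-homo
    detN-homo (suc n) M = S.trans (∑-homo (suc n) (λ j → DR.sgn j R.* (M 0 j R.* DR.detN n (DR.minor j M)))) (DS.∑-cong (suc n) (λ j _ →
      S.trans (*-homo (DR.sgn j) (M 0 j R.* DR.detN n (DR.minor j M))) (S.*-cong (sgn-homo j) (S.trans (*-homo (M 0 j) (DR.detN n (DR.minor j M))) (S.*-congˡ (detN-homo n (DR.minor j M)))))))

    nat·-homo : ∀ k x → φ (LR.nat· k x) S.≈ LS.nat· k (φ x)
    nat·-homo zero x = 0#-homo
    nat·-homo (suc k) x = S.trans (+-homo _ _) (S.+-congˡ (nat·-homo k x))

    if0-homo : ∀ (b : Bool) x → φ (if b then x else R.0#) S.≈ (if b then φ x else S.0#)
    if0-homo true x = S.refl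
    if0-homo false x = 0#-homo

    band-homo : ∀ m p r col → φ (LR.band m p r col) S.≈ LS.band m (λ i → φ (p i)) r col
    band-homo m p r col = if0-homo ((r ≤ᵇ col) ∧ (col ≤ᵇ r +ℕ m)) _

    sylN-homo : ∀ m k p q r col → φ (SR.sylN m k p q r col) S.≈ SS.sylN m k (λ i → φ (p i)) (λ i → φ (q i)) r col
    sylN-homo m k p q r col with suc r ≤ᵇ k
    ... | true = band-homo m p r col
    ... | false = band-homo k q (r ∸ k) col

    deriv-homo : ∀ g i → φ (LR.deriv g i) S.≈ LS.deriv (λ j → φ (g j)) i
    deriv-homo g i = nat·-homo (suc i) (g (suc i))

    sylvesterDeriv-homo : ∀ e g r col → φ (SR.sylN (suc (suc e)) (suc e) g (LR.deriv g) r col) S.≈ SS.sylN (suc (suc e)) (suc e) (λ i → φ (g i)) (LS.deriv (λ i → φ (g i))) r col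
    sylvesterDeriv-homo e g r col = S.trans (sylN-homo (suc (suc e)) (suc e) g (LR.deriv g) r col)
          (SS.sylN-cong (suc (suc e)) (suc e) {λ i → φ (g i)} {λ i → φ (g i)} {λ i → φ (LR.deriv g i)}
             {LS.deriv (λ i → φ (g i))} (λ i → S.refl) (deriv-homo g) r col)

    discMinor-homo : ∀ e g r col → φ (DiR.DiscMatrix.discMinor e g r col) S.≈ DiS.DiscMatrix.discMinor e (λ i → φ (g i)) r col
    discMinor-homo e g r col with suc r ≤ᵇ suc e
    ... | false = sylvesterDeriv-homo e g (suc r) (suc col)
    ... | true with suc e ≤ᵇ suc r
    ... | false = sylvesterDeriv-homo e g (suc r) (suc col)
    ... | true = S.trans (+-homo (syl (suc r) (suc col)) (R.- LR.nat· (suc (suc e)) (syl 0 (suc col))))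
          (S.+-cong (sylvesterDeriv-homo e g (suc r) (suc col))
             (S.trans (-‿homo (LR.nat· (suc (suc e)) (syl 0 (suc col))))
                (S.-‿cong
                   (S.trans (nat·-homo (suc (suc e)) (syl 0 (suc col)))
                      (MS.nat·-cong (suc (suc e)) (sylvesterDeriv-homo e g 0 (suc col)))))))
      where
      syl : ℕ → ℕ → R.Carrier
      syl = SR.sylN (suc (suc e)) (suc e) g (LR.deriv g)

    hornerDesc-homo : ∀ m p x i → φ (SR.hornerDesc m p x i) S.≈ SS.hornerDesc m (λ j → φ (p j)) (φ x) i
    hornerDesc-homo m p x zero = S.refl
    hornerDesc-homo m p x (suc i) = S.trans (+-homo (p (m ∸ suc i)) (x R.* SR.hornerDesc m p x i))
          (S.+-congˡ (S.trans (*-homo x (SR.hornerDesc m p x i)) (S.*-congˡ (hornerDesc-homo m p x i))))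

    evalDesc-homo : ∀ m p x → φ (SR.evalDesc m p x) S.≈ SS.evalDesc m (λ j → φ (p j)) (φ x)
    evalDesc-homo m p x = hornerDesc-homo m p x m

    ∏-homo : ∀ {a} {A : Set a} (F : A → R.Carrier) L → φ (DR.∏ F L) S.≈ DS.∏ (λ x → φ (F x)) L
    ∏-homo F [] = 1#-homo
    ∏-homo F (x ∷ L) = S.trans (*-homo (F x) (DR.∏ F L)) (S.*-congˡ (∏-homo F L))

    pow-homo : ∀ x k → φ (LR.pow x k) S.≈ LS.pow (φ x) k
    pow-homo x zero = 1#-homo
    pow-homo x (suc k) = S.trans (*-homo x (LR.pow x k)) (S.*-congˡ (pow-homo x k))

    rootPoly-homo : ∀ L i → LS.coeffL (LS.rootPoly (map φ L)) i S.≈ φ (LR.coeffL (LR.rootPoly L) i)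
    rootPoly-homo [] zero = S.sym 1#-homo
    rootPoly-homo [] (suc i) = S.sym 0#-homo
    rootPoly-homo (t ∷ L) i = begin
      LS.coeffL (LS.rootPoly (φ t ∷ map φ L)) i ≈⟨ CS.coeffL-rootPoly-cons (φ t) (map φ L) i ⟩
      CS.shift (ES.rootCoeff (map φ L)) i S.- φ t S.* ES.rootCoeff (map φ L) i
        ≈⟨ S.+-cong (shifted i) (S.-‿cong (S.*-congˡ (rootPoly-homo L i))) ⟩
      φ (CR.shift (ER.rootCoeff L) i) S.- φ t S.* φ (ER.rootCoeff L i)
        ≈⟨ S.sym
             (S.trans (+-homo (CR.shift (ER.rootCoeff L) i) (R.- (t R.* ER.rootCoeff L i)))
                (S.+-congˡ (S.trans (-‿homo (t R.* ER.rootCoeff L i)) (S.-‿cong (*-homo t (ER.rootCoeff L i)))))) ⟩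
      φ (CR.shift (ER.rootCoeff L) i R.- t R.* ER.rootCoeff L i) ≈⟨ ⟦⟧-cong (R.sym (CR.coeffL-rootPoly-cons t L i)) ⟩
      φ (LR.coeffL (LR.rootPoly (t ∷ L)) i) ∎
      where
      shifted : ∀ i → CS.shift (ES.rootCoeff (map φ L)) i S.≈ φ (CR.shift (ER.rootCoeff L) i)
      shifted zero = S.sym 0#-homo
      shifted (suc i) = rootPoly-homo L i

    evalUpTo-homo : ∀ m p x → φ (ER.evalUpTo m p x) S.≈ ES.evalUpTo m (λ j → φ (p j)) (φ x)
    evalUpTo-homo zero p x = S.refl
    evalUpTo-homo (suc m) p x = S.trans (+-homo (p 0) (x R.* ER.evalUpTo m (λ i → p (suc i)) x))
          (S.+-congˡ
             (S.trans (*-homo x (ER.evalUpTo m (λ i → p (suc i)) x)) (S.*-congˡ (evalUpTo-homo m (λ i → p (suc i)) x))))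

module Polynomials {c ℓ} (R : CommutativeRing c ℓ) where
  open RingSolver R
  open Lemma46 R using (coeffL; padd; pmul)
  open CoefficientLists R using (coeffL-padd; coeffL-map*; coeffL-neg)
  open import Data.Nat using (zero; suc)
  open import Data.List using (List; []; _∷_; map)
  open import Data.Product using (_,_)

  infix 4 _≋_

  _≋_ : List Carrier → List Carrier → Set ℓ
  A ≋ B = ∀ i → coeffL A i ≈ coeffL B i

  x· : List Carrier → List Carrier
  x· C = 0# ∷ C

  pneg : List Carrier → List Carrier
  pneg = map (-_)

  one : List Carrier
  one = 1# ∷ []

  scale : Carrier → List Carrier → List Carrier
  scale a = map (a *_)

  padd-cong : ∀ A A' B B' → A ≋ A' → B ≋ B' → padd A B ≋ padd A' B'
  padd-cong A A' B B' e f i = trans (coeffL-padd A B i) (trans (+-cong (e i) (f i)) (sym (coeffL-padd A' B' i)))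

  scale-cong : ∀ a B B' → B ≋ B' → scale a B ≋ scale a B'
  scale-cong a B B' e i = trans (coeffL-map* a B i) (trans (*-congˡ (e i)) (sym (coeffL-map* a B' i)))

  x·-cong : ∀ A B → A ≋ B → x· A ≋ x· B
  x·-cong A B e zero = refl
  x·-cong A B e (suc i) = e i

  pneg-cong : ∀ A B → A ≋ B → pneg A ≋ pneg B
  pneg-cong A B e i = trans (coeffL-neg A i) (trans (-‿cong (e i)) (sym (coeffL-neg B i)))

  x·-[] : ∀ i → coeffL (x· []) i ≈ 0#
  x·-[] zero = refl
  x·-[] (suc i) = refl

  pmul-zeroˡ : ∀ A B → A ≋ [] → pmul A B ≋ []
  pmul-zeroˡ [] B e i = refl
  pmul-zeroˡ (a ∷ A) B e i = trans (coeffL-padd (scale a B) (x· (pmul A B)) i)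
    (trans
       (+-cong (trans (coeffL-map* a B i) (trans (*-congʳ (e 0)) (zeroˡ _)))
          (trans (x·-cong (pmul A B) [] (pmul-zeroˡ A B (λ j → e (suc j))) i) (x·-[] i)))
       (+-identityˡ _))

  pmul-congˡ : ∀ A A' B → A ≋ A' → pmul A B ≋ pmul A' B
  pmul-congˡ [] A' B e i = sym (pmul-zeroˡ A' B (λ j → sym (e j)) i)
  pmul-congˡ (a ∷ A) [] B e = pmul-zeroˡ (a ∷ A) B e
  pmul-congˡ (a ∷ A) (a' ∷ A') B e = padd-cong (scale a B) (scale a' B) (x· (pmul A B)) (x· (pmul A' B))
        (λ i → trans (coeffL-map* a B i) (trans (*-congʳ (e 0)) (sym (coeffL-map* a' B i))))
    (x·-cong (pmul A B) (pmul A' B) (pmul-congˡ A A' B (λ j → e (suc j))))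

  pmul-congʳ : ∀ A B B' → B ≋ B' → pmul A B ≋ pmul A B'
  pmul-congʳ [] B B' e i = refl
  pmul-congʳ (a ∷ A) B B' e = padd-cong (scale a B) (scale a B') (x· (pmul A B)) (x· (pmul A B')) (scale-cong a B B' e)
        (x·-cong (pmul A B) (pmul A B') (pmul-congʳ A B B' e))

  coeffL-pmul-cons′ : ∀ a A B i → coeffL (pmul (a ∷ A) B) i ≈ a * coeffL B i + coeffL (x· (pmul A B)) i
  coeffL-pmul-cons′ a A B i = trans (coeffL-padd (scale a B) (x· (pmul A B)) i) (+-congʳ (coeffL-map* a B i))

  x·-padd : ∀ C D i → coeffL (x· (padd C D)) i ≈ coeffL (x· C) i + coeffL (x· D) i
  x·-padd C D zero = sym (+-identityˡ 0#)
  x·-padd C D (suc i) = coeffL-padd C D i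

  pmul-distribʳ : ∀ A A' B → pmul (padd A A') B ≋ padd (pmul A B) (pmul A' B)
  pmul-distribʳ [] A' B i = refl
  pmul-distribʳ (a ∷ A) [] B i = sym (trans (coeffL-padd (pmul (a ∷ A) B) [] i) (+-identityʳ _))
  pmul-distribʳ (a ∷ A) (a' ∷ A') B i = begin
    coeffL (pmul ((a + a') ∷ padd A A') B) i ≈⟨ coeffL-pmul-cons′ (a + a') (padd A A') B i ⟩
    (a + a') * coeffL B i + coeffL (x· (pmul (padd A A') B)) i
      ≈⟨ +-congˡ
           (trans (x·-cong (pmul (padd A A') B) (padd (pmul A B) (pmul A' B)) (pmul-distribʳ A A' B) i)
              (x·-padd (pmul A B) (pmul A' B) i)) ⟩
    (a + a') * coeffL B i + (coeffL (x· (pmul A B)) i + coeffL (x· (pmul A' B)) i)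
      ≈⟨ solve 5 (λ a a' b p q → (a :+ a') :* b :+ (p :+ q) := (a :* b :+ p) :+ (a' :* b :+ q)) refl a a' (coeffL B i)
           (coeffL (x· (pmul A B)) i)
           (coeffL (x· (pmul A' B)) i) ⟩
    (a * coeffL B i + coeffL (x· (pmul A B)) i) + (a' * coeffL B i + coeffL (x· (pmul A' B)) i)
      ≈⟨ sym
           (trans (coeffL-padd (pmul (a ∷ A) B) (pmul (a' ∷ A') B) i)
              (+-cong (coeffL-pmul-cons′ a A B i) (coeffL-pmul-cons′ a' A' B i))) ⟩
    coeffL (padd (pmul (a ∷ A) B) (pmul (a' ∷ A') B)) i ∎

  pmul-distribˡ : ∀ A B B' → pmul A (padd B B') ≋ padd (pmul A B) (pmul A B')
  pmul-distribˡ [] B B' i = refl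
  pmul-distribˡ (a ∷ A) B B' i = begin
    coeffL (pmul (a ∷ A) (padd B B')) i ≈⟨ coeffL-pmul-cons′ a A (padd B B') i ⟩
    a * coeffL (padd B B') i + coeffL (x· (pmul A (padd B B'))) i
      ≈⟨ +-cong (*-congˡ (coeffL-padd B B' i))
           (trans (x·-cong (pmul A (padd B B')) (padd (pmul A B) (pmul A B')) (pmul-distribˡ A B B') i)
              (x·-padd (pmul A B) (pmul A B') i)) ⟩
    a * (coeffL B i + coeffL B' i) + (coeffL (x· (pmul A B)) i + coeffL (x· (pmul A B')) i)
      ≈⟨ solve 5 (λ a b b' p q → a :* (b :+ b') :+ (p :+ q) := (a :* b :+ p) :+ (a :* b' :+ q)) refl a (coeffL B i)
           (coeffL B' i)
           (coeffL (x· (pmul A B)) i)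
           (coeffL (x· (pmul A B')) i) ⟩
    (a * coeffL B i + coeffL (x· (pmul A B)) i) + (a * coeffL B' i + coeffL (x· (pmul A B')) i)
      ≈⟨ sym
           (trans (coeffL-padd (pmul (a ∷ A) B) (pmul (a ∷ A) B') i)
              (+-cong (coeffL-pmul-cons′ a A B i) (coeffL-pmul-cons′ a A B' i))) ⟩
    coeffL (padd (pmul (a ∷ A) B) (pmul (a ∷ A) B')) i ∎

  scale-pmulˡ : ∀ a A B → pmul (scale a A) B ≋ scale a (pmul A B)
  scale-pmulˡ a [] B i = refl
  scale-pmulˡ a (b ∷ A) B i = begin
    coeffL (pmul (a * b ∷ scale a A) B) i ≈⟨ coeffL-pmul-cons′ (a * b) (scale a A) B i ⟩
    (a * b) * coeffL B i + coeffL (x· (pmul (scale a A) B)) i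
      ≈⟨ +-congˡ (x·-cong (pmul (scale a A) B) (scale a (pmul A B)) (scale-pmulˡ a A B) i) ⟩
    (a * b) * coeffL B i + coeffL (x· (scale a (pmul A B))) i ≈⟨ +-congˡ (shifted i) ⟩
    (a * b) * coeffL B i + a * coeffL (x· (pmul A B)) i
      ≈⟨ solve 4 (λ a b c d → (a :* b) :* c :+ a :* d := a :* (b :* c :+ d)) refl a b (coeffL B i)
           (coeffL (x· (pmul A B)) i) ⟩
    a * (b * coeffL B i + coeffL (x· (pmul A B)) i) ≈⟨ *-congˡ (sym (coeffL-pmul-cons′ b A B i)) ⟩
    a * coeffL (pmul (b ∷ A) B) i ≈⟨ sym (coeffL-map* a (pmul (b ∷ A) B) i) ⟩
    coeffL (scale a (pmul (b ∷ A) B)) i ∎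
    where
    shifted : ∀ i → coeffL (x· (scale a (pmul A B))) i ≈ a * coeffL (x· (pmul A B)) i
    shifted zero = sym (zeroʳ a)
    shifted (suc i) = coeffL-map* a (pmul A B) i

  scale-pmulʳ : ∀ a A B → pmul A (scale a B) ≋ scale a (pmul A B)
  scale-pmulʳ a [] B i = refl
  scale-pmulʳ a (b ∷ A) B i = begin
    coeffL (pmul (b ∷ A) (scale a B)) i ≈⟨ coeffL-pmul-cons′ b A (scale a B) i ⟩
    b * coeffL (scale a B) i + coeffL (x· (pmul A (scale a B))) i
      ≈⟨ +-cong (*-congˡ (coeffL-map* a B i)) (x·-cong (pmul A (scale a B)) (scale a (pmul A B)) (scale-pmulʳ a A B) i) ⟩
    b * (a * coeffL B i) + coeffL (x· (scale a (pmul A B))) i ≈⟨ +-congˡ (shifted i) ⟩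
    b * (a * coeffL B i) + a * coeffL (x· (pmul A B)) i
      ≈⟨ solve 4 (λ a b c d → b :* (a :* c) :+ a :* d := a :* (b :* c :+ d)) refl a b (coeffL B i)
           (coeffL (x· (pmul A B)) i) ⟩
    a * (b * coeffL B i + coeffL (x· (pmul A B)) i) ≈⟨ *-congˡ (sym (coeffL-pmul-cons′ b A B i)) ⟩
    a * coeffL (pmul (b ∷ A) B) i ≈⟨ sym (coeffL-map* a (pmul (b ∷ A) B) i) ⟩
    coeffL (scale a (pmul (b ∷ A) B)) i ∎
    where
    shifted : ∀ i → coeffL (x· (scale a (pmul A B))) i ≈ a * coeffL (x· (pmul A B)) i
    shifted zero = sym (zeroʳ a)
    shifted (suc i) = coeffL-map* a (pmul A B) i

  x-pmulˡ : ∀ A B → pmul (x· A) B ≋ x· (pmul A B)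
  x-pmulˡ A B i = trans (coeffL-pmul-cons′ 0# A B i) (trans (+-congʳ (zeroˡ _)) (+-identityˡ _))

  x-pmulʳ : ∀ A B → pmul A (x· B) ≋ x· (pmul A B)
  x-pmulʳ [] B zero = refl
  x-pmulʳ [] B (suc i) = refl
  x-pmulʳ (a ∷ A) B i = begin
    coeffL (pmul (a ∷ A) (x· B)) i ≈⟨ coeffL-pmul-cons′ a A (x· B) i ⟩
    a * coeffL (x· B) i + coeffL (x· (pmul A (x· B))) i
      ≈⟨ +-congˡ (x·-cong (pmul A (x· B)) (x· (pmul A B)) (x-pmulʳ A B) i) ⟩
    a * coeffL (x· B) i + coeffL (x· (x· (pmul A B))) i ≈⟨ shifted i ⟩
    coeffL (x· (pmul (a ∷ A) B)) i ∎
    where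
    shifted : ∀ i → a * coeffL (x· B) i + coeffL (x· (x· (pmul A B))) i ≈ coeffL (x· (pmul (a ∷ A) B)) i
    shifted zero = trans (+-identityʳ _) (zeroʳ a)
    shifted (suc i) = sym (coeffL-pmul-cons′ a A B i)

  ≋-refl : ∀ {A} → A ≋ A
  ≋-refl i = refl

  ≋-sym : ∀ {A B} → A ≋ B → B ≋ A
  ≋-sym e i = sym (e i)

  ≋-trans : ∀ {A B C} → A ≋ B → B ≋ C → A ≋ C
  ≋-trans e f i = trans (e i) (f i)

  pmul-zeroʳ : ∀ B → pmul B [] ≋ []
  pmul-zeroʳ [] i = refl
  pmul-zeroʳ (b ∷ B) i = trans (coeffL-pmul-cons′ b B [] i)
        (trans (+-cong (zeroʳ b) (x·-cong (pmul B []) [] (pmul-zeroʳ B) i)) (trans (+-identityˡ _) (x·-[] i)))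

  pmul-oneʳ : ∀ B → pmul B one ≋ B
  pmul-oneʳ [] i = refl
  pmul-oneʳ (b ∷ B) zero = trans (coeffL-pmul-cons′ b B one 0) (trans (+-identityʳ _) (*-identityʳ b))
  pmul-oneʳ (b ∷ B) (suc i) = trans (coeffL-pmul-cons′ b B one (suc i)) (trans (+-cong (zeroʳ b) (pmul-oneʳ B i)) (+-identityˡ _))

  pmul-oneˡ : ∀ B → pmul one B ≋ B
  pmul-oneˡ B i = trans (coeffL-pmul-cons′ 1# [] B i) (trans (+-cong (*-identityˡ _) (x·-[] i)) (+-identityʳ _))

  cons≋padd : ∀ a A → (a ∷ A) ≋ padd (a ∷ []) (x· A)
  cons≋padd a A zero = sym (+-identityʳ a)
  cons≋padd a A (suc i) = refl

  pmul-constantʳ : ∀ a B → pmul B (a ∷ []) ≋ scale a B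
  pmul-constantʳ a B = ≋-trans {pmul B (a ∷ [])} {pmul B (scale a one)} {scale a B} (pmul-congʳ B (a ∷ []) (scale a one) constant≋scale)
        (≋-trans {pmul B (scale a one)} {scale a (pmul B one)} {scale a B} (scale-pmulʳ a B one)
           (scale-cong a (pmul B one) B (pmul-oneʳ B)))
    where
    constant≋scale : (a ∷ []) ≋ scale a one
    constant≋scale zero = sym (*-identityʳ a)
    constant≋scale (suc i) = refl

  pmul-comm : ∀ A B → pmul A B ≋ pmul B A
  pmul-comm [] B i = sym (pmul-zeroʳ B i)
  pmul-comm (a ∷ A) B i = begin
    coeffL (padd (scale a B) (x· (pmul A B))) i
      ≈⟨ padd-cong (scale a B) (scale a B) (x· (pmul A B)) (x· (pmul B A)) (≋-refl {scale a B})
           (x·-cong (pmul A B) (pmul B A) (pmul-comm A B)) i ⟩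
    coeffL (padd (scale a B) (x· (pmul B A))) i
      ≈⟨ sym
           (padd-cong (pmul B (a ∷ [])) (scale a B) (pmul B (x· A)) (x· (pmul B A)) (pmul-constantʳ a B) (x-pmulʳ B A) i) ⟩
    coeffL (padd (pmul B (a ∷ [])) (pmul B (x· A))) i ≈⟨ sym (pmul-distribˡ B (a ∷ []) (x· A) i) ⟩
    coeffL (pmul B (padd (a ∷ []) (x· A))) i ≈⟨ sym (pmul-congʳ B (a ∷ A) (padd (a ∷ []) (x· A)) (cons≋padd a A) i) ⟩
    coeffL (pmul B (a ∷ A)) i ∎

  pmul-assoc : ∀ A B C → pmul (pmul A B) C ≋ pmul A (pmul B C)
  pmul-assoc [] B C i = refl
  pmul-assoc (a ∷ A) B C i = begin
    coeffL (pmul (padd (scale a B) (x· (pmul A B))) C) i ≈⟨ pmul-distribʳ (scale a B) (x· (pmul A B)) C i ⟩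
    coeffL (padd (pmul (scale a B) C) (pmul (x· (pmul A B)) C)) i ≈⟨ padd-cong (pmul (scale a B) C) (scale a (pmul B C)) (pmul (x· (pmul A B)) C) (x· (pmul A (pmul B C))) (scale-pmulˡ a B C)
          (≋-trans {pmul (x· (pmul A B)) C} {x· (pmul (pmul A B) C)} {x· (pmul A (pmul B C))} (x-pmulˡ (pmul A B) C) (x·-cong (pmul (pmul A B) C) (pmul A (pmul B C)) (pmul-assoc A B C))) i ⟩
    coeffL (padd (scale a (pmul B C)) (x· (pmul A (pmul B C)))) i ∎

  padd-assoc : ∀ A B C → padd (padd A B) C ≋ padd A (padd B C)
  padd-assoc A B C i = trans (coeffL-padd (padd A B) C i)
        (trans (+-congʳ (coeffL-padd A B i))
           (trans (+-assoc _ _ _) (sym (trans (coeffL-padd A (padd B C) i) (+-congˡ (coeffL-padd B C i))))))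

  padd-comm : ∀ A B → padd A B ≋ padd B A
  padd-comm A B i = trans (coeffL-padd A B i) (trans (+-comm _ _) (sym (coeffL-padd B A i)))

  infix 4 _≈P_
  record _≈P_ (A B : List Carrier) : Set ℓ where
    constructor mk
    field get : A ≋ B
  open _≈P_ public

  polyRing : CommutativeRing c ℓ
  polyRing = record
    { Carrier = List Carrier ; _≈_ = _≈P_ ; _+_ = padd ; _*_ = pmul ; -_ = pneg ; 0# = [] ; 1# = one
    ; isCommutativeRing = record
      { isRing = record
        { +-isAbelianGroup = record
          { isGroup = record
            { isMonoid = record
              { isSemigroup = record
                { isMagma = record
                  { isEquivalence = record { refl = λ {A} → mk (≋-refl {A}) ; sym = λ {A} {B} e → mk (≋-sym {A} {B} (get e)) ; trans = λ {A} {B} {C} e f → mk (≋-trans {A} {B} {C} (get e) (get f)) }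
                  ; ∙-cong = λ {A} {A'} {B} {B'} e f → mk (padd-cong A A' B B' (get e) (get f)) }
                ; assoc = λ A B C → mk (padd-assoc A B C) }
              ; identity = (λ A → mk (λ i → refl)) , (λ A → mk (λ i → trans (coeffL-padd A [] i) (+-identityʳ _))) }
            ; inverse = (λ A → mk (λ i → trans (coeffL-padd (pneg A) A i) (trans (+-congʳ (coeffL-neg A i)) (-‿inverseˡ _))))
                      , (λ A → mk (λ i → trans (coeffL-padd A (pneg A) i) (trans (+-congˡ (coeffL-neg A i)) (-‿inverseʳ _))))
            ; ⁻¹-cong = λ {A} {B} e → mk (pneg-cong A B (get e)) }
          ; comm = λ A B → mk (padd-comm A B) }
        ; *-cong = λ {A} {A'} {B} {B'} e f → mk (≋-trans {pmul A B} {pmul A' B} {pmul A' B'} (pmul-congˡ A A' B (get e)) (pmul-congʳ A' B B' (get f)))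
        ; *-assoc = λ A B C → mk (pmul-assoc A B C)
        ; *-identity = (λ A → mk (pmul-oneˡ A)) , (λ A → mk (pmul-oneʳ A))
        ; distrib = (λ A B C → mk (pmul-distribˡ A B C)) , (λ A B C → mk (pmul-distribʳ B C A)) }
      ; *-comm = λ A B → mk (pmul-comm A B) } }

module PolynomialMaps {c ℓ} (R : CommutativeRing c ℓ) where
  open RingSolver R
  open Polynomials R
  open Lemma46 R using (padd; pmul; evalL)
  open import Data.Nat using (zero; suc)
  open import Data.List using (List; []; _∷_; map)
  open import Algebra.Morphism.Structures using (IsRingHomomorphism)

  constant : Carrier → List Carrier
  constant x = x ∷ []

  constant-isRingHomomorphism : IsRingHomomorphism rawRing (CommutativeRing.rawRing polyRing) constant
  constant-isRingHomomorphism = record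
    { isSemiringHomomorphism = record
      { isNearSemiringHomomorphism = record
        { +-isMonoidHomomorphism = record
          { isMagmaHomomorphism = record
            { isRelHomomorphism = record { cong = λ e → mk (λ { zero → e ; (suc i) → refl }) }
            ; homo = λ x y → mk (λ i → refl) }
          ; ε-homo = mk (λ { zero → refl ; (suc i) → refl }) }
        ; *-homo = λ x y → mk (λ { zero → sym (+-identityʳ _) ; (suc i) → refl }) }
      ; 1#-homo = mk (λ i → refl) }
    ; -‿homo = λ x → mk (λ i → refl) }

  evalAt : Carrier → List Carrier → Carrier
  evalAt x L = evalL L x

  evalAt-cong : ∀ x A B → A ≋ B → evalAt x A ≈ evalAt x B
  evalAt-cong x [] [] e = refl
  evalAt-cong x [] (b ∷ B) e = sym
        (trans (+-cong (sym (e 0)) (*-congˡ (sym (evalAt-cong x [] B (λ i → e (suc i))))))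
           (trans (+-identityˡ _) (zeroʳ x)))
  evalAt-cong x (a ∷ A) [] e = trans (+-cong (e 0) (*-congˡ (evalAt-cong x A [] (λ i → e (suc i))))) (trans (+-identityˡ _) (zeroʳ x))
  evalAt-cong x (a ∷ A) (b ∷ B) e = +-cong (e 0) (*-congˡ (evalAt-cong x A B (λ i → e (suc i))))

  evalAt-padd : ∀ x A B → evalAt x (padd A B) ≈ evalAt x A + evalAt x B
  evalAt-padd x [] B = sym (+-identityˡ _)
  evalAt-padd x (a ∷ A) [] = sym (trans (+-identityʳ _) refl)
  evalAt-padd x (a ∷ A) (b ∷ B) = trans (+-congˡ (*-congˡ (evalAt-padd x A B)))
    (solve 5 (λ a b x p q → (a :+ b) :+ x :* (p :+ q) := (a :+ x :* p) :+ (b :+ x :* q)) refl a b x _ _)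

  evalAt-scale : ∀ x a B → evalAt x (map (a *_) B) ≈ a * evalAt x B
  evalAt-scale x a [] = sym (zeroʳ a)
  evalAt-scale x a (b ∷ B) = trans (+-congˡ (*-congˡ (evalAt-scale x a B)))
    (solve 4 (λ a b x p → a :* b :+ x :* (a :* p) := a :* (b :+ x :* p)) refl a b x _)

  evalAt-pmul : ∀ x A B → evalAt x (pmul A B) ≈ evalAt x A * evalAt x B
  evalAt-pmul x [] B = sym (zeroˡ _)
  evalAt-pmul x (a ∷ A) B = begin
    evalAt x (padd (map (a *_) B) (0# ∷ pmul A B)) ≈⟨ evalAt-padd x (map (a *_) B) (0# ∷ pmul A B) ⟩
    evalAt x (map (a *_) B) + (0# + x * evalAt x (pmul A B))
      ≈⟨ +-cong (evalAt-scale x a B) (+-congˡ (*-congˡ (evalAt-pmul x A B))) ⟩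
    a * evalAt x B + (0# + x * (evalAt x A * evalAt x B))
      ≈⟨ solve 4 (λ a x p q → a :* q :+ (:0 :+ x :* (p :* q)) := (a :+ x :* p) :* q) refl a x _ _ ⟩
    (a + x * evalAt x A) * evalAt x B ∎

  evalAt-neg : ∀ x A → evalAt x (map (-_) A) ≈ - evalAt x A
  evalAt-neg x [] = sym -0#≈0#
  evalAt-neg x (a ∷ A) = trans (+-congˡ (*-congˡ (evalAt-neg x A)))
    (solve 3 (λ a x p → :- a :+ x :* (:- p) := :- (a :+ x :* p)) refl a x _)

  evalAt-isRingHomomorphism : ∀ x → IsRingHomomorphism (CommutativeRing.rawRing polyRing) rawRing (evalAt x)
  evalAt-isRingHomomorphism x = record
    { isSemiringHomomorphism = record
      { isNearSemiringHomomorphism = record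
        { +-isMonoidHomomorphism = record
          { isMagmaHomomorphism = record
            { isRelHomomorphism = record { cong = λ {A} {B} e → evalAt-cong x A B (get e) }
            ; homo = evalAt-padd x }
          ; ε-homo = refl }
        ; *-homo = evalAt-pmul x }
      ; 1#-homo = trans (+-congˡ (zeroʳ x)) (+-identityʳ 1#) }
    ; -‿homo = evalAt-neg x }

  X : List Carrier
  X = 0# ∷ 1# ∷ []

  X*-shift : ∀ A → pmul X A ≋ (0# ∷ A)
  X*-shift A = ≋-trans {pmul X A} {x· (pmul (1# ∷ []) A)} {0# ∷ A} (x-pmulˡ (1# ∷ []) A)
        (x·-cong (pmul (1# ∷ []) A) A (pmul-oneˡ A))

  X*-cancel : ∀ A B → pmul X A ≋ pmul X B → A ≋ B
  X*-cancel A B e i = trans (sym (X*-shift A (suc i))) (trans (e (suc i)) (X*-shift B (suc i)))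

  evalAt-X : ∀ x → evalAt x X ≈ x
  evalAt-X x = solve 1 (λ x → :0 :+ x :* (:1 :+ x :* :0) := x) refl x

  X*-cancelˡ : ∀ A B → pmul X A ≈P pmul X B → A ≈P B
  X*-cancelˡ A B e = mk (X*-cancel A B (get e))

  evalAt-constant : ∀ x r → evalAt x (constant r) ≈ r
  evalAt-constant x r = trans (+-congˡ (zeroʳ x)) (+-identityʳ r)

  evalAt-X*constant : ∀ x r → evalAt x (pmul X (constant r)) ≈ x * r
  evalAt-X*constant x r = trans (evalAt-pmul x X (constant r)) (*-cong (evalAt-X x) (evalAt-constant x r))

module LeadingCoefficientAsVariable {c ℓ} (R : CommutativeRing c ℓ) where
  open RingSolver R
  open Determinants R
  open DiscriminantMinor R
  open Lemma46 R using (disc)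
  open Polynomials R using (polyRing)
  open PolynomialMaps R using (X; evalAt; evalAt-isRingHomomorphism; X*-cancelˡ)
  open import Algebra.Morphism.Structures using (IsRingHomomorphism)
  open import Data.List using (List)
  open import Data.Nat using (ℕ; suc; ⌊_/2⌋) renaming (_+_ to _+ℕ_; _*_ to _*ℕ_)
  module T where
    open RingSolver polyRing public
    open Determinants polyRing public
    open Sylvester polyRing public
    open DiscriminantMinor polyRing public
    open Lemma46 polyRing public using (deriv)
  module H = Homomorphisms polyRing R

  -- disc divides the Sylvester determinant by the leading coefficient.  When that
  -- coefficient is the variable X of R[X] it is cancellable, so the quotient can be
  -- computed generically and only then specialised at X = C.
  disc-specialise : ∀ e (G : ℕ → List Carrier) (Y : List Carrier) (C : Carrier) {g : ℕ → Carrier} →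
    G (suc (suc e)) T.≈ X →
    T.detN (suc (suc e) +ℕ suc e) (T.sylN (suc (suc e)) (suc e) G (T.deriv G)) T.≈ X T.* Y →
    (∀ i → evalAt C (G i) ≈ g i) →
    disc (suc (suc e)) g ≈ sgn ⌊ suc (suc e) *ℕ suc e /2⌋ * evalAt C Y
  disc-specialise e G Y C {g} G-lead syl≈XY G≈g = begin
    disc (suc (suc e)) g                              ≈⟨ disc≈detN-discMinor e g ⟩
    sgn ⌊ suc (suc e) *ℕ suc e /2⌋ * detN n (discMinor e g) ≈⟨ *-congˡ specialised ⟩
    sgn ⌊ suc (suc e) *ℕ suc e /2⌋ * evalAt C Y          ∎
    where
    n : ℕ
    n = suc e +ℕ suc e
    open IsRingHomomorphism (evalAt-isRingHomomorphism C) using (⟦⟧-cong)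

    generic : T.detN n (T.discMinor e G) T.≈ Y
    generic = X*-cancelˡ _ _ (T.begin
      X T.* T.detN n (T.discMinor e G)                    T.≈⟨ T.*-congʳ (T.sym G-lead) ⟩
      G (suc (suc e)) T.* T.detN n (T.discMinor e G)
        T.≈⟨ T.sym (T.LeadingColumn.detN-sylvester-leadingColumn e G) ⟩
      T.detN (suc n) (T.sylN (suc (suc e)) (suc e) G (T.deriv G)) T.≈⟨ syl≈XY ⟩
      X T.* Y                                            T.∎)

    specialised : detN n (discMinor e g) ≈ evalAt C Y
    specialised = begin
      detN n (discMinor e g)
        ≈⟨ detN-cong n (λ r c _ _ → sym (trans (H.discMinor-homo (evalAt C) (evalAt-isRingHomomorphism C) e G r c)
                                                (discMinor-cong e G≈g r c))) ⟩
      detN n (λ r c → evalAt C (T.discMinor e G r c))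
        ≈⟨ sym (H.detN-homo (evalAt C) (evalAt-isRingHomomorphism C) n (T.discMinor e G)) ⟩
      evalAt C (T.detN n (T.discMinor e G))     ≈⟨ ⟦⟧-cong generic ⟩
      evalAt C Y                                 ∎

module DiscriminantOfSplitPolynomial {c ℓ} (R : CommutativeRing c ℓ) where
  open RingSolver R
  open Multiples R
  open Determinants R
  open CoefficientLists R
  open Sylvester R using (evalDesc)
  open Evaluation R
  open Indices
  open Lemma46 R using (coeffL; rootPoly; pow; deriv; disc; pairProd)
  open Polynomials R using (polyRing)
  open PolynomialMaps R
    using (constant; constant-isRingHomomorphism; evalAt; evalAt-isRingHomomorphism; X; evalAt-X; evalAt-constant; evalAt-X*constant)
  open LeadingCoefficientAsVariable R using (disc-specialise)
  open import Algebra.Morphism.Structures using (IsRingHomomorphism)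
  open import Data.Nat using (ℕ; suc; ⌊_/2⌋) renaming (_+_ to _+ℕ_; _*_ to _*ℕ_)
  open import Data.List using (List; []; _∷_; map; length)
  open import Data.List.Properties using (length-map)
  import Relation.Binary.PropositionalEquality as P
  open import Relation.Binary.PropositionalEquality using (_≡_)
  module T where
    open RingSolver polyRing public
    open Multiples polyRing public
    open Determinants polyRing public
    open Sylvester polyRing public
    open Evaluation polyRing public
    open Lemma46 polyRing public using (coeffL; rootPoly; pow; deriv)
  module H = Homomorphisms R polyRing
  module H′ = Homomorphisms polyRing R
  module K = IsRingHomomorphism constant-isRingHomomorphism

  module _ (e : ℕ) (ρ : List Carrier) (ρ-length : length ρ ≡ suc (suc e)) where
    private
      m d : ℕ
      m = suc e
      d = suc m

      r : ℕ → Carrier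
      r = coeffL (rootPoly ρ)

      Π′ : Carrier
      Π′ = ∏ (derivRootPoly ρ) ρ

      G̃ : ℕ → List Carrier
      G̃ i = X T.* constant (r i)

      G̃-split : ∀ i → G̃ i T.≈ X T.* T.coeffL (T.rootPoly (map constant ρ)) i
      G̃-split i = T.*-congˡ {X} (T.sym (H.rootPoly-homo constant constant-isRingHomomorphism ρ i))

      G̃-lead : G̃ d T.≈ X
      G̃-lead = T.trans (T.*-congˡ {X} (T.trans (K.⟦⟧-cong r-lead) K.1#-homo)) (T.*-identityʳ X)
        where
        r-lead : r d ≈ 1#
        r-lead = P.subst (λ k → r k ≈ 1#) ρ-length (coeffL-rootPoly-leading ρ)

      G̃′≈ : ∀ i → T.deriv G̃ i T.≈ X T.* constant (deriv r i)
      G̃′≈ i = T.trans (T.nat·-*ˡ (suc i) X (constant (r (suc i))))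
        (T.*-congˡ {X} (T.sym (H.nat·-homo constant constant-isRingHomomorphism (suc i) (r (suc i)))))

      G̃′-atRoot : ∀ x → T.evalDesc m (T.deriv G̃) (constant x) T.≈ X T.* constant (derivRootPoly ρ x)
      G̃′-atRoot x = T.begin
        T.evalDesc m (T.deriv G̃) (constant x)                     T.≈⟨ T.evalDesc-cong m (constant x) G̃′≈ ⟩
        T.evalDesc m (λ i → X T.* constant (deriv r i)) (constant x)
          T.≈⟨ T.evalDesc-scale m (λ i → constant (deriv r i)) X (constant x) ⟩
        X T.* T.evalDesc m (λ i → constant (deriv r i)) (constant x)
          T.≈⟨ T.*-congˡ {X} (T.sym (H.evalDesc-homo constant constant-isRingHomomorphism m (deriv r) x)) ⟩
        X T.* constant (evalDesc m (deriv r) x)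
          T.≈⟨ T.*-congˡ {X} (K.⟦⟧-cong (evalDesc-derivRootPoly ρ m x ρ-length)) ⟩
        X T.* constant (derivRootPoly ρ x)                         T.∎

      ∏-G̃′ : ∀ L → T.∏ (T.evalDesc m (T.deriv G̃)) (map constant L) T.≈ T.pow X (length L) T.* constant (∏ (derivRootPoly ρ) L)
      ∏-G̃′ [] = T.sym (T.*-identityˡ (constant 1#))
      ∏-G̃′ (x ∷ L) = T.begin
        T.evalDesc m (T.deriv G̃) (constant x) T.* T.∏ (T.evalDesc m (T.deriv G̃)) (map constant L)
          T.≈⟨ T.*-cong (G̃′-atRoot x) (∏-G̃′ L) ⟩
        (X T.* constant (derivRootPoly ρ x)) T.* (T.pow X (length L) T.* constant (∏ (derivRootPoly ρ) L))
          T.≈⟨ T.solve 4 (λ t a p b → (t T.:* a) T.:* (p T.:* b) T.:= (t T.:* p) T.:* (a T.:* b))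
                 T.refl X (constant (derivRootPoly ρ x)) (T.pow X (length L)) (constant (∏ (derivRootPoly ρ) L)) ⟩
        T.pow X (suc (length L)) T.* (constant (derivRootPoly ρ x) T.* constant (∏ (derivRootPoly ρ) L))
          T.≈⟨ T.*-congˡ {T.pow X (suc (length L))} (T.sym (K.*-homo (derivRootPoly ρ x) (∏ (derivRootPoly ρ) L))) ⟩
        T.pow X (suc (length L)) T.* constant (∏ (derivRootPoly ρ) (x ∷ L)) T.∎

      sylvester-G̃ : T.detN (d +ℕ m) (T.sylN d m G̃ (T.deriv G̃)) T.≈ X T.* (T.pow X (m +ℕ m) T.* constant Π′)
      sylvester-G̃ = T.begin
        T.detN (d +ℕ m) (T.sylN d m G̃ (T.deriv G̃))
          T.≈⟨ P.subst (λ k → T.detN (k +ℕ m) (T.sylN k m G̃ (T.deriv G̃)) T.≈ T.pow X m T.* T.∏ (T.evalDesc m (T.deriv G̃)) (map constant ρ))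
                 (P.trans (length-map constant ρ) ρ-length)
                 (T.sylvester-poisson′ m (map constant ρ) G̃ (T.deriv G̃) X G̃-split) ⟩
        T.pow X m T.* T.∏ (T.evalDesc m (T.deriv G̃)) (map constant ρ)
          T.≈⟨ T.*-congˡ {T.pow X m}
                 (T.trans (∏-G̃′ ρ) (T.reflexive (P.cong (λ k → T.pow X k T.* constant Π′) ρ-length))) ⟩
        T.pow X m T.* ((X T.* T.pow X m) T.* constant Π′)
          T.≈⟨ T.solve 3 (λ t p z → p T.:* ((t T.:* p) T.:* z) T.:= t T.:* ((p T.:* p) T.:* z)) T.refl X (T.pow X m)
                 (constant Π′) ⟩
        X T.* ((T.pow X m T.* T.pow X m) T.* constant Π′)
          T.≈⟨ T.*-congˡ {X} (T.*-congʳ (T.sym (T.pow-+ X m m))) ⟩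
        X T.* (T.pow X (m +ℕ m) T.* constant Π′) T.∎

      evalAt-Y : ∀ C → evalAt C (T.pow X (m +ℕ m) T.* constant Π′) ≈ pow C (m +ℕ m) * Π′
      evalAt-Y C = trans (E.*-homo (T.pow X (m +ℕ m)) (constant Π′))
        (*-cong (trans (H′.pow-homo (evalAt C) (evalAt-isRingHomomorphism C) X (m +ℕ m)) (pow-cong (m +ℕ m) (evalAt-X C)))
                (evalAt-constant C Π′))
        where module E = IsRingHomomorphism (evalAt-isRingHomomorphism C)

    disc-splitPolynomial : ∀ C {G : ℕ → Carrier} → (∀ i → G i ≈ C * coeffL (rootPoly ρ) i) →
      disc (suc (suc e)) G ≈ pow C (suc e +ℕ suc e) * pairProd (λ x → x) ρ
    disc-splitPolynomial C {G} G≈ = begin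
      disc d G
        ≈⟨ disc-specialise e G̃ _ C G̃-lead sylvester-G̃ (λ i → trans (evalAt-X*constant C (r i)) (sym (G≈ i))) ⟩
      sgn ⌊ d *ℕ m /2⌋ * evalAt C (T.pow X (m +ℕ m) T.* constant Π′)
        ≈⟨ *-cong (reflexive (P.cong sgn (⌊n*[n-1]/2⌋≡triangle e))) (evalAt-Y C) ⟩
      sgn (triangle d) * (pow C (m +ℕ m) * Π′)
        ≈⟨ *-congˡ (*-congˡ (P.subst (λ k → Π′ ≈ sgn (triangle k) * pairProd (λ x → x) ρ) ρ-length (∏-derivRootPoly ρ))) ⟩
      sgn (triangle d) * (pow C (m +ℕ m) * (sgn (triangle d) * pairProd (λ x → x) ρ))
        ≈⟨ solve 3 (λ s c p → s :* (c :* (s :* p)) := (s :* s) :* (c :* p)) refl _ _ _ ⟩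
      (sgn (triangle d) * sgn (triangle d)) * (pow C (m +ℕ m) * pairProd (λ x → x) ρ)
        ≈⟨ trans (*-congʳ (sgn-square (triangle d))) (*-identityˡ _) ⟩
      pow C (m +ℕ m) * pairProd (λ x → x) ρ ∎

module DiscriminantViaCriticalPoints {c ℓ} (R : CommutativeRing c ℓ) where
  open RingSolver R
  open Multiples R
  open Determinants R
  open Sylvester R using (evalDesc)
  open Evaluation R
  open Lemma46 R using (coeffL; rootPoly; pow; nat·; deriv; disc)
  open Polynomials R using (polyRing)
  open PolynomialMaps R
    using (constant; constant-isRingHomomorphism; evalAt; evalAt-isRingHomomorphism; X; evalAt-X; evalAt-constant; evalAt-X*constant)
  open LeadingCoefficientAsVariable R using (disc-specialise)
  open import Algebra.Morphism.Structures using (IsRingHomomorphism)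
  open import Data.Nat using (ℕ; zero; suc; ⌊_/2⌋) renaming (_+_ to _+ℕ_; _*_ to _*ℕ_)
  open import Data.List using (List; map; length)
  open import Data.List.Properties using (length-map)
  import Relation.Binary.PropositionalEquality as P
  open import Relation.Binary.PropositionalEquality using (_≡_)
  module T where
    open RingSolver polyRing public
    open Multiples polyRing public
    open Determinants polyRing public
    open Sylvester polyRing public
    open Lemma46 polyRing public using (coeffL; rootPoly; pow; nat·; deriv)
  module H = Homomorphisms R polyRing
  module H′ = Homomorphisms polyRing R
  module K = IsRingHomomorphism constant-isRingHomomorphism

  -- g = g₀ + a (F - F₀) with F monic of degree d and F′ = d ∏ (x - sⱼ), so that
  -- g′ = d a ∏ (x - sⱼ) and the sⱼ are the critical points of g.
  module WithCriticalPoints (e : ℕ) (g₀ a : Carrier) (F : ℕ → Carrier) (ss : List Carrier)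
           (ss-length : length ss ≡ suc e) (F-lead : F (suc (suc e)) ≈ 1#)
           (F-deriv : ∀ i → nat· (suc i) (F (suc i)) ≈ nat· (suc (suc e)) 1# * coeffL (rootPoly ss) i) where

    g : ℕ → Carrier
    g zero = g₀
    g (suc i) = a * F (suc i)

    private
      d k : ℕ
      d = suc (suc e)
      k = suc e

      n : Carrier
      n = nat· d 1#

      G̃ : ℕ → List Carrier
      G̃ zero = constant g₀
      G̃ (suc i) = X T.* constant (F (suc i))

      Π̃ : List Carrier
      Π̃ = T.∏ (T.evalDesc d G̃) (map constant ss)

      Y : List Carrier
      Y = T.sgn (d *ℕ k) T.* (T.pow X k T.* (T.pow (constant n) d T.* Π̃))

      G̃-lead : G̃ d T.≈ X
      G̃-lead = T.trans (T.*-congˡ {X} (T.trans (K.⟦⟧-cong F-lead) K.1#-homo)) (T.*-identityʳ X)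

      G̃′-split : ∀ i → T.deriv G̃ i T.≈ (X T.* constant n) T.* T.coeffL (T.rootPoly (map constant ss)) i
      G̃′-split i = T.begin
        T.nat· (suc i) (X T.* constant (F (suc i)))      T.≈⟨ T.nat·-*ˡ (suc i) X (constant (F (suc i))) ⟩
        X T.* T.nat· (suc i) (constant (F (suc i)))
          T.≈⟨ T.*-congˡ {X} (T.sym (H.nat·-homo constant constant-isRingHomomorphism (suc i) (F (suc i)))) ⟩
        X T.* constant (nat· (suc i) (F (suc i)))         T.≈⟨ T.*-congˡ {X} (K.⟦⟧-cong (F-deriv i)) ⟩
        X T.* constant (n * coeffL (rootPoly ss) i)       T.≈⟨ T.*-congˡ {X} (K.*-homo n (coeffL (rootPoly ss) i)) ⟩
        X T.* (constant n T.* constant (coeffL (rootPoly ss) i))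
          T.≈⟨ T.sym (T.*-assoc X (constant n) (constant (coeffL (rootPoly ss) i))) ⟩
        (X T.* constant n) T.* constant (coeffL (rootPoly ss) i)
          T.≈⟨ T.*-congˡ {X T.* constant n} (T.sym (H.rootPoly-homo constant constant-isRingHomomorphism ss i)) ⟩
        (X T.* constant n) T.* T.coeffL (T.rootPoly (map constant ss)) i T.∎

      sylvester-G̃ : T.detN (d +ℕ k) (T.sylN d k G̃ (T.deriv G̃)) T.≈ X T.* Y
      sylvester-G̃ = T.begin
        T.detN (d +ℕ k) (T.sylN d k G̃ (T.deriv G̃))
          T.≈⟨ P.subst (λ l → T.detN (d +ℕ l) (T.sylN d l G̃ (T.deriv G̃)) T.≈ T.sgn (d *ℕ l) T.* (T.pow (X T.* constant n) d T.* Π̃))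
                 (P.trans (length-map constant ss) ss-length)
                 (T.sylvester-poisson d (map constant ss) G̃ (T.deriv G̃) (X T.* constant n) G̃′-split) ⟩
        T.sgn (d *ℕ k) T.* (T.pow (X T.* constant n) d T.* Π̃)
          T.≈⟨ T.*-congˡ {T.sgn (d *ℕ k)} (T.*-congʳ (T.pow-* X (constant n) d)) ⟩
        T.sgn (d *ℕ k) T.* ((X T.* T.pow X k T.* T.pow (constant n) d) T.* Π̃)
          T.≈⟨ T.solve 5 (λ s x p q π → s T.:* ((x T.:* p T.:* q) T.:* π) T.:= x T.:* (s T.:* (p T.:* (q T.:* π))))
                 T.refl (T.sgn (d *ℕ k)) X (T.pow X k) (T.pow (constant n) d) Π̃ ⟩
        X T.* Y T.∎

      evalAt-G̃ : ∀ i → evalAt a (G̃ i) ≈ g i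
      evalAt-G̃ zero = evalAt-constant a g₀
      evalAt-G̃ (suc i) = evalAt-X*constant a (F (suc i))

      module E = IsRingHomomorphism (evalAt-isRingHomomorphism a)

      evalAt-Π̃ : evalAt a Π̃ ≈ ∏ (evalDesc d g) ss
      evalAt-Π̃ = begin
        evalAt a Π̃
          ≈⟨ H′.∏-homo (evalAt a) (evalAt-isRingHomomorphism a) (T.evalDesc d G̃) (map constant ss) ⟩
        ∏ (λ y → evalAt a (T.evalDesc d G̃ y)) (map constant ss) ≈⟨ ∏-map _ _ constant ss (λ _ → refl) ⟩
        ∏ (λ x → evalAt a (T.evalDesc d G̃ (constant x))) ss   ≈⟨ ∏-cong ss (λ x _ → atPoint x) ⟩
        ∏ (evalDesc d g) ss                                   ∎
        where
        atPoint : ∀ x → evalAt a (T.evalDesc d G̃ (constant x)) ≈ evalDesc d g x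
        atPoint x = begin
          evalAt a (T.evalDesc d G̃ (constant x))
            ≈⟨ H′.evalDesc-homo (evalAt a) (evalAt-isRingHomomorphism a) d G̃ (constant x) ⟩
          evalDesc d (λ i → evalAt a (G̃ i)) (evalAt a (constant x)) ≈⟨ evalDesc-cong d _ evalAt-G̃ ⟩
          evalDesc d g (evalAt a (constant x))                     ≈⟨ evalDesc-congˣ d g (evalAt-constant a x) ⟩
          evalDesc d g x                                           ∎

      evalAt-Y : evalAt a Y ≈ sgn (d *ℕ k) * (pow a k * (pow n d * ∏ (evalDesc d g) ss))
      evalAt-Y = begin
        evalAt a Y ≈⟨ E.*-homo (T.sgn (d *ℕ k)) (T.pow X k T.* (T.pow (constant n) d T.* Π̃)) ⟩
        evalAt a (T.sgn (d *ℕ k)) * evalAt a (T.pow X k T.* (T.pow (constant n) d T.* Π̃))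
          ≈⟨ *-cong (H′.sgn-homo (evalAt a) (evalAt-isRingHomomorphism a) (d *ℕ k))
                    (trans (E.*-homo (T.pow X k) (T.pow (constant n) d T.* Π̃))
                      (*-cong powX (trans (E.*-homo (T.pow (constant n) d) Π̃) (*-cong powN evalAt-Π̃)))) ⟩
        sgn (d *ℕ k) * (pow a k * (pow n d * ∏ (evalDesc d g) ss)) ∎
        where
        powX : evalAt a (T.pow X k) ≈ pow a k
        powX = trans (H′.pow-homo (evalAt a) (evalAt-isRingHomomorphism a) X k) (pow-cong k (evalAt-X a))
        powN : evalAt a (T.pow (constant n) d) ≈ pow n d
        powN = trans (H′.pow-homo (evalAt a) (evalAt-isRingHomomorphism a) (constant n) d)
              (pow-cong d (evalAt-constant a n))

    disc≈∏criticalValues : disc (suc (suc e)) g ≈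
      sgn ⌊ suc (suc e) *ℕ suc e /2⌋ * (sgn (suc (suc e) *ℕ suc e) *
        (pow a (suc e) * (pow (nat· (suc (suc e)) 1#) (suc (suc e)) * ∏ (evalDesc (suc (suc e)) g) ss)))
    disc≈∏criticalValues = trans (disc-specialise e G̃ Y a G̃-lead sylvester-G̃ evalAt-G̃) (*-congˡ evalAt-Y)

module ProofOfLemma46 {c ℓ} (K : CommutativeRing c ℓ) where
  open RingSolver K
  open Multiples K
  open Determinants K
  open CoefficientLists K
  open Sylvester K using (evalDesc)
  open Evaluation K
  open Indices
  open Lemma46 K using (IsField; CharZero; fCoeff; fEval; fCoeffA0; D; DD0; coeffL; rootPoly; nat·; pow; deriv; pairProd)
  open Polynomials K using (polyRing; mk; get; _≋_)
  open PolynomialMaps K using (constant; constant-isRingHomomorphism; X)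
  open DiscriminantOfSplitPolynomial K using (disc-splitPolynomial)
  open import Algebra.Morphism.Structures using (IsRingHomomorphism)
  open import Data.Nat using (ℕ; zero; suc; _<_; _≤_; _∸_; s≤s; ⌊_/2⌋) renaming (_+_ to _+ℕ_; _*_ to _*ℕ_)
  import Data.Nat.Properties as NP
  open import Data.List using (List; []; _∷_; map; length)
  open import Data.List.Properties using (length-map)
  open import Data.Vec using (Vec; lookup; toList)
  open import Data.Vec.Properties using (length-toList)
  open import Data.Fin using (fromℕ)
  open import Data.Product using (proj₁; proj₂)
  open import Data.Sum using (inj₁; inj₂)
  import Relation.Binary.PropositionalEquality as P
  open import Relation.Binary.PropositionalEquality using (_≡_)
  module A₀ where
    open RingSolver polyRing public
    open Multiples polyRing public
    open Determinants polyRing public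
    open Sylvester polyRing public using (evalDesc)
    open Evaluation polyRing public using (evalUpTo; evalDesc≈evalUpTo; evalDesc-cong)
    open DiscriminantMinor polyRing public using (disc-cong)
    open Lemma46 polyRing public using (coeffL; rootPoly; nat·; pow; disc)
  module H = Homomorphisms K polyRing
  module C = IsRingHomomorphism constant-isRingHomomorphism

  module DiscriminantInA₀ (isField : IsField) (charZero : CharZero) (e : ℕ)
           (a : Vec Carrier (suc (suc (suc e)))) (s : Vec Carrier (suc e))
           (f′-split : ∀ i → i < suc (suc e) →
              deriv (fCoeff a) i ≈ nat· (suc (suc e)) (lookup a (fromℕ (suc (suc e)))) * coeffL (rootPoly (toList s)) i) where
    private
      n : ℕ
      n = suc (suc e)

      aₙ N : Carrier
      aₙ = lookup a (fromℕ n)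
      N = nat· n 1#

      A : ℕ → Carrier
      A = fCoeff a

      ss : List Carrier
      ss = toList s

      r : ℕ → Carrier
      r = coeffL (rootPoly ss)

      ss-length : length ss ≡ suc e
      ss-length = length-toList s

      inv : ℕ → Carrier
      inv k = proj₁ (isField (nat· (suc k) 1#) (charZero k))

      inv-correct : ∀ k → nat· (suc k) 1# * inv k ≈ 1#
      inv-correct k = proj₂ (isField (nat· (suc k) 1#) (charZero k))

      -- F = (f - a₀) / aₙ, obtained by integrating f′ / aₙ = n ∏ (x - sⱼ) so that no
      -- division by aₙ (which may vanish) is needed.
      F : ℕ → Carrier
      F zero = 0#
      F (suc j) = inv j * (N * r j)

      F-deriv : ∀ j → nat· (suc j) (F (suc j)) ≈ N * r j
      F-deriv j = begin
        nat· (suc j) (inv j * (N * r j))       ≈⟨ nat·≈nat·1* (suc j) _ ⟩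
        nat· (suc j) 1# * (inv j * (N * r j))  ≈⟨ sym (*-assoc _ _ _) ⟩
        (nat· (suc j) 1# * inv j) * (N * r j)  ≈⟨ *-congʳ (inv-correct j) ⟩
        1# * (N * r j)                         ≈⟨ *-identityˡ _ ⟩
        N * r j                                ∎

      F-lead : F n ≈ 1#
      F-lead = begin
        inv (suc e) * (N * r (suc e))
          ≈⟨ *-congˡ (*-congˡ (P.subst (λ k → r k ≈ 1#) ss-length (coeffL-rootPoly-leading ss))) ⟩
        inv (suc e) * (N * 1#)  ≈⟨ trans (*-congˡ (*-identityʳ N)) (*-comm _ _) ⟩
        N * inv (suc e)         ≈⟨ inv-correct (suc e) ⟩
        1#                      ∎

      A≈aₙF : ∀ j → A (suc j) ≈ aₙ * F (suc j)
      A≈aₙF j with NP.<-≤-connex j n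
      ... | inj₁ j<n = begin
        A (suc j)                              ≈⟨ sym (trans (*-congʳ (inv-correct j)) (*-identityˡ _)) ⟩
        (nat· (suc j) 1# * inv j) * A (suc j)  ≈⟨ solve 3 (λ u v w → (u :* v) :* w := v :* (u :* w)) refl _ _ _ ⟩
        inv j * (nat· (suc j) 1# * A (suc j))  ≈⟨ *-congˡ (sym (nat·≈nat·1* (suc j) _)) ⟩
        inv j * nat· (suc j) (A (suc j))       ≈⟨ *-congˡ (f′-split j j<n) ⟩
        inv j * (nat· n aₙ * r j)              ≈⟨ *-congˡ (*-congʳ (nat·≈nat·1* n aₙ)) ⟩
        inv j * ((N * aₙ) * r j)
          ≈⟨ solve 4 (λ i m v w → i :* ((m :* v) :* w) := v :* (i :* (m :* w))) refl _ _ _ _ ⟩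
        aₙ * (inv j * (N * r j))               ∎
      ... | inj₂ n≤j = begin
        A (suc j)
          ≈⟨ reflexive (coeffL-≥length (toList a) (suc j) (P.subst (_≤ suc j) (P.sym (length-toList a)) (s≤s n≤j))) ⟩
        0#
          ≈⟨ sym (trans (*-congˡ (trans (*-congˡ (trans (*-congˡ r-vanishes) (zeroʳ N))) (zeroʳ _))) (zeroʳ aₙ)) ⟩
        aₙ * (inv j * (N * r j)) ∎
        where
        r-vanishes : r j ≈ 0#
        r-vanishes = coeffL-rootPoly-above ss j (P.subst (_< j) (P.sym ss-length) n≤j)

    γ : Carrier → Carrier
    γ x = x * evalUpTo (suc e) (λ i → A (suc i)) x

    ρs : List Carrier
    ρs = map (λ x → - γ x) ss

    f≈a₀+γ : ∀ x → fEval a x ≈ A 0 + γ x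
    f≈a₀+γ x = evalL≈evalUpTo (toList a) n x (NP.≤-reflexive (length-toList a))

    module Generic = DiscriminantViaCriticalPoints.WithCriticalPoints polyRing e X (constant aₙ) (λ i → constant (F i))
          (map constant ss)
      (P.trans (length-map constant ss) ss-length)
      (A₀.trans (C.⟦⟧-cong F-lead) C.1#-homo)
      (λ i → A₀.begin
        A₀.nat· (suc i) (constant (F (suc i)))
          A₀.≈⟨ A₀.sym (H.nat·-homo constant constant-isRingHomomorphism (suc i) (F (suc i))) ⟩
        constant (nat· (suc i) (F (suc i)))       A₀.≈⟨ C.⟦⟧-cong (F-deriv i) ⟩
        constant (N * r i)                        A₀.≈⟨ C.*-homo N (r i) ⟩
        constant N A₀.* constant (r i)
          A₀.≈⟨ A₀.*-cong (H.nat·-homo constant constant-isRingHomomorphism n 1#)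
                  (A₀.sym (H.rootPoly-homo constant constant-isRingHomomorphism ss i)) ⟩
        A₀.nat· n A₀.1# A₀.* A₀.coeffL (A₀.rootPoly (map constant ss)) i A₀.∎)

    private
      fCoeffA0≈g : ∀ i → fCoeffA0 a i A₀.≈ Generic.g i
      fCoeffA0≈g zero = A₀.refl
      fCoeffA0≈g (suc i) = A₀.trans (C.⟦⟧-cong (A≈aₙF i)) (C.*-homo aₙ (F (suc i)))

      criticalValue : ∀ x → A₀.evalDesc n Generic.g (constant x) A₀.≈ (- (- γ x)) ∷ 1# ∷ []
      criticalValue x = A₀.begin
        A₀.evalDesc n Generic.g (constant x)   A₀.≈⟨ A₀.evalDesc-cong n (constant x) (λ i → A₀.sym (fCoeffA0≈g i)) ⟩
        A₀.evalDesc n (fCoeffA0 a) (constant x) A₀.≈⟨ A₀.evalDesc≈evalUpTo n (fCoeffA0 a) (constant x) ⟩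
        X A₀.+ constant x A₀.* A₀.evalUpTo (suc e) (λ i → constant (A (suc i))) (constant x)
          A₀.≈⟨ A₀.+-congˡ {X}
                  (A₀.*-congˡ {constant x}
                     (A₀.sym (H.evalUpTo-homo constant constant-isRingHomomorphism (suc e) (λ i → A (suc i)) x))) ⟩
        X A₀.+ constant x A₀.* constant (evalUpTo (suc e) (λ i → A (suc i)) x)
          A₀.≈⟨ A₀.+-congˡ {X} (A₀.sym (C.*-homo x (evalUpTo (suc e) (λ i → A (suc i)) x))) ⟩
        X A₀.+ constant (γ x)                  A₀.≈⟨ mk coefficients ⟩
        (- (- γ x)) ∷ 1# ∷ []                  A₀.∎
        where
        coefficients : (X A₀.+ constant (γ x)) ≋ ((- (- γ x)) ∷ 1# ∷ [])
        coefficients zero = trans (+-identityˡ _) (sym (-‿involutive _))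
        coefficients (suc zero) = refl
        coefficients (suc (suc i)) = refl

      ∏criticalValues : A₀.∏ (A₀.evalDesc n Generic.g) (map constant ss) A₀.≈ rootPoly ρs
      ∏criticalValues = A₀.trans (A₀.∏-map _ _ constant ss (λ _ → A₀.refl)) (factors ss)
        where
        factors : ∀ L → A₀.∏ (λ x → A₀.evalDesc n Generic.g (constant x)) L A₀.≈ rootPoly (map (λ x → - γ x) L)
        factors [] = A₀.refl
        factors (x ∷ L) = A₀.*-cong (criticalValue x) (factors L)

    Cst : Carrier
    Cst = sgn ⌊ n *ℕ suc e /2⌋ * (sgn (n *ℕ suc e) * (pow aₙ (suc e) * pow N n))

    private
      D≈Cst*rootPoly : D n a A₀.≈ constant Cst A₀.* rootPoly ρs
      D≈Cst*rootPoly = A₀.begin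
        D n a                     A₀.≈⟨ A₀.disc-cong n fCoeffA0≈g ⟩
        A₀.disc n Generic.g        A₀.≈⟨ Generic.disc≈∏criticalValues ⟩
        A₀.sgn s₁ A₀.* (A₀.sgn s₂ A₀.* (A₀.pow (constant aₙ) (suc e) A₀.* (A₀.pow (A₀.nat· n A₀.1#) n A₀.* A₀.∏ (A₀.evalDesc n Generic.g) (map constant ss))))
          A₀.≈⟨ A₀.*-cong (sgn≈ s₁) (A₀.*-cong (sgn≈ s₂) (A₀.*-cong (pow≈ aₙ (suc e))
                 (A₀.*-cong (A₀.trans (A₀.pow-cong n (A₀.sym (H.nat·-homo constant constant-isRingHomomorphism n 1#))) (pow≈ N n))
                            ∏criticalValues))) ⟩
        constant (sgn s₁) A₀.* (constant (sgn s₂) A₀.* (constant (pow aₙ (suc e)) A₀.* (constant (pow N n) A₀.* rootPoly ρs)))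
          A₀.≈⟨ A₀.solve 5
                  (λ u v w z ρ → u A₀.:* (v A₀.:* (w A₀.:* (z A₀.:* ρ))) A₀.:= (u A₀.:* (v A₀.:* (w A₀.:* z))) A₀.:* ρ)
                  A₀.refl (constant (sgn s₁))
                  (constant (sgn s₂))
                  (constant (pow aₙ (suc e)))
                  (constant (pow N n)) (rootPoly ρs) ⟩
        (constant (sgn s₁) A₀.* (constant (sgn s₂) A₀.* (constant (pow aₙ (suc e)) A₀.* constant (pow N n)))) A₀.* rootPoly ρs
          A₀.≈⟨ A₀.*-congʳ (A₀.sym (A₀.trans (C.*-homo (sgn s₁) (sgn s₂ * (pow aₙ (suc e) * pow N n))) (A₀.*-congˡ {constant (sgn s₁)}
                 (A₀.trans (C.*-homo (sgn s₂) (pow aₙ (suc e) * pow N n)) (A₀.*-congˡ {constant (sgn s₂)} (C.*-homo (pow aₙ (suc e)) (pow N n))))))) ⟩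
        constant Cst A₀.* rootPoly ρs A₀.∎
        where
        s₁ s₂ : ℕ
        s₁ = ⌊ n *ℕ suc e /2⌋
        s₂ = n *ℕ suc e
        sgn≈ : ∀ k → A₀.sgn k A₀.≈ constant (sgn k)
        sgn≈ k = A₀.sym (H.sgn-homo constant constant-isRingHomomorphism k)
        pow≈ : ∀ x k → A₀.pow (constant x) k A₀.≈ constant (pow x k)
        pow≈ x k = A₀.sym (H.pow-homo constant constant-isRingHomomorphism x k)

    D-split : ∀ i → coeffL (D n a) i ≈ Cst * coeffL (rootPoly ρs) i
    D-split i = trans (get D≈Cst*rootPoly i) (coeffL-pmul-constant Cst (rootPoly ρs) i)

  module Formula (isField : IsField) (charZero : CharZero) (e : ℕ)
                 (a : Vec Carrier (suc (suc (suc (suc e))))) (s : Vec Carrier (suc (suc e)))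
                 (f′-split : ∀ i → i < suc (suc (suc e)) →
                    deriv (fCoeff a) i ≈ nat· (suc (suc (suc e))) (lookup a (fromℕ (suc (suc (suc e))))) * coeffL (rootPoly (toList s)) i) where
    open DiscriminantInA₀ isField charZero (suc e) a s f′-split
    private
      n m : ℕ
      n = suc (suc (suc e))
      m = suc e

      aₙ N σ : Carrier
      aₙ = lookup a (fromℕ n)
      N = nat· n 1#
      σ = sgn ⌊ n *ℕ suc m /2⌋ * sgn (n *ℕ suc m)

      ρs-length : length ρs ≡ suc (suc e)
      ρs-length = P.trans (length-map (λ x → - γ x) (toList s)) (length-toList s)

      σ-involution : σ * σ ≈ 1#
      σ-involution = begin
        σ * σ ≈⟨ solve 2 (λ u v → (u :* v) :* (u :* v) := (u :* u) :* (v :* v)) refl _ _ ⟩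
        (sgn ⌊ n *ℕ suc m /2⌋ * sgn ⌊ n *ℕ suc m /2⌋) * (sgn (n *ℕ suc m) * sgn (n *ℕ suc m))
          ≈⟨ *-cong (sgn-square ⌊ n *ℕ suc m /2⌋) (sgn-square (n *ℕ suc m)) ⟩
        1# * 1# ≈⟨ *-identityˡ 1# ⟩
        1# ∎

      pow-Cst : pow Cst (m +ℕ m) ≈ pow N (2 *ℕ n *ℕ (n ∸ 2)) * pow aₙ (2 *ℕ (n ∸ 1) *ℕ (n ∸ 2))
      pow-Cst = begin
        pow Cst (m +ℕ m)
          ≈⟨ pow-cong (m +ℕ m)
               (solve 4 (λ u v p q → u :* (v :* (p :* q)) := (u :* v) :* (p :* q)) refl _ _ (pow aₙ (suc m)) (pow N n)) ⟩
        pow (σ * (pow aₙ (suc m) * pow N n)) (m +ℕ m)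
          ≈⟨ trans (pow-* σ _ (m +ℕ m)) (*-cong (pow-involution σ m σ-involution) (pow-* _ _ (m +ℕ m))) ⟩
        1# * (pow (pow aₙ (suc m)) (m +ℕ m) * pow (pow N n) (m +ℕ m))
          ≈⟨ trans (*-identityˡ _) (*-cong (pow-pow aₙ (suc m) (m +ℕ m)) (pow-pow N n (m +ℕ m))) ⟩
        pow aₙ (suc m *ℕ (m +ℕ m)) * pow N (n *ℕ (m +ℕ m))
          ≈⟨ *-cong (reflexive (P.cong (pow aₙ) (exponent-aₙ e))) (reflexive (P.cong (pow N) (exponent-N e))) ⟩
        pow aₙ (2 *ℕ (n ∸ 1) *ℕ (n ∸ 2)) * pow N (2 *ℕ n *ℕ (n ∸ 2))
          ≈⟨ *-comm _ _ ⟩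
        pow N (2 *ℕ n *ℕ (n ∸ 2)) * pow aₙ (2 *ℕ (n ∸ 1) *ℕ (n ∸ 2)) ∎
        where
        open import Data.Nat.Tactic.RingSolver using (solve-∀)
        exponent-aₙ : ∀ e → suc (suc e) *ℕ (suc e +ℕ suc e) ≡ 2 *ℕ suc (suc e) *ℕ suc e
        exponent-aₙ = solve-∀
        exponent-N : ∀ e → suc (suc (suc e)) *ℕ (suc e +ℕ suc e) ≡ 2 *ℕ suc (suc (suc e)) *ℕ suc e
        exponent-N = solve-∀

      pairProd-ρs : pairProd (λ x → x) ρs ≈ pairProd (fEval a) (toList s)
      pairProd-ρs = pairProd-map (λ x → x) (fEval a) (λ x → - γ x) (toList s) square
        where
        square : ∀ t u → ((- γ t) - (- γ u)) * ((- γ t) - (- γ u)) ≈ (fEval a t - fEval a u) * (fEval a t - fEval a u)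
        square t u = begin
          ((- γ t) - (- γ u)) * ((- γ t) - (- γ u))
            ≈⟨ solve 3
                 (λ a₀ g h → ((:- g) :- (:- h)) :* ((:- g) :- (:- h)) := ((a₀ :+ g) :- (a₀ :+ h)) :* ((a₀ :+ g) :- (a₀ :+ h)))
                 refl (fCoeff a 0) (γ t) (γ u) ⟩
          ((fCoeff a 0 + γ t) - (fCoeff a 0 + γ u)) * ((fCoeff a 0 + γ t) - (fCoeff a 0 + γ u))
            ≈⟨ sym (*-cong (+-cong (f≈a₀+γ t) (-‿cong (f≈a₀+γ u))) (+-cong (f≈a₀+γ t) (-‿cong (f≈a₀+γ u)))) ⟩
          (fEval a t - fEval a u) * (fEval a t - fEval a u) ∎

    DD0≈ : DD0 n a ≈ pow N (2 *ℕ n *ℕ (n ∸ 2)) * pow aₙ (2 *ℕ (n ∸ 1) *ℕ (n ∸ 2)) * pairProd (fEval a) (toList s)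
    DD0≈ = begin
      DD0 n a                                  ≈⟨ disc-splitPolynomial e ρs ρs-length Cst D-split ⟩
      pow Cst (m +ℕ m) * pairProd (λ x → x) ρs  ≈⟨ *-cong pow-Cst pairProd-ρs ⟩
      pow N (2 *ℕ n *ℕ (n ∸ 2)) * pow aₙ (2 *ℕ (n ∸ 1) *ℕ (n ∸ 2)) * pairProd (fEval a) (toList s) ∎

lemma4p6 : ∀ {c ℓ} (K : CommutativeRing c ℓ) →
    let open CommutativeRing K
        open Lemma46 K
    in
    IsField → CharZero →
    (n : ℕ) → 2 ≤ n →
    (a : Vec Carrier (suc n)) →
    (s : Vec Carrier (n ∸ 1)) →
    -- s_1, …, s_{n-1} are the roots (with multiplicity) of f':
    -- f'(x) = n a_n ∏_j (x - s_j), coefficientwise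
    (∀ i → i < n →
      deriv (fCoeff a) i ≈ nat· n (lookup a (fromℕ n)) * coeffL (rootPoly (toList s)) i) →
    DD0 n a ≈
      pow (nat· n 1#) (2 *ℕ n *ℕ (n ∸ 2))
      * pow (lookup a (fromℕ n)) (2 *ℕ (n ∸ 1) *ℕ (n ∸ 2))
      * pairProd (fEval a) (toList s)
lemma4p6 K isField charZero zero () a s f′-split
lemma4p6 K isField charZero (suc zero) (s≤s ()) a s f′-split
-- For n = 2, D is linear in a₀ and both sides are 1.
lemma4p6 K isField charZero (suc (suc zero)) _ a (_ ∷ []) _ =
  sym (trans (*-cong (*-identityˡ 1#) (*-identityˡ 1#)) (*-identityˡ 1#))
  where open CommutativeRing K
lemma4p6 K isField charZero (suc (suc (suc e))) _ a s f′-split =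
  ProofOfLemma46.Formula.DD0≈ K isField charZero e a s f′-split
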